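{- Let $V\in\mathbb{R}^{r\times n}$ be a vector configuration in general position. Then $$f^*_V(x,y)=(x+y+1)^n-(-1)^rx^n-(x+1)^nf_V\!\left(-\tfrac{x}{x+1},\tfrac{x+y}{x+1}\right)$$ and $$f_V(x,y)=(x+y+1)^n-(-1)^{n-r}x^n-(x+1)^nf^*_V\!\left(-\tfrac{x}{x+1},\tfrac{x+y}{x+1}\right).$$
   Context: $V=[v_1|\dots|v_n]$, general position: any $r$ columns linearly independent. For a sign vector $F$, $F_0,F_-$ are the coordinate sets where $F$ is $0$, $-1$. $\mathcal F(V)$ is the set of sign vectors $(\operatorname{sgn}\langle v_1,u\rangle,\dots,\operatorname{sgn}\langle v_n,u\rangle)$ for nonzero $u\in\mathbb{R}^r$, and $f_V(x,y)=\sum_{F\in\mathcal F(V)}x^{|F_0|}y^{|F_-|}$. $\mathcal F^*(V)$ is the set of sign vectors $(\operatorname{sgn}\lambda_1,\dots,\operatorname{sgn}\lambda_n)$ of nontrivial linear dependencies $\sum\lambda_iv_i=0$, and $f^*_V(x,y)=\sum_{F\in\mathcal F^*(V)}x^{|F_0|}y^{|F_-|}$. -}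

module Defs where

open import Level using (Level; _⊔_) renaming (suc to lsuc)
open import Algebra.Bundles using (CommutativeRing)
open import Relation.Binary.Structures using (IsStrictTotalOrder)
open import Relation.Binary.Definitions using (Tri; tri<; tri≈; tri>)
open import Relation.Nullary using (¬_)
open import Data.Nat as ℕ using (ℕ; zero; suc)
open import Data.Fin using (Fin; zero; suc)
open import Data.Vec using (Vec; []; _∷_; lookup)
open import Data.List using (List; []; _∷_)
open import Data.List.Membership.Propositional using (_∈_)
open import Data.List.Relation.Unary.Unique.Propositional using (Unique)
open import Data.Product using (Σ; ∃; _×_)
open import Function.Bundles using (_⇔_)
open import Relation.Binary.PropositionalEquality using (_≡_)

-- An ordered field (the paper uses ℝ).
record OrderedField (c ℓ₁ ℓ₂ : Level) : Set (lsuc (c ⊔ ℓ₁ ⊔ ℓ₂)) where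
  field
    commutativeRing : CommutativeRing c ℓ₁
  open CommutativeRing commutativeRing public
  field
    _<_                : Carrier → Carrier → Set ℓ₂
    isStrictTotalOrder : IsStrictTotalOrder _≈_ _<_
    +-monoˡ-<          : ∀ {a b} z → a < b → (a + z) < (b + z)
    *-pos              : ∀ {a b} → 0# < a → 0# < b → 0# < (a * b)
    0≉1                : ¬ (0# ≈ 1#)
    inverse            : ∀ x → ¬ (x ≈ 0#) → ∃ λ y → (x * y) ≈ 1#

data Sign : Set where
  neg zer pos : Sign

count : Sign → ∀ {n} → Vec Sign n → ℕ
count s [] = 0
count neg (neg ∷ F) = suc (count neg F)
count zer (zer ∷ F) = suc (count zer F)
count pos (pos ∷ F) = suc (count pos F)
count s (_ ∷ F) = count s F

Enumerates : ∀ {p n} → (Vec Sign n → Set p) → List (Vec Sign n) → Set p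
Enumerates P L = Unique L × (∀ F → (F ∈ L) ⇔ P F)

module _ {c ℓ₁ ℓ₂} (K : OrderedField c ℓ₁ ℓ₂) where
  open OrderedField K using (Carrier; _≈_; _+_; _*_; 0#; 1#; isStrictTotalOrder)

  sgn : Carrier → Sign
  sgn x with IsStrictTotalOrder.compare isStrictTotalOrder x 0#
  ... | tri< _ _ _ = neg
  ... | tri≈ _ _ _ = zer
  ... | tri> _ _ _ = pos

  ∑ : ∀ {k} → (Fin k → Carrier) → Carrier
  ∑ {zero} f = 0#
  ∑ {suc k} f = f zero + ∑ (λ i → f (suc i))

  pow : Carrier → ℕ → Carrier
  pow x zero = 1#
  pow x (suc m) = x * pow x m

  -- an r×n matrix; column j is the vector v_j ∈ K^r
  Matrix : ℕ → ℕ → Set c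
  Matrix r n = Fin r → Fin n → Carrier

  signVec : ∀ {n} → (Fin n → Carrier) → Vec Sign n
  signVec {zero} f = []
  signVec {suc n} f = sgn (f zero) ∷ signVec (λ j → f (suc j))

  -- general position: any r columns are linearly independent
  GeneralPosition : ∀ {r n} → Matrix r n → Set (c ⊔ ℓ₁)
  GeneralPosition {r} {n} V =
    (σ : Fin r → Fin n) → (∀ {k l} → σ k ≡ σ l → k ≡ l) →
    (μ : Fin r → Carrier) →
    (∀ i → ∑ (λ k → V i (σ k) * μ k) ≈ 0#) → ∀ k → μ k ≈ 0#

  -- F ∈ 𝓕(V): F is the sign vector (sgn⟨v_j,u⟩)_j for some nonzero u
  Covector : ∀ {r n} → Matrix r n → Vec Sign n → Set (c ⊔ ℓ₁)
  Covector {r} {n} V F =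
    Σ (Fin r → Carrier) λ u → (∃ λ i → ¬ (u i ≈ 0#)) ×
      (signVec (λ j → ∑ (λ i → V i j * u i)) ≡ F)

  -- F ∈ 𝓕*(V): F is the sign vector of a nontrivial dependency λ
  Dependency : ∀ {r n} → Matrix r n → Vec Sign n → Set (c ⊔ ℓ₁)
  Dependency {r} {n} V F =
    Σ (Fin n → Carrier) λ μ → (∃ λ j → ¬ (μ j ≈ 0#)) ×
      (∀ i → ∑ (λ j → V i j * μ j) ≈ 0#) × (signVec μ ≡ F)

  genPoly : ∀ {n} → List (Vec Sign n) → Carrier → Carrier → Carrier
  genPoly [] x y = 0#
  genPoly (F ∷ L) x y = pow x (count zer F) * pow y (count neg F) + genPoly L x y

{-# OPTIONS --safe #-}

-- Everything reduces to one identity per sign vector G,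
--   [G ∈ 𝓕*(V)] = 1 - (-1)^r [G = 0] - χ(G),   χ(G) = ∑ { (-1)^|F₀| : F ∈ 𝓕(V), G ⊑ F },
-- where G ⊑ F means that F agrees with G on supp G. Multiplying by x^|G₀| y^|G₋| and summing over G gives
-- the first formula, since for fixed F the sum over G ⊑ F factors coordinatewise into (x + 1)^n x′^|F₀| y′^|F₋|
-- with x′ = -x/(x + 1) and y′ = (x + y)/(x + 1);
-- the substitution (x, y) ↦ (x′, y′) is an involution, which gives the second formula.
--
-- For G ≠ 0, Gordan's alternative, sharpened by general position, says that either some u has
-- sgn ⟨v_j, u⟩ = G_j on supp G, or G itself is the sign vector of a dependency. Sweeping the coordinates one
-- at a time shows that χ(G) is 1 in the first case and 0 in the second: refining the cells by the sign at a
-- new coordinate keeps the alternating count, because a zero refinement forces both signed ones, except for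
-- cells split into exactly two signed pieces. By general position that only happens for G = 0, when the r-th
-- coordinate is reached, so χ(0) = 1 - (-1)^r.
module Submission where

open import Defs
open import Data.Nat using (ℕ; _≤_; _∸_)
open import Data.Vec using (Vec)
open import Data.List using (List)
open import Data.Product using (_×_; _,_; proj₁)
open import Algebra.Bundles using (CommutativeRing)

module ℤ-RingSolver {a ℓ} (R : CommutativeRing a ℓ) where

  open import Data.Nat.Base as ℕ using (ℕ; zero; suc)
  open import Data.Integer.Base as ℤ using (ℤ; +_; -[1+_]; _⊖_; _◃_; sign; ∣_∣)
  import Data.Integer.Properties as ℤ
  import Data.Sign.Base as Sign
  open import Data.Maybe.Base using (Maybe; just; nothing)
  open import Relation.Nullary.Decidable.Core using (yes; no)
  import Relation.Binary.PropositionalEquality.Core as ≡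
  open import Algebra.Solver.Ring.AlmostCommutativeRing
    using (fromCommutativeRing; _-Raw-AlmostCommutative⟶_)
  import Algebra.Solver.Ring as RingSolver

  open CommutativeRing R
  open import Algebra.Properties.Ring ring
    using (-‿distribˡ-*; -‿involutive; -‿+-comm; -0#≈0#)
  open import Algebra.Properties.Semiring.Mult.TCOptimised semiring
    using (1+×; ×-homo-+; ×1-homo-*) renaming (_×_ to _×′_)
  open import Algebra.Properties.CommutativeSemigroup +-commutativeSemigroup
    using () renaming (interchange to +-interchange)
  open import Algebra.Properties.CommutativeSemigroup *-commutativeSemigroup
    using () renaming (interchange to *-interchange)
  open import Relation.Binary.Reasoning.Setoid setoid

  ι : ℤ → Carrier
  ι (+ n) = n ×′ 1#
  ι -[1+ n ] = - (suc n ×′ 1#)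

  ι-neg : ∀ i → ι (ℤ.- i) ≈ - ι i
  ι-neg -[1+ n ] = sym (-‿involutive _)
  ι-neg (+ zero) = sym -0#≈0#
  ι-neg (+ suc n) = refl

  ι-⊖ : ∀ m n → ι (m ⊖ n) ≈ m ×′ 1# - n ×′ 1#
  ι-⊖ m zero = sym (trans (+-congˡ -0#≈0#) (+-identityʳ _))
  ι-⊖ zero (suc n) = sym (+-identityˡ _)
  ι-⊖ (suc m) (suc n) = begin
    ι (suc m ⊖ suc n)                  ≡⟨ ≡.cong ι (ℤ.[1+m]⊖[1+n]≡m⊖n m n) ⟩
    ι (m ⊖ n)                          ≈⟨ ι-⊖ m n ⟩
    m ×′ 1# - n ×′ 1#                    ≈⟨ +-identityˡ _ ⟨
    0# + (m ×′ 1# - n ×′ 1#)             ≈⟨ +-congʳ (-‿inverseʳ 1#) ⟨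
    (1# - 1#) + (m ×′ 1# - n ×′ 1#)      ≈⟨ +-interchange _ _ _ _ ⟩
    (1# + m ×′ 1#) + (- 1# - n ×′ 1#)    ≈⟨ +-congˡ (-‿+-comm 1# _) ⟩
    (1# + m ×′ 1#) - (1# + n ×′ 1#)      ≈⟨ +-cong (1+× m 1#) (-‿cong (1+× n 1#)) ⟨
    suc m ×′ 1# - suc n ×′ 1#            ∎

  ι-+ : ∀ i j → ι (i ℤ.+ j) ≈ ι i + ι j
  ι-+ (+ m) (+ n) = ×-homo-+ 1# m n
  ι-+ (+ m) -[1+ n ] = ι-⊖ m (suc n)
  ι-+ -[1+ m ] (+ n) = trans (ι-⊖ n (suc m)) (+-comm _ _)
  ι-+ -[1+ m ] -[1+ n ] = begin
    - (suc (suc (m ℕ.+ n)) ×′ 1#)       ≈⟨ -‿cong (1+× (suc (m ℕ.+ n)) 1#) ⟩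
    - (1# + suc (m ℕ.+ n) ×′ 1#)        ≈⟨ -‿cong (+-congˡ (×-homo-+ 1# (suc m) n)) ⟩
    - (1# + (suc m ×′ 1# + n ×′ 1#))     ≈⟨ -‿cong (x∙yz≈y∙xz 1# _ _) ⟩
    - (suc m ×′ 1# + (1# + n ×′ 1#))     ≈⟨ -‿cong (+-congˡ (1+× n 1#)) ⟨
    - (suc m ×′ 1# + suc n ×′ 1#)        ≈⟨ -‿+-comm _ _ ⟨
    - (suc m ×′ 1#) - suc n ×′ 1#        ∎
    where open import Algebra.Properties.CommutativeSemigroup +-commutativeSemigroup
            using (x∙yz≈y∙xz)

  signValue : Sign.Sign → Carrier
  signValue Sign.+ = 1#
  signValue Sign.- = - 1#

  ι-◃ : ∀ s n → ι (s ◃ n) ≈ signValue s * (n ×′ 1#)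
  ι-◃ s zero = sym (zeroʳ _)
  ι-◃ Sign.+ (suc n) = sym (*-identityˡ _)
  ι-◃ Sign.- (suc n) = trans (-‿cong (sym (*-identityˡ _))) (-‿distribˡ-* 1# _)

  ι-sign-abs : ∀ i → ι i ≈ signValue (sign i) * (∣ i ∣ ×′ 1#)
  ι-sign-abs (+ n) = sym (*-identityˡ _)
  ι-sign-abs -[1+ n ] = ι-◃ Sign.- (suc n)

  signValue-* : ∀ s t → signValue (s Sign.* t) ≈ signValue s * signValue t
  signValue-* Sign.+ t = sym (*-identityˡ _)
  signValue-* Sign.- Sign.+ = sym (*-identityʳ _)
  signValue-* Sign.- Sign.- = begin
    1#                ≈⟨ -‿involutive 1# ⟨
    - - 1#            ≈⟨ -‿cong (*-identityˡ _) ⟨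
    - (1# * - 1#)     ≈⟨ -‿distribˡ-* 1# (- 1#) ⟩
    - 1# * - 1#       ∎

  ι-* : ∀ i j → ι (i ℤ.* j) ≈ ι i * ι j
  ι-* i j = begin
    ι (i ℤ.* j)
      ≈⟨ ι-◃ (sign i Sign.* sign j) (∣ i ∣ ℕ.* ∣ j ∣) ⟩
    signValue (sign i Sign.* sign j) * ((∣ i ∣ ℕ.* ∣ j ∣) ×′ 1#)
      ≈⟨ *-cong (signValue-* (sign i) (sign j)) (×1-homo-* ∣ i ∣ ∣ j ∣) ⟩
    (signValue (sign i) * signValue (sign j)) * ((∣ i ∣ ×′ 1#) * (∣ j ∣ ×′ 1#))
      ≈⟨ *-interchange _ _ _ _ ⟩
    (signValue (sign i) * (∣ i ∣ ×′ 1#)) * (signValue (sign j) * (∣ j ∣ ×′ 1#))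
      ≈⟨ *-cong (ι-sign-abs i) (ι-sign-abs j) ⟨
    ι i * ι j ∎

  ι-homomorphism : ℤ.+-*-rawRing -Raw-AlmostCommutative⟶ fromCommutativeRing R
  ι-homomorphism = record
    { ⟦_⟧ = ι
    ; +-homo = ι-+
    ; *-homo = ι-*
    ; -‿homo = ι-neg
    ; 0-homo = refl
    ; 1-homo = refl
    }

  ι-equal? : ∀ i j → Maybe (ι i ≈ ι j)
  ι-equal? i j with i ℤ.≟ j
  ... | yes i≡j = just (reflexive (≡.cong ι i≡j))
  ... | no _ = nothing

  open RingSolver ℤ.+-*-rawRing (fromCommutativeRing R) ι-homomorphism ι-equal? public

module BooleanSubsets where

  open import Data.Nat.Base as ℕ using (ℕ; zero; suc; _≤_; _<_; z≤n; s≤s; _+_)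
  import Data.Nat.Properties as ℕ
  open import Data.Fin.Base using (Fin; zero; suc; fromℕ<)
  open import Data.Fin.Properties using (_≟_; suc-injective)
  open import Data.Bool.Base using (Bool; true; false; _∧_; _∨_; not)
  open import Data.Bool.Properties using (not-¬; ∧-identityʳ; ∨-identityʳ)
  open import Data.Product.Base using (∃; _×_; _,_)
  open import Data.Sum.Base using (_⊎_; inj₁; inj₂)
  open import Data.Empty using (⊥-elim)
  open import Relation.Nullary.Decidable.Core using (yes; no; does)
  open import Relation.Binary.PropositionalEquality.Core
    using (_≡_; _≢_; refl; sym; trans; cong; cong₂)

  ∧-≡-trueˡ : ∀ {a b} → a ∧ b ≡ true → a ≡ true
  ∧-≡-trueˡ {true} _ = refl

  ∧-≡-trueʳ : ∀ {a b} → a ∧ b ≡ true → b ≡ true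
  ∧-≡-trueʳ {true} h = h

  ∨-≡-trueˡ : ∀ {a} b → a ≡ true → a ∨ b ≡ true
  ∨-≡-trueˡ b refl = refl

  ∨-≡-trueʳ : ∀ a {b} → b ≡ true → a ∨ b ≡ true
  ∨-≡-trueʳ true _ = refl
  ∨-≡-trueʳ false h = h

  not-≡-true : ∀ {a} → not a ≡ true → a ≡ false
  not-≡-true {false} _ = refl

  Subset : ℕ → Set
  Subset n = Fin n → Bool

  indicator : Bool → ℕ
  indicator true = 1
  indicator false = 0

  ∣_∣ : ∀ {n} → Subset n → ℕ
  ∣_∣ {zero} J = 0
  ∣_∣ {suc n} J = indicator (J zero) + ∣ (λ j → J (suc j)) ∣

  _⊆_ : ∀ {n} → Subset n → Subset n → Set
  J ⊆ J′ = ∀ j → J j ≡ true → J′ j ≡ true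

  ⁅_⁆ : ∀ {n} → Fin n → Subset n
  ⁅ p ⁆ j = does (j ≟ p)

  _∖_ : ∀ {n} → Subset n → Fin n → Subset n
  (J ∖ p) j = J j ∧ not (⁅ p ⁆ j)

  ⁅p⁆p : ∀ {n} (p : Fin n) → ⁅ p ⁆ p ≡ true
  ⁅p⁆p p with p ≟ p
  ... | yes _ = refl
  ... | no p≢p = ⊥-elim (p≢p refl)

  ⁅p⁆j : ∀ {n} {p j : Fin n} → j ≢ p → ⁅ p ⁆ j ≡ false
  ⁅p⁆j {p = p} {j} j≢p with j ≟ p
  ... | yes j≡p = ⊥-elim (j≢p j≡p)
  ... | no _ = refl

  ∖-⊆ : ∀ {n} (J : Subset n) p → (J ∖ p) ⊆ J
  ∖-⊆ J p j h with J j
  ... | true = refl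
  ... | false = h

  ∖-removes : ∀ {n} (J : Subset n) p → (J ∖ p) p ≡ false
  ∖-removes J p rewrite ⁅p⁆p p with J p
  ... | true = refl
  ... | false = refl

  ∖-keeps : ∀ {n} (J : Subset n) {p j} → j ≢ p → (J ∖ p) j ≡ J j
  ∖-keeps J {p} {j} j≢p rewrite ⁅p⁆j j≢p = ∧-identityʳ (J j)

  ∖-outside : ∀ {n} (J : Subset n) p j → J j ≡ false → (J ∖ p) j ≡ false
  ∖-outside J p j Jj rewrite Jj = refl

  nonempty? : ∀ {n} (J : Subset n) → (∃ λ j → J j ≡ true) ⊎ (∀ j → J j ≡ false)
  nonempty? {zero} J = inj₂ (λ ())
  nonempty? {suc n} J with J zero in eq | nonempty? (λ j → J (suc j))
  ... | true  | _ = inj₁ (zero , eq)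
  ... | false | inj₁ (j , h) = inj₁ (suc j , h)
  ... | false | inj₂ h = inj₂ (λ { zero → eq ; (suc j) → h j })

  ∣∣-cong : ∀ {n} {J J′ : Subset n} → (∀ j → J j ≡ J′ j) → ∣ J ∣ ≡ ∣ J′ ∣
  ∣∣-cong {zero} h = refl
  ∣∣-cong {suc n} h = cong₂ _+_ (cong indicator (h zero)) (∣∣-cong (λ j → h (suc j)))

  ∣∅∣ : ∀ {n} (J : Subset n) → (∀ j → J j ≡ false) → ∣ J ∣ ≡ 0
  ∣∅∣ {zero} J h = refl
  ∣∅∣ {suc n} J h rewrite h zero = ∣∅∣ (λ j → J (suc j)) (λ j → h (suc j))

  ∣J∣≡0⇒J≡∅ : ∀ {n} (J : Subset n) → ∣ J ∣ ≡ 0 → ∀ j → J j ≡ false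
  ∣J∣≡0⇒J≡∅ {suc n} J e j with J zero in eq
  ∣J∣≡0⇒J≡∅ {suc n} J e zero | false = eq
  ∣J∣≡0⇒J≡∅ {suc n} J e (suc j) | false = ∣J∣≡0⇒J≡∅ (λ j → J (suc j)) e j

  ∣J∣≡1+n⇒nonempty : ∀ {n k} (J : Subset n) → ∣ J ∣ ≡ suc k → ∃ λ j → J j ≡ true
  ∣J∣≡1+n⇒nonempty J e with nonempty? J
  ... | inj₁ j = j
  ... | inj₂ empty = ⊥-elim (ℕ.1+n≢0 (trans (sym e) (∣∅∣ J empty)))

  ∣J∖p∣ : ∀ {n} (J : Subset n) p → J p ≡ true → ∣ J ∣ ≡ suc ∣ J ∖ p ∣
  ∣J∖p∣ {suc n} J zero Jp rewrite Jp =
    cong suc (∣∣-cong (λ j → sym (∧-identityʳ (J (suc j)))))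
  ∣J∖p∣ {suc n} J (suc p) Jp rewrite ∧-identityʳ (J zero) | ∣J∖p∣ (λ j → J (suc j)) p Jp =
    ℕ.+-suc (indicator (J zero)) _

  ∣∪⁅p⁆∣ : ∀ {n} (J : Subset n) p → J p ≡ false → ∣ (λ j → J j ∨ ⁅ p ⁆ j) ∣ ≡ suc ∣ J ∣
  ∣∪⁅p⁆∣ J p Jp = trans (∣J∖p∣ J⁺ p J⁺p) (cong suc (∣∣-cong J⁺∖p≡J))
    where
    J⁺ : Subset _
    J⁺ j = J j ∨ ⁅ p ⁆ j
    J⁺p : J⁺ p ≡ true
    J⁺p rewrite Jp = ⁅p⁆p p
    J⁺∖p≡J : ∀ j → (J⁺ ∖ p) j ≡ J j
    J⁺∖p≡J j with j ≟ p
    ... | yes refl rewrite Jp = refl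
    ... | no _ rewrite ∨-identityʳ (J j) = ∧-identityʳ (J j)

  ∣∣-mono : ∀ {n} {J J′ : Subset n} → J ⊆ J′ → ∣ J ∣ ≤ ∣ J′ ∣
  ∣∣-mono {zero} h = z≤n
  ∣∣-mono {suc n} {J} {J′} h with J zero in e₁ | J′ zero in e₂
  ... | true  | true  = s≤s (∣∣-mono (λ j → h (suc j)))
  ... | true  | false = ⊥-elim (not-¬ (h zero e₁) e₂)
  ... | false | true  = ℕ.m≤n⇒m≤1+n (∣∣-mono (λ j → h (suc j)))
  ... | false | false = ∣∣-mono (λ j → h (suc j))

  ∣J∣≤n : ∀ {n} (J : Subset n) → ∣ J ∣ ≤ n
  ∣J∣≤n {zero} J = z≤n
  ∣J∣≤n {suc n} J with J zero
  ... | true  = s≤s (∣J∣≤n _)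
  ... | false = ℕ.m≤n⇒m≤1+n (∣J∣≤n _)

  superset-of-size : ∀ {n} (J : Subset n) k → ∣ J ∣ ≤ k → k ≤ n →
                     ∃ λ J′ → J ⊆ J′ × ∣ J′ ∣ ≡ k
  superset-of-size {zero} J zero _ _ = J , (λ _ h → h) , refl
  superset-of-size {suc n} J k J≤k k≤n with J zero in e
  superset-of-size {suc n} J (suc k) (s≤s J≤k) (s≤s k≤n) | true
    with superset-of-size (λ j → J (suc j)) k J≤k k≤n
  ... | J′ , J⊆J′ , ∣J′∣ =
    (λ { zero → true ; (suc j) → J′ j }) , (λ { zero _ → refl ; (suc j) → J⊆J′ j }) , cong suc ∣J′∣
  superset-of-size {suc n} J k J≤k k≤1+n | false with k ℕ.≤? n
  ... | yes k≤n with superset-of-size (λ j → J (suc j)) k J≤k k≤n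
  ... | J′ , J⊆J′ , ∣J′∣ =
    (λ { zero → false ; (suc j) → J′ j }) ,
    (λ { zero h → ⊥-elim (not-¬ h e) ; (suc j) → J⊆J′ j }) , ∣J′∣
  superset-of-size {suc n} J k J≤k k≤1+n | false | no k≰n
    with ℕ.≤-antisym k≤1+n (ℕ.≰⇒> k≰n)
  ... | refl with superset-of-size (λ j → J (suc j)) n (∣J∣≤n _) ℕ.≤-refl
  ... | J′ , J⊆J′ , ∣J′∣ =
    (λ { zero → true ; (suc j) → J′ j }) , (λ { zero _ → refl ; (suc j) → J⊆J′ j }) , cong suc ∣J′∣

  subset-of-size : ∀ {n} (J : Subset n) k → k ≤ ∣ J ∣ → ∃ λ R → R ⊆ J × ∣ R ∣ ≡ k
  subset-of-size {zero} J zero _ = J , (λ _ h → h) , refl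
  subset-of-size {suc n} J k k≤J with J zero in e
  subset-of-size {suc n} J zero _ | true =
    (λ _ → false) , (λ _ ()) , ∣∅∣ {suc n} (λ _ → false) (λ _ → refl)
  subset-of-size {suc n} J (suc k) (s≤s k≤J) | true with subset-of-size (λ j → J (suc j)) k k≤J
  ... | R , R⊆J , ∣R∣ =
    (λ { zero → true ; (suc j) → R j }) , (λ { zero _ → e ; (suc j) → R⊆J j }) , cong suc ∣R∣
  subset-of-size {suc n} J k k≤J | false with subset-of-size (λ j → J (suc j)) k k≤J
  ... | R , R⊆J , ∣R∣ =
    (λ { zero → false ; (suc j) → R j }) , (λ { zero () ; (suc j) → R⊆J j }) , ∣R∣

  full : ∀ {n} → Subset n
  full _ = true

  ∣full∣ : ∀ {n} → ∣ full {n} ∣ ≡ n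
  ∣full∣ {zero} = refl
  ∣full∣ {suc n} = cong suc (∣full∣ {n})

  prefix : ∀ {n} → ℕ → Subset n
  prefix zero j = false
  prefix (suc k) zero = true
  prefix (suc k) (suc j) = prefix k j

  ∣prefix∣ : ∀ {n} k → k ≤ n → ∣ prefix {n} k ∣ ≡ k
  ∣prefix∣ {n} zero _ = ∣∅∣ (prefix {n} 0) (λ _ → refl)
  ∣prefix∣ {suc n} (suc k) (s≤s k≤n) = cong suc (∣prefix∣ k k≤n)

  prefix-last : ∀ {n} m (m<n : m < n) → prefix (suc m) (fromℕ< m<n) ≡ true
  prefix-last {suc n} zero _ = refl
  prefix-last {suc n} (suc m) (s≤s m<n) = prefix-last m m<n

  prefix-next : ∀ {n} m (m<n : m < n) → prefix m (fromℕ< m<n) ≡ false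
  prefix-next {suc n} zero _ = refl
  prefix-next {suc n} (suc m) (s≤s m<n) = prefix-next m m<n

  prefix-other : ∀ {n} m (m<n : m < n) {j} → j ≢ fromℕ< m<n → prefix (suc m) j ≡ prefix m j
  prefix-other {suc n} zero _ {zero} j≢0 = ⊥-elim (j≢0 refl)
  prefix-other {suc n} zero _ {suc j} _ = refl
  prefix-other {suc n} (suc m) (s≤s m<n) {zero} _ = refl
  prefix-other {suc n} (suc m) (s≤s m<n) {suc j} j≢e = prefix-other m m<n (λ e → j≢e (cong suc e))

  enumerate : ∀ {n} (J : Subset n) → Fin ∣ J ∣ → Fin n
  enumerate-from : ∀ {n} b (J : Subset n) → Fin (indicator b + ∣ J ∣) → Fin (suc n)

  enumerate {suc n} J = enumerate-from (J zero) (λ j → J (suc j))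

  enumerate-from true J zero = zero
  enumerate-from true J (suc k) = suc (enumerate J k)
  enumerate-from false J k = suc (enumerate J k)

  enumerate-injective : ∀ {n} (J : Subset n) {k k′} → enumerate J k ≡ enumerate J k′ → k ≡ k′
  enumerate-injective {suc n} J = injective (J zero)
    where
    J⁺ : Subset n
    J⁺ j = J (suc j)
    injective : ∀ b {k k′} → enumerate-from b J⁺ k ≡ enumerate-from b J⁺ k′ → k ≡ k′
    injective true {zero} {zero} _ = refl
    injective true {suc k} {suc k′} e = cong suc (enumerate-injective J⁺ (suc-injective e))
    injective false e = enumerate-injective J⁺ (suc-injective e)

  enumerate-surjective : ∀ {n} (J : Subset n) j → J j ≡ true → ∃ λ k → enumerate J k ≡ j
  enumerate-surjective {suc n} J = surjective (J zero) refl
    where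
    J⁺ : Subset n
    J⁺ j = J (suc j)
    surjective : ∀ b → J zero ≡ b → ∀ j → J j ≡ true → ∃ λ k → enumerate-from b J⁺ k ≡ j
    surjective true _ zero _ = zero , refl
    surjective false e zero Jj = ⊥-elim (not-¬ Jj e)
    surjective true _ (suc j) Jj with enumerate-surjective J⁺ j Jj
    ... | k , eq = suc k , cong suc eq
    surjective false _ (suc j) Jj with enumerate-surjective J⁺ j Jj
    ... | k , eq = k , cong suc eq

module OrderedFieldProperties {c ℓ₁ ℓ₂} (K : OrderedField c ℓ₁ ℓ₂) where

  open import Level using (_⊔_)
  open import Data.Nat.Base using (zero; suc)
  open import Data.Fin.Base using (Fin; zero; suc)
  open import Data.Integer.Base using (+_; -[1+_])
  open import Data.Bool.Base using (Bool; true; false)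
  open import Data.Product.Base using (∃; _×_; _,_; proj₁; proj₂)
  open import Data.Sum.Base using (_⊎_; inj₁; inj₂)
  open import Data.Empty using (⊥-elim)
  open import Relation.Nullary.Negation.Core using (¬_)
  open import Relation.Nullary.Decidable.Core using (yes; no)
  open import Relation.Binary.Definitions using (tri<; tri≈; tri>)
  open import Relation.Binary.Structures using (IsStrictTotalOrder)
  open import Relation.Binary.PropositionalEquality.Core as ≡ using (_≡_)
  open import Data.Bool.Properties using (not-¬)

  open OrderedField K public hiding (zero)
  open IsStrictTotalOrder isStrictTotalOrder public
    using (compare; <-respʳ-≈; <-respˡ-≈)
    renaming (_≟_ to _≈?_; trans to <-trans; irrefl to <-irrefl; asym to <-asym)

  open ℤ-RingSolver commutativeRing public using (solve; _:=_; _:+_; _:*_; :-_; _:-_; con)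
  open import Relation.Binary.Reasoning.Setoid setoid public
  open import Algebra.Properties.Ring ring public using (-0#≈0#)

  :0 :1 :-1 : ∀ {k} → ℤ-RingSolver.Polynomial commutativeRing k
  :0 = con (+ 0)
  :1 = con (+ 1)
  :-1 = con -[1+ 0 ]

  Positive : Carrier → Set ℓ₂
  Positive x = 0# < x

  NonNegative : Carrier → Set (ℓ₁ ⊔ ℓ₂)
  NonNegative x = Positive x ⊎ (x ≈ 0#)

  <-resp-≈ : ∀ {a b a′ b′} → a ≈ a′ → b ≈ b′ → a < b → a′ < b′
  <-resp-≈ a≈a′ b≈b′ a<b = <-respʳ-≈ b≈b′ (<-respˡ-≈ a≈a′ a<b)

  pos-resp-≈ : ∀ {a b} → a ≈ b → Positive a → Positive b
  pos-resp-≈ = <-respʳ-≈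

  pos+pos : ∀ {a b} → Positive a → Positive b → Positive (a + b)
  pos+pos {a} {b} 0<a 0<b =
    <-trans 0<a (<-resp-≈ (+-identityˡ a) (+-comm b a) (+-monoˡ-< a 0<b))

  pos⇒< : ∀ {a b} → Positive (b - a) → a < b
  pos⇒< {a} {b} h =
    <-resp-≈ (+-identityˡ a) (solve 2 (λ a b → b :- a :+ a := b) refl a b) (+-monoˡ-< a h)

  neg⇒-pos : ∀ {a} → a < 0# → Positive (- a)
  neg⇒-pos {a} a<0 =
    <-resp-≈ (-‿inverseʳ a) (solve 1 (λ a → :0 :- a := :- a) refl a) (+-monoˡ-< (- a) a<0)

  -pos⇒neg : ∀ {a} → Positive (- a) → a < 0#
  -pos⇒neg {a} h = pos⇒< (pos-resp-≈ (solve 1 (λ a → :- a := :0 :- a) refl a) h)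

  pos⇒-neg : ∀ {a} → Positive a → (- a) < 0#
  pos⇒-neg {a} h = -pos⇒neg (pos-resp-≈ (solve 1 (λ a → a := :- (:- a)) refl a) h)

  pos⇒≉0 : ∀ {a} → Positive a → ¬ (a ≈ 0#)
  pos⇒≉0 0<a a≈0 = <-irrefl (sym a≈0) 0<a

  neg⇒≉0 : ∀ {a} → a < 0# → ¬ (a ≈ 0#)
  neg⇒≉0 a<0 a≈0 = <-irrefl a≈0 a<0

  ≉0⇒neg⊎pos : ∀ {a} → ¬ (a ≈ 0#) → (a < 0#) ⊎ Positive a
  ≉0⇒neg⊎pos {a} a≉0 with compare a 0#
  ... | tri< a<0 _ _ = inj₁ a<0
  ... | tri≈ _ a≈0 _ = ⊥-elim (a≉0 a≈0)
  ... | tri> _ _ 0<a = inj₂ 0<a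

  nonNeg⊎neg : ∀ a → NonNegative a ⊎ (a < 0#)
  nonNeg⊎neg a with compare a 0#
  ... | tri< a<0 _ _ = inj₂ a<0
  ... | tri≈ _ a≈0 _ = inj₁ (inj₂ a≈0)
  ... | tri> _ _ 0<a = inj₁ (inj₁ 0<a)

  pos*neg : ∀ {a b} → Positive a → b < 0# → (a * b) < 0#
  pos*neg {a} {b} 0<a b<0 =
    -pos⇒neg (pos-resp-≈ (solve 2 (λ a b → a :* (:- b) := :- (a :* b)) refl a b)
                         (*-pos 0<a (neg⇒-pos b<0)))

  neg*neg : ∀ {a b} → a < 0# → b < 0# → Positive (a * b)
  neg*neg {a} {b} a<0 b<0 =
    pos-resp-≈ (solve 2 (λ a b → (:- a) :* (:- b) := a :* b) refl a b)
               (*-pos (neg⇒-pos a<0) (neg⇒-pos b<0))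

  -1*-1≈1 : - 1# * - 1# ≈ 1#
  -1*-1≈1 = solve 0 (:-1 :* :-1 := :1) refl

  0<1 : Positive 1#
  0<1 with compare 1# 0#
  ... | tri≈ _ 1≈0 _ = ⊥-elim (0≉1 (sym 1≈0))
  ... | tri> _ _ 0<1 = 0<1
  ... | tri< 1<0 _ _ = ⊥-elim (<-asym 1<0 (pos-resp-≈ -1*-1≈1 (*-pos (neg⇒-pos 1<0) (neg⇒-pos 1<0))))

  square-pos : ∀ {a} → ¬ (a ≈ 0#) → Positive (a * a)
  square-pos a≉0 with ≉0⇒neg⊎pos a≉0
  ... | inj₁ a<0 = neg*neg a<0 a<0
  ... | inj₂ 0<a = *-pos 0<a 0<a

  *-≉0 : ∀ {a b} → ¬ (a ≈ 0#) → ¬ (b ≈ 0#) → ¬ (a * b ≈ 0#)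
  *-≉0 a≉0 b≉0 with ≉0⇒neg⊎pos a≉0 | ≉0⇒neg⊎pos b≉0
  ... | inj₁ a<0 | inj₁ b<0 = pos⇒≉0 (neg*neg a<0 b<0)
  ... | inj₁ a<0 | inj₂ 0<b = neg⇒≉0 (<-resp-≈ (*-comm _ _) refl (pos*neg 0<b a<0))
  ... | inj₂ 0<a | inj₁ b<0 = neg⇒≉0 (pos*neg 0<a b<0)
  ... | inj₂ 0<a | inj₂ 0<b = pos⇒≉0 (*-pos 0<a 0<b)

  *-cancelˡ-≈0 : ∀ {a b} → ¬ (a ≈ 0#) → a * b ≈ 0# → b ≈ 0#
  *-cancelˡ-≈0 {b = b} a≉0 ab≈0 with b ≈? 0#
  ... | yes b≈0 = b≈0
  ... | no b≉0 = ⊥-elim (*-≉0 a≉0 b≉0 ab≈0)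

  pos-cancelˡ : ∀ {a b} → Positive a → Positive (a * b) → Positive b
  pos-cancelˡ {a} {b} 0<a 0<ab with compare b 0#
  ... | tri> _ _ 0<b = 0<b
  ... | tri≈ _ b≈0 _ = ⊥-elim (pos⇒≉0 0<ab (trans (*-congˡ b≈0) (zeroʳ a)))
  ... | tri< b<0 _ _ = ⊥-elim (<-asym 0<ab (pos*neg 0<a b<0))

  _⁻¹⟨_⟩ : (a : Carrier) → ¬ (a ≈ 0#) → Carrier
  a ⁻¹⟨ a≉0 ⟩ = proj₁ (inverse a a≉0)

  *-inverseʳ : ∀ a (a≉0 : ¬ (a ≈ 0#)) → a * a ⁻¹⟨ a≉0 ⟩ ≈ 1#
  *-inverseʳ a a≉0 = proj₂ (inverse a a≉0)

  inverse-pos : ∀ {a} (0<a : Positive a) → Positive (a ⁻¹⟨ pos⇒≉0 0<a ⟩)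
  inverse-pos {a} 0<a = pos-cancelˡ 0<a (pos-resp-≈ (sym (*-inverseʳ a (pos⇒≉0 0<a))) 0<1)

  nonNeg-resp-≈ : ∀ {a b} → a ≈ b → NonNegative a → NonNegative b
  nonNeg-resp-≈ a≈b (inj₁ 0<a) = inj₁ (pos-resp-≈ a≈b 0<a)
  nonNeg-resp-≈ a≈b (inj₂ a≈0) = inj₂ (trans (sym a≈b) a≈0)

  pos+nonNeg : ∀ {a b} → Positive a → NonNegative b → Positive (a + b)
  pos+nonNeg 0<a (inj₁ 0<b) = pos+pos 0<a 0<b
  pos+nonNeg {a} 0<a (inj₂ b≈0) = pos-resp-≈ (trans (sym (+-identityʳ a)) (+-congˡ (sym b≈0))) 0<a

  nonNeg+nonNeg : ∀ {a b} → NonNegative a → NonNegative b → NonNegative (a + b)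
  nonNeg+nonNeg (inj₁ 0<a) b≥0 = inj₁ (pos+nonNeg 0<a b≥0)
  nonNeg+nonNeg {a} {b} (inj₂ a≈0) b≥0 =
    nonNeg-resp-≈ (trans (sym (+-identityˡ b)) (+-congʳ (sym a≈0))) b≥0

  nonNeg*nonNeg : ∀ {a b} → NonNegative a → NonNegative b → NonNegative (a * b)
  nonNeg*nonNeg (inj₁ 0<a) (inj₁ 0<b) = inj₁ (*-pos 0<a 0<b)
  nonNeg*nonNeg {a} _ (inj₂ b≈0) = inj₂ (trans (*-congˡ b≈0) (zeroʳ a))
  nonNeg*nonNeg {b = b} (inj₂ a≈0) _ = inj₂ (trans (*-congʳ a≈0) (zeroˡ b))

  -- p + ε′ q lies between p and p + ε q.
  pos-+*-antitone : ∀ {p q ε ε′} → Positive p → Positive (p + ε * q) →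
                    NonNegative ε′ → NonNegative (ε - ε′) → Positive (p + ε′ * q)
  pos-+*-antitone {p} {q} {ε} {ε′} 0<p 0<p+εq ε′≥0 ε-ε′≥0 with nonNeg⊎neg q
  ... | inj₁ q≥0 = pos+nonNeg 0<p (nonNeg*nonNeg ε′≥0 q≥0)
  ... | inj₂ q<0 =
    pos-resp-≈ (solve 4 (λ p q ε ε′ → (p :+ ε :* q) :+ (ε :- ε′) :* (:- q) := p :+ ε′ :* q) refl p q ε ε′)
               (pos+nonNeg 0<p+εq (nonNeg*nonNeg ε-ε′≥0 (inj₁ (neg⇒-pos q<0))))

  -- For q < 0 the witness is ε = p / (p - q), giving p + ε q = p² / (p - q).
  ∃-pos-+* : ∀ {p} q → Positive p → ∃ λ ε → Positive ε × Positive (p + ε * q)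
  ∃-pos-+* {p} q 0<p with nonNeg⊎neg q
  ... | inj₁ q≥0 = 1# , 0<1 , pos+nonNeg 0<p (nonNeg-resp-≈ (sym (*-identityˡ q)) q≥0)
  ... | inj₂ q<0 = p * i , *-pos 0<p (inverse-pos 0<p-q) , pos-resp-≈ p²i≈p+piq (*-pos (*-pos 0<p (inverse-pos 0<p-q)) 0<p)
    where
    0<p-q : Positive (p - q)
    0<p-q = pos+pos 0<p (neg⇒-pos q<0)
    i = (p - q) ⁻¹⟨ pos⇒≉0 0<p-q ⟩
    p²i≈p+piq : (p * i) * p ≈ p + (p * i) * q
    p²i≈p+piq = begin
      (p * i) * p                       ≈⟨ solve 3 (λ p q i → (p :* i) :* p := p :* ((p :- q) :* i) :+ (p :* i) :* q) refl p q i ⟩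
      p * ((p - q) * i) + (p * i) * q   ≈⟨ +-congʳ (*-congˡ (*-inverseʳ (p - q) (pos⇒≉0 0<p-q))) ⟩
      p * 1# + (p * i) * q              ≈⟨ +-congʳ (*-identityʳ p) ⟩
      p + (p * i) * q                   ∎

  min-pos : ∀ {a b} → Positive a → Positive b →
            ∃ λ m → Positive m × NonNegative (a - m) × NonNegative (b - m)
  min-pos {a} {b} 0<a 0<b with nonNeg⊎neg (b - a)
  ... | inj₁ b-a≥0 = a , 0<a , inj₂ (-‿inverseʳ a) , b-a≥0
  ... | inj₂ b-a<0 =
    b , 0<b , inj₁ (pos-resp-≈ (solve 2 (λ a b → :- (b :- a) := a :- b) refl a b) (neg⇒-pos b-a<0)) ,
    inj₂ (-‿inverseʳ b)

  small-perturbation-pos : ∀ {m} (C : Fin m → Bool) (p q : Fin m → Carrier) →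
    (∀ i → C i ≡ true → Positive (p i)) →
    ∃ λ ε → Positive ε × (∀ i → C i ≡ true → Positive (p i + ε * q i))
  small-perturbation-pos {zero} C p q h = 1# , 0<1 , λ ()
  small-perturbation-pos {suc m} C p q h
    with small-perturbation-pos (λ i → C (suc i)) (λ i → p (suc i)) (λ i → q (suc i)) (λ i → h (suc i))
       | C zero in C0
  ... | ε′ , 0<ε′ , h′ | false = ε′ , 0<ε′ , λ { zero C0≡t → ⊥-elim (not-¬ C0≡t C0) ; (suc i) → h′ i }
  ... | ε′ , 0<ε′ , h′ | true with ∃-pos-+* (q zero) (h zero C0)
  ... | ε₀ , 0<ε₀ , h₀ with min-pos 0<ε₀ 0<ε′
  ... | ε , 0<ε , ε₀-ε≥0 , ε′-ε≥0 =
    ε , 0<ε , λ { zero c → pos-+*-antitone (h zero c) h₀ (inj₁ 0<ε) ε₀-ε≥0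
                ; (suc i) c → pos-+*-antitone (h (suc i) c) (h′ i c) (inj₁ 0<ε) ε′-ε≥0 }

module FiniteSums {c ℓ₁ ℓ₂} (K : OrderedField c ℓ₁ ℓ₂) where

  open import Data.Nat.Base using (zero; suc)
  open import Data.Fin.Base using (Fin; zero; suc)
  open import Data.Bool.Base using (Bool; true; false; _∧_)
  open import Data.Product.Base using (∃; _,_)
  open import Data.Sum.Base using (_⊎_; inj₁; inj₂)
  open import Data.Empty using (⊥-elim)
  open import Relation.Nullary.Negation.Core using (¬_)
  open import Relation.Nullary.Decidable.Core using (yes; no)
  open import Relation.Binary.PropositionalEquality.Core as ≡ using (_≡_; _≢_)

  open OrderedFieldProperties K
  open BooleanSubsets

  𝟙 : Bool → Carrier
  𝟙 true = 1#
  𝟙 false = 0#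

  𝟙-nonNeg : ∀ b → NonNegative (𝟙 b)
  𝟙-nonNeg true = inj₁ 0<1
  𝟙-nonNeg false = inj₂ refl

  𝟙-∧ : ∀ a b x → 𝟙 (a ∧ b) * x ≈ 𝟙 a * (𝟙 b * x)
  𝟙-∧ true b x = sym (*-identityˡ _)
  𝟙-∧ false b x = trans (zeroˡ _) (sym (zeroˡ _))

  δ : ∀ {k} → Fin k → Fin k → Carrier
  δ p i = 𝟙 (⁅ p ⁆ i)

  δ-same : ∀ {k} (p : Fin k) → δ p p ≈ 1#
  δ-same p rewrite ⁅p⁆p p = refl

  δ-other : ∀ {k} {p i : Fin k} → i ≢ p → δ p i ≈ 0#
  δ-other i≢p rewrite ⁅p⁆j i≢p = refl

  ∑-cong : ∀ {k} {f g : Fin k → Carrier} → (∀ i → f i ≈ g i) → ∑ K f ≈ ∑ K g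
  ∑-cong {zero} h = refl
  ∑-cong {suc k} h = +-cong (h zero) (∑-cong (λ i → h (suc i)))

  ∑-zero : ∀ {k} {f : Fin k → Carrier} → (∀ i → f i ≈ 0#) → ∑ K f ≈ 0#
  ∑-zero {zero} h = refl
  ∑-zero {suc k} h = trans (+-cong (h zero) (∑-zero (λ i → h (suc i)))) (+-identityʳ 0#)

  ∑-+ : ∀ {k} (f g : Fin k → Carrier) → ∑ K (λ i → f i + g i) ≈ ∑ K f + ∑ K g
  ∑-+ {zero} f g = sym (+-identityʳ 0#)
  ∑-+ {suc k} f g = trans (+-congˡ (∑-+ (λ i → f (suc i)) (λ i → g (suc i))))
    (solve 4 (λ a b c d → (a :+ b) :+ (c :+ d) := (a :+ c) :+ (b :+ d)) refl
      (f zero) (g zero) (∑ K (λ i → f (suc i))) (∑ K (λ i → g (suc i))))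

  ∑-*ˡ : ∀ {k} a (f : Fin k → Carrier) → ∑ K (λ i → a * f i) ≈ a * ∑ K f
  ∑-*ˡ {zero} a f = sym (zeroʳ a)
  ∑-*ˡ {suc k} a f = trans (+-congˡ (∑-*ˡ a (λ i → f (suc i)))) (sym (distribˡ a _ _))

  ∑-*ʳ : ∀ {k} a (f : Fin k → Carrier) → ∑ K (λ i → f i * a) ≈ ∑ K f * a
  ∑-*ʳ a f = trans (∑-cong (λ i → *-comm (f i) a)) (trans (∑-*ˡ a f) (*-comm a _))

  ∑-neg : ∀ {k} (f : Fin k → Carrier) → ∑ K (λ i → - f i) ≈ - ∑ K f
  ∑-neg {zero} f = sym -0#≈0#
  ∑-neg {suc k} f = trans (+-congˡ (∑-neg (λ i → f (suc i))))
    (solve 2 (λ a b → :- a :+ :- b := :- (a :+ b)) refl (f zero) _)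

  ∑-- : ∀ {k} (f g : Fin k → Carrier) → ∑ K (λ i → f i - g i) ≈ ∑ K f - ∑ K g
  ∑-- f g = trans (∑-+ f (λ i → - g i)) (+-congˡ (∑-neg g))

  ∑-linear : ∀ {k} (a x y : Fin k → Carrier) s t →
    ∑ K (λ l → a l * (s * x l + t * y l)) ≈ s * ∑ K (λ l → a l * x l) + t * ∑ K (λ l → a l * y l)
  ∑-linear a x y s t = begin
    ∑ K (λ l → a l * (s * x l + t * y l))
      ≈⟨ ∑-cong (λ l → solve 5 (λ a x y s t → a :* (s :* x :+ t :* y) := s :* (a :* x) :+ t :* (a :* y)) refl (a l) (x l) (y l) s t) ⟩
    ∑ K (λ l → s * (a l * x l) + t * (a l * y l))
      ≈⟨ ∑-+ (λ l → s * (a l * x l)) (λ l → t * (a l * y l)) ⟩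
    ∑ K (λ l → s * (a l * x l)) + ∑ K (λ l → t * (a l * y l))
      ≈⟨ +-cong (∑-*ˡ s (λ l → a l * x l)) (∑-*ˡ t (λ l → a l * y l)) ⟩
    s * ∑ K (λ l → a l * x l) + t * ∑ K (λ l → a l * y l) ∎

  ∑-linearˡ : ∀ {k} (f g x : Fin k → Carrier) s t →
    ∑ K (λ l → (s * f l - t * g l) * x l) ≈ s * ∑ K (λ l → f l * x l) - t * ∑ K (λ l → g l * x l)
  ∑-linearˡ f g x s t = begin
    ∑ K (λ l → (s * f l - t * g l) * x l)
      ≈⟨ ∑-cong (λ l → solve 5 (λ f g x s t → (s :* f :- t :* g) :* x := s :* (f :* x) :- t :* (g :* x)) refl (f l) (g l) (x l) s t) ⟩
    ∑ K (λ l → s * (f l * x l) - t * (g l * x l))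
      ≈⟨ ∑-- (λ l → s * (f l * x l)) (λ l → t * (g l * x l)) ⟩
    ∑ K (λ l → s * (f l * x l)) - ∑ K (λ l → t * (g l * x l))
      ≈⟨ +-cong (∑-*ˡ s (λ l → f l * x l)) (-‿cong (∑-*ˡ t (λ l → g l * x l))) ⟩
    s * ∑ K (λ l → f l * x l) - t * ∑ K (λ l → g l * x l) ∎

  ∑-comm : ∀ {k m} (f : Fin k → Fin m → Carrier) →
           ∑ K (λ i → ∑ K (λ j → f i j)) ≈ ∑ K (λ j → ∑ K (λ i → f i j))
  ∑-comm {zero} {m} f = sym (∑-zero {m} {λ j → ∑ K (λ (i : Fin 0) → f i j)} (λ _ → refl))
  ∑-comm {suc k} f = begin
    ∑ K (f zero) + ∑ K (λ i → ∑ K (f (suc i)))       ≈⟨ +-congˡ (∑-comm (λ i → f (suc i))) ⟩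
    ∑ K (f zero) + ∑ K (λ j → ∑ K (λ i → f (suc i) j)) ≈⟨ ∑-+ (f zero) (λ j → ∑ K (λ i → f (suc i) j)) ⟨
    ∑ K (λ j → f zero j + ∑ K (λ i → f (suc i) j))   ∎

  ∑-transpose : ∀ {m d} (B : Fin m → Fin d → Carrier) (u : Fin d → Carrier) (μ : Fin m → Carrier) →
    ∑ K (λ l → u l * ∑ K (λ j → B j l * μ j)) ≈ ∑ K (λ j → ∑ K (λ l → B j l * u l) * μ j)
  ∑-transpose B u μ = begin
    ∑ K (λ l → u l * ∑ K (λ j → B j l * μ j))   ≈⟨ ∑-cong (λ l → ∑-*ˡ (u l) (λ j → B j l * μ j)) ⟨
    ∑ K (λ l → ∑ K (λ j → u l * (B j l * μ j))) ≈⟨ ∑-comm (λ l j → u l * (B j l * μ j)) ⟩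
    ∑ K (λ j → ∑ K (λ l → u l * (B j l * μ j))) ≈⟨ ∑-cong (λ j → trans (∑-cong (λ l → solve 3 (λ u b m → u :* (b :* m) := (b :* u) :* m) refl (u l) (B j l) (μ j))) (∑-*ʳ (μ j) (λ l → B j l * u l))) ⟩
    ∑ K (λ j → ∑ K (λ l → B j l * u l) * μ j)   ∎

  ∑-δ : ∀ {k} (p : Fin k) (f : Fin k → Carrier) → ∑ K (λ i → δ p i * f i) ≈ f p
  ∑-δ {suc k} zero f = begin
    1# * f zero + ∑ K (λ i → 0# * f (suc i)) ≈⟨ +-cong (*-identityˡ _) (∑-zero {f = λ i → 0# * f (suc i)} (λ i → zeroˡ _)) ⟩
    f zero + 0#                             ≈⟨ +-identityʳ _ ⟩
    f zero                                  ∎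
  ∑-δ {suc k} (suc p) f = begin
    0# * f zero + ∑ K (λ i → δ p i * f (suc i)) ≈⟨ +-congʳ (zeroˡ _) ⟩
    0# + ∑ K (λ i → δ p i * f (suc i))          ≈⟨ +-identityˡ _ ⟩
    ∑ K (λ i → δ p i * f (suc i))               ≈⟨ ∑-δ p (λ i → f (suc i)) ⟩
    f (suc p)                                   ∎

  ∑-δʳ : ∀ {k} (p : Fin k) (f : Fin k → Carrier) → ∑ K (λ i → f i * δ p i) ≈ f p
  ∑-δʳ p f = trans (∑-cong (λ i → *-comm (f i) (δ p i))) (∑-δ p f)

  ∑-nonNeg : ∀ {k} {f : Fin k → Carrier} → (∀ i → NonNegative (f i)) → NonNegative (∑ K f)
  ∑-nonNeg {zero} h = inj₂ refl
  ∑-nonNeg {suc k} h = nonNeg+nonNeg (h zero) (∑-nonNeg (λ i → h (suc i)))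

  ∑-pos : ∀ {k} {f : Fin k → Carrier} → (∀ i → NonNegative (f i)) → ∀ p → Positive (f p) → Positive (∑ K f)
  ∑-pos {suc k} h zero 0<fp = pos+nonNeg 0<fp (∑-nonNeg (λ i → h (suc i)))
  ∑-pos {suc k} h (suc p) 0<fp = pos-resp-≈ (+-comm _ _) (pos+nonNeg (∑-pos (λ i → h (suc i)) p 0<fp) (h zero))

  ∑-enumerate : ∀ {m} (J : Subset m) (f : Fin m → Carrier) → (∀ j → J j ≡ false → f j ≈ 0#) →
                ∑ K (λ k → f (enumerate J k)) ≈ ∑ K f
  ∑-enumerate {zero} J f h = refl
  ∑-enumerate {suc m} J f h = split (J zero) ≡.refl
    where
    IH : ∑ K (λ k → f (suc (enumerate (λ j → J (suc j)) k))) ≈ ∑ K (λ j → f (suc j))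
    IH = ∑-enumerate (λ j → J (suc j)) (λ j → f (suc j)) (λ j → h (suc j))
    split : ∀ b → J zero ≡ b → ∑ K (λ k → f (enumerate-from b (λ j → J (suc j)) k)) ≈ ∑ K f
    split true _ = +-congˡ IH
    split false J0 = trans IH (trans (sym (+-identityˡ _)) (+-congʳ (sym (h zero J0))))

  Nonzero : ∀ {k} → (Fin k → Carrier) → Set ℓ₁
  Nonzero u = ∃ λ i → ¬ (u i ≈ 0#)

  nonzero? : ∀ {k} (u : Fin k → Carrier) → Nonzero u ⊎ (∀ i → u i ≈ 0#)
  nonzero? {zero} u = inj₂ (λ ())
  nonzero? {suc k} u with u zero ≈? 0# | nonzero? (λ i → u (suc i))
  ... | no u0≉0 | _ = inj₁ (zero , u0≉0)
  ... | yes _ | inj₁ (i , ui≉0) = inj₁ (suc i , ui≉0)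
  ... | yes u0≈0 | inj₂ u≈0 = inj₂ (λ { zero → u0≈0 ; (suc i) → u≈0 i })

  ∑≉0⇒nonzero : ∀ {k} (a u : Fin k → Carrier) → ¬ (∑ K (λ i → a i * u i) ≈ 0#) → Nonzero u
  ∑≉0⇒nonzero a u ∑≉0 with nonzero? u
  ... | inj₁ u≉0 = u≉0
  ... | inj₂ u≈0 = ⊥-elim (∑≉0 (∑-zero (λ i → trans (*-congˡ (u≈0 i)) (zeroʳ _))))

module LinearElimination {c ℓ₁ ℓ₂} (K : OrderedField c ℓ₁ ℓ₂) where

  open import Level using (_⊔_)
  open import Data.Nat.Base as ℕ using (ℕ; zero; suc; _≤_; s≤s)
  import Data.Nat.Properties as ℕ
  open import Data.Fin.Base using (Fin; zero; suc)
  open import Data.Fin.Properties using (_≟_)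
  open import Data.Bool.Base using (true; false)
  open import Data.Bool.Properties using (not-¬)
  open import Data.Product.Base using (∃; _×_; _,_; proj₁; proj₂)
  open import Data.Sum.Base using (_⊎_; inj₁; inj₂)
  open import Data.Empty using (⊥-elim)
  open import Relation.Nullary.Negation.Core using (¬_)
  open import Relation.Nullary.Decidable.Core using (yes; no; toSum)
  open import Relation.Binary.PropositionalEquality.Core as ≡ using (_≡_; _≢_)

  open OrderedFieldProperties K
  open FiniteSums K
  open BooleanSubsets

  SupportedOn : ∀ {n} → (Fin n → Carrier) → Subset n → Set ℓ₁
  SupportedOn μ J = ∀ j → J j ≡ false → μ j ≈ 0#

  DependencyOn : ∀ {n d} → (Fin n → Fin d → Carrier) → Subset n → (Fin n → Carrier) → Set ℓ₁
  DependencyOn A J μ = SupportedOn μ J × Nonzero μ × (∀ l → ∑ K (λ j → A j l * μ j) ≈ 0#)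

  SolvableOn : ∀ {n d} → (Fin n → Fin d → Carrier) → Subset n → Set (c ⊔ ℓ₁)
  SolvableOn {n} {d} A J =
    ∀ (b : Fin n → Carrier) → ∃ λ (u : Fin d → Carrier) → ∀ j → J j ≡ true → ∑ K (λ l → A j l * u l) ≈ b j

  pivot? : ∀ {n} (J : Subset n) (f : Fin n → Carrier) →
           (∃ λ p → J p ≡ true × ¬ (f p ≈ 0#)) ⊎ (∀ p → J p ≡ true → f p ≈ 0#)
  pivot? {zero} J f = inj₂ (λ ())
  pivot? {suc n} J f with J zero in J0 | f zero ≈? 0# | pivot? (λ j → J (suc j)) (λ j → f (suc j))
  ... | true  | no f0≉0 | _ = inj₁ (zero , J0 , f0≉0)
  ... | _     | _       | inj₁ (p , Jp , fp≉0) = inj₁ (suc p , Jp , fp≉0)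
  ... | true  | yes f0≈0 | inj₂ f≈0 = inj₂ (λ { zero _ → f0≈0 ; (suc p) → f≈0 p })
  ... | false | _       | inj₂ f≈0 = inj₂ (λ { zero J0≡t → ⊥-elim (not-¬ J0≡t J0) ; (suc p) → f≈0 p })

  δ-supported : ∀ {n} (J : Subset n) {p} → J p ≡ true → SupportedOn (δ p) J
  δ-supported J {p} Jp j Jj with toSum (j ≟ p)
  ... | inj₁ ≡.refl = ⊥-elim (not-¬ Jp Jj)
  ... | inj₂ j≢p = δ-other j≢p

  δ-nonzero : ∀ {n} (p : Fin n) → Nonzero (δ p)
  δ-nonzero p = p , λ δpp≈0 → 0≉1 (sym (trans (sym (δ-same p)) δpp≈0))

  module ZeroColumn {n d} (A : Fin n → Fin (suc d) → Carrier) (J : Subset n)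
                    (A0≈0 : ∀ j → J j ≡ true → A j zero ≈ 0#) where

    lift-dependency : ∀ {μ} → DependencyOn (λ j l → A j (suc l)) J μ → DependencyOn A J μ
    lift-dependency {μ} (supp , μ≉0 , dep) = supp , μ≉0 , λ { zero → ∑-zero term ; (suc l) → dep l }
      where
      term : ∀ j → A j zero * μ j ≈ 0#
      term j with J j in Jj
      ... | true = trans (*-congʳ (A0≈0 j Jj)) (zeroˡ _)
      ... | false = trans (*-congˡ (supp j Jj)) (zeroʳ _)

    lift-solvable : SolvableOn (λ j l → A j (suc l)) J → SolvableOn A J
    lift-solvable solve′ b with solve′ b
    ... | u , Au≈b = (λ { zero → 0# ; (suc l) → u l }) , λ j Jj →
      trans (+-congʳ (trans (*-congʳ (A0≈0 j Jj)) (zeroˡ _))) (trans (+-identityˡ _) (Au≈b j Jj))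

  module Pivot {n d} (A : Fin n → Fin (suc d) → Carrier) (J : Subset n)
               (p : Fin n) (Jp : J p ≡ true) (Ap≉0 : ¬ (A p zero ≈ 0#)) where

    α : Carrier
    α = A p zero

    α⁻¹ : Carrier
    α⁻¹ = α ⁻¹⟨ Ap≉0 ⟩

    reduced : Fin n → Fin d → Carrier
    reduced j l = A j (suc l) - (A j zero * α⁻¹) * A p (suc l)

    ∑-shift : ∀ (μ : Fin n → Carrier) s l → ∑ K (λ j → A j l * (μ j - s * δ p j)) ≈ ∑ K (λ j → A j l * μ j) - s * A p l
    ∑-shift μ s l = begin
      ∑ K (λ j → A j l * (μ j - s * δ p j))
        ≈⟨ ∑-cong (λ j → solve 4 (λ a m s d → a :* (m :- s :* d) := a :* m :- s :* (d :* a)) refl (A j l) (μ j) s (δ p j)) ⟩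
      ∑ K (λ j → A j l * μ j - s * (δ p j * A j l))
        ≈⟨ ∑-- (λ j → A j l * μ j) (λ j → s * (δ p j * A j l)) ⟩
      ∑ K (λ j → A j l * μ j) - ∑ K (λ j → s * (δ p j * A j l))
        ≈⟨ +-congˡ (-‿cong (trans (∑-*ˡ s (λ j → δ p j * A j l)) (*-congˡ (∑-δ p (λ j → A j l))))) ⟩
      ∑ K (λ j → A j l * μ j) - s * A p l ∎

    ∑-reduced : ∀ (μ : Fin n → Carrier) l →
      ∑ K (λ j → reduced j l * μ j) ≈ ∑ K (λ j → A j (suc l) * μ j) - (α⁻¹ * ∑ K (λ j → A j zero * μ j)) * A p (suc l)
    ∑-reduced μ l = begin
      ∑ K (λ j → reduced j l * μ j)
        ≈⟨ ∑-cong (λ j → solve 5 (λ a b i q m → (a :- (b :* i) :* q) :* m := a :* m :- (i :* q) :* (b :* m)) refl (A j (suc l)) (A j zero) α⁻¹ (A p (suc l)) (μ j)) ⟩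
      ∑ K (λ j → A j (suc l) * μ j - (α⁻¹ * A p (suc l)) * (A j zero * μ j))
        ≈⟨ ∑-- (λ j → A j (suc l) * μ j) (λ j → (α⁻¹ * A p (suc l)) * (A j zero * μ j)) ⟩
      ∑ K (λ j → A j (suc l) * μ j) - ∑ K (λ j → (α⁻¹ * A p (suc l)) * (A j zero * μ j))
        ≈⟨ +-congˡ (-‿cong (∑-*ˡ (α⁻¹ * A p (suc l)) (λ j → A j zero * μ j))) ⟩
      ∑ K (λ j → A j (suc l) * μ j) - (α⁻¹ * A p (suc l)) * T
        ≈⟨ +-congˡ (-‿cong (solve 3 (λ i q t → (i :* q) :* t := (i :* t) :* q) refl α⁻¹ (A p (suc l)) T)) ⟩
      ∑ K (λ j → A j (suc l) * μ j) - (α⁻¹ * T) * A p (suc l) ∎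
      where
      T : Carrier
      T = ∑ K (λ j → A j zero * μ j)

    -- Adding back the pivot row with coefficient -s makes the pivot column vanish as well.
    lift-dependency : ∀ {μ} → DependencyOn reduced (J ∖ p) μ → ∃ λ ν → DependencyOn A J ν
    lift-dependency {μ} (supp , (i , μi≉0) , dep) = ν , suppν , (i , νi≉0) , depν
      where
      T s : Carrier
      T = ∑ K (λ j → A j zero * μ j)
      s = α⁻¹ * T
      ν : Fin n → Carrier
      ν j = μ j - s * δ p j
      μp≈0 : μ p ≈ 0#
      μp≈0 = supp p (∖-removes J p)
      ν≈μ : ∀ {j} → j ≢ p → ν j ≈ μ j
      ν≈μ j≢p = trans (+-congˡ (trans (-‿cong (trans (*-congˡ (δ-other j≢p)) (zeroʳ s))) -0#≈0#)) (+-identityʳ _)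
      suppν : SupportedOn ν J
      suppν j Jj with toSum (j ≟ p)
      ... | inj₁ ≡.refl = ⊥-elim (not-¬ Jp Jj)
      ... | inj₂ j≢p = trans (ν≈μ j≢p) (supp j (∖-outside J p j Jj))
      νi≉0 : ¬ (ν i ≈ 0#)
      νi≉0 νi≈0 with toSum (i ≟ p)
      ... | inj₁ ≡.refl = μi≉0 μp≈0
      ... | inj₂ i≢p = μi≉0 (trans (sym (ν≈μ i≢p)) νi≈0)
      depν : ∀ l → ∑ K (λ j → A j l * ν j) ≈ 0#
      depν zero = begin
        ∑ K (λ j → A j zero * ν j)  ≈⟨ ∑-shift μ s zero ⟩
        T - (α⁻¹ * T) * α           ≈⟨ solve 3 (λ t i c → t :- (i :* t) :* c := t :- t :* (c :* i)) refl T α⁻¹ α ⟩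
        T - T * (α * α⁻¹)           ≈⟨ +-congˡ (-‿cong (trans (*-congˡ (*-inverseʳ α Ap≉0)) (*-identityʳ T))) ⟩
        T - T                       ≈⟨ -‿inverseʳ T ⟩
        0#                          ∎
      depν (suc l) = trans (∑-shift μ s (suc l)) (trans (sym (∑-reduced μ l)) (dep l))

    lift-solvable : SolvableOn reduced (J ∖ p) → SolvableOn A J
    lift-solvable solve′ b = u , Au≈b
      where
      b′ : Fin n → Carrier
      b′ j = b j - (A j zero * α⁻¹) * b p
      u′ : Fin d → Carrier
      u′ = proj₁ (solve′ b′)
      X : Fin n → Carrier
      X j = ∑ K (λ l → A j (suc l) * u′ l)
      u : Fin (suc d) → Carrier
      u zero = α⁻¹ * (b p - X p)
      u (suc l) = u′ l
      reduced-row : ∀ j → ∑ K (λ l → reduced j l * u′ l) + (A j zero * α⁻¹) * X p ≈ X j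
      reduced-row j = begin
        ∑ K (λ l → reduced j l * u′ l) + (A j zero * α⁻¹) * X p
          ≈⟨ +-congˡ (∑-*ˡ (A j zero * α⁻¹) (λ l → A p (suc l) * u′ l)) ⟨
        ∑ K (λ l → reduced j l * u′ l) + ∑ K (λ l → (A j zero * α⁻¹) * (A p (suc l) * u′ l))
          ≈⟨ ∑-+ (λ l → reduced j l * u′ l) (λ l → (A j zero * α⁻¹) * (A p (suc l) * u′ l)) ⟨
        ∑ K (λ l → reduced j l * u′ l + (A j zero * α⁻¹) * (A p (suc l) * u′ l))
          ≈⟨ ∑-cong (λ l → solve 4 (λ a k q v → (a :- k :* q) :* v :+ k :* (q :* v) := a :* v) refl (A j (suc l)) (A j zero * α⁻¹) (A p (suc l)) (u′ l)) ⟩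
        X j ∎
      Au≈b : ∀ j → J j ≡ true → ∑ K (λ l → A j l * u l) ≈ b j
      Au≈b j Jj with toSum (j ≟ p)
      ... | inj₁ ≡.refl = begin
        α * (α⁻¹ * (b p - X p)) + X p ≈⟨ solve 4 (λ c i b x → c :* (i :* (b :- x)) :+ x := (c :* i) :* (b :- x) :+ x) refl α α⁻¹ (b p) (X p) ⟩
        (α * α⁻¹) * (b p - X p) + X p ≈⟨ +-congʳ (trans (*-congʳ (*-inverseʳ α Ap≉0)) (*-identityˡ _)) ⟩
        (b p - X p) + X p             ≈⟨ solve 2 (λ b x → (b :- x) :+ x := b) refl (b p) (X p) ⟩
        b p                           ∎
      ... | inj₂ j≢p = begin
        A j zero * u zero + X j
          ≈⟨ +-congˡ (reduced-row j) ⟨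
        A j zero * u zero + (∑ K (λ l → reduced j l * u′ l) + (A j zero * α⁻¹) * X p)
          ≈⟨ +-congˡ (+-congʳ (proj₂ (solve′ b′) j (≡.trans (∖-keeps J j≢p) Jj))) ⟩
        A j zero * u zero + (b′ j + (A j zero * α⁻¹) * X p)
          ≈⟨ solve 5 (λ a i bp x bj → a :* (i :* (bp :- x)) :+ ((bj :- (a :* i) :* bp) :+ (a :* i) :* x) := bj) refl (A j zero) α⁻¹ (b p) (X p) (b j) ⟩
        b j ∎

  dependent-or-solvable : ∀ d {n} (A : Fin n → Fin d → Carrier) (J : Subset n) →
                          (∃ λ μ → DependencyOn A J μ) ⊎ (∣ J ∣ ≤ d × SolvableOn A J)
  dependent-or-solvable zero A J with nonempty? J
  ... | inj₁ (p , Jp) = inj₁ (δ p , δ-supported J Jp , δ-nonzero p , λ ())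
  ... | inj₂ J≡∅ =
    inj₂ (ℕ.≤-reflexive (∣∅∣ J J≡∅) , λ b → (λ ()) , λ j Jj → ⊥-elim (not-¬ Jj (J≡∅ j)))
  dependent-or-solvable (suc d) A J with pivot? J (λ j → A j zero)
  ... | inj₂ A0≈0 with dependent-or-solvable d (λ j l → A j (suc l)) J
  ...   | inj₁ (μ , dep) = inj₁ (μ , ZeroColumn.lift-dependency A J A0≈0 dep)
  ...   | inj₂ (∣J∣≤d , solvable) = inj₂ (ℕ.m≤n⇒m≤1+n ∣J∣≤d , ZeroColumn.lift-solvable A J A0≈0 solvable)
  dependent-or-solvable (suc d) A J | inj₁ (p , Jp , Ap≉0)
    with dependent-or-solvable d (Pivot.reduced A J p Jp Ap≉0) (J ∖ p)
  ... | inj₁ (μ , dep) = inj₁ (Pivot.lift-dependency A J p Jp Ap≉0 dep)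
  ... | inj₂ (∣J∖p∣≤d , solvable) =
    inj₂ (≡.subst (_≤ suc d) (≡.sym (∣J∖p∣ J p Jp)) (s≤s ∣J∖p∣≤d) , Pivot.lift-solvable A J p Jp Ap≉0 solvable)

module GordanAlternative {c ℓ₁ ℓ₂} (K : OrderedField c ℓ₁ ℓ₂) where

  open import Level using (_⊔_)
  open import Data.Nat.Base as ℕ using (ℕ; zero; suc)
  import Data.Nat.Properties as ℕ
  open import Data.Fin.Base using (Fin; zero; suc)
  open import Data.Fin.Properties using (_≟_)
  open import Data.Bool.Base using (true; false)
  open import Data.Bool.Properties using (not-¬)
  open import Data.Product.Base using (∃; _×_; _,_)
  open import Data.Sum.Base using (_⊎_; inj₁; inj₂)
  open import Data.Empty using (⊥-elim)
  open import Relation.Nullary.Decidable.Core using (toSum)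
  open import Relation.Binary.Definitions using (tri<; tri≈; tri>)
  open import Relation.Binary.PropositionalEquality.Core as ≡ using (_≡_; _≢_)

  open OrderedFieldProperties K
  open FiniteSums K
  open BooleanSubsets
  open LinearElimination K using (SupportedOn; pivot?)

  PositiveOn : ∀ {n d} → (Fin n → Fin d → Carrier) → Subset n → (Fin d → Carrier) → Set ℓ₂
  PositiveOn A S u = ∀ j → S j ≡ true → Positive (∑ K (λ l → A j l * u l))

  SemipositiveDependencyOn : ∀ {n d} → (Fin n → Fin d → Carrier) → Subset n → (Fin n → Carrier) → Set (ℓ₁ ⊔ ℓ₂)
  SemipositiveDependencyOn A S λ′ =
    SupportedOn λ′ S × (∀ j → NonNegative (λ′ j)) × (∃ λ j → Positive (λ′ j)) ×
    (∀ l → ∑ K (λ j → A j l * λ′ j) ≈ 0#)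

  Alternative : ∀ {n d} → (Fin n → Fin d → Carrier) → Subset n → Set (c ⊔ ℓ₁ ⊔ ℓ₂)
  Alternative A S = (∃ (PositiveOn A S)) ⊎ (∃ (SemipositiveDependencyOn A S))

  singleton-alternative : ∀ {n d} (A : Fin n → Fin d → Carrier) (S : Subset n) {p} → S p ≡ true →
                          (∀ j → S j ≡ true → j ≡ p) → Alternative A S
  singleton-alternative {d = d} A S {p} Sp S⊆p with pivot? full (A p)
  ... | inj₁ (l , _ , Apl≉0) = inj₁ (w , w-pos)
    where
    w : Fin d → Carrier
    w l′ = δ l l′ * A p l
    w-pos : PositiveOn A S w
    w-pos j Sj with S⊆p j Sj
    ... | ≡.refl = pos-resp-≈ (sym (trans (∑-cong (λ l′ → solve 3 (λ a b c → a :* (b :* c) := b :* (a :* c)) refl (A p l′) (δ l l′) (A p l)))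
                                          (∑-δ l (λ l′ → A p l′ * A p l))))
                              (square-pos Apl≉0)
  ... | inj₂ Ap≈0 = inj₂ (δ p , LinearElimination.δ-supported K S Sp , (λ j → 𝟙-nonNeg (⁅ p ⁆ j)) ,
                          (p , pos-resp-≈ (sym (δ-same p)) 0<1) , λ l → trans (∑-δʳ p (λ j → A j l)) (Ap≈0 l ≡.refl))

  module Step {n d} (A : Fin n → Fin d → Carrier) (S : Subset n) (p : Fin n) (Sp : S p ≡ true) where

    S′ : Subset n
    S′ = S ∖ p

    S′-grows : ∀ {j} → S j ≡ true → j ≢ p → S′ j ≡ true
    S′-grows Sj j≢p = ≡.trans (∖-keeps S j≢p) Sj

    extend-dependency : ∀ {λ′} → SemipositiveDependencyOn A S′ λ′ → SemipositiveDependencyOn A S λ′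
    extend-dependency (supp , λ≥0 , λ>0 , dep) = (λ j Sj → supp j (∖-outside S p j Sj)) , λ≥0 , λ>0 , dep

    module FromPositive (u : Fin d → Carrier) (u-pos : PositiveOn A S′ u) where

      α : Fin n → Carrier
      α j = ∑ K (λ l → A j l * u l)

      -- The rows of D are orthogonal to u, so a positive point of D adjusts u at row p.
      D : Fin n → Fin d → Carrier
      D j l = α j * A p l - α p * A j l

      ∑-combination : ∀ (λ″ : Fin n → Carrier) l →
        ∑ K (λ j → A j l * ((- α p) * λ″ j + ∑ K (λ i → λ″ i * α i) * δ p j)) ≈ ∑ K (λ j → D j l * λ″ j)
      ∑-combination λ″ l = begin
        ∑ K (λ j → A j l * ((- α p) * λ″ j + s * δ p j))
          ≈⟨ ∑-linear (λ j → A j l) λ″ (δ p) (- α p) s ⟩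
        (- α p) * X + s * ∑ K (λ j → A j l * δ p j)
          ≈⟨ +-congˡ (*-congˡ (∑-δʳ p (λ j → A j l))) ⟩
        (- α p) * X + s * A p l
          ≈⟨ solve 4 (λ a s b x → (:- b) :* x :+ s :* a := a :* s :- b :* x) refl (A p l) s (α p) X ⟩
        A p l * s - α p * X
          ≈⟨ +-congʳ (*-congˡ (∑-cong (λ j → *-comm (λ″ j) (α j)))) ⟩
        A p l * ∑ K (λ j → α j * λ″ j) - α p * X
          ≈⟨ ∑-linearˡ α (λ j → A j l) λ″ (A p l) (α p) ⟨
        ∑ K (λ j → (A p l * α j - α p * A j l) * λ″ j)
          ≈⟨ ∑-cong (λ j → *-congʳ (+-congʳ (*-comm (A p l) (α j)))) ⟩
        ∑ K (λ j → D j l * λ″ j) ∎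
        where
        s X : Carrier
        s = ∑ K (λ i → λ″ i * α i)
        X = ∑ K (λ j → A j l * λ″ j)

      from-dependency : ∀ {λ″} → NonNegative (- α p) → SemipositiveDependencyOn D S′ λ″ →
                        SemipositiveDependencyOn A S (λ j → (- α p) * λ″ j + ∑ K (λ i → λ″ i * α i) * δ p j)
      from-dependency {λ″} -β≥0 (supp , λ≥0 , (i , 0<λi) , dep) = supp′ , λ′≥0 , (p , 0<λp) , dep′
        where
        β : Carrier
        β = α p
        s : Carrier
        s = ∑ K (λ i → λ″ i * α i)
        term-nonNeg : ∀ j → NonNegative (λ″ j * α j)
        term-nonNeg j with S′ j in S′j
        ... | true = nonNeg*nonNeg (λ≥0 j) (inj₁ (u-pos j S′j))
        ... | false = inj₂ (trans (*-congʳ (supp j S′j)) (zeroˡ _))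
        0<s : Positive s
        0<s = ∑-pos term-nonNeg i pos-term
          where
          pos-term : Positive (λ″ i * α i)
          pos-term with S′ i in S′i
          ... | true = *-pos 0<λi (u-pos i S′i)
          ... | false = ⊥-elim (pos⇒≉0 0<λi (supp i S′i))
        supp′ : SupportedOn (λ j → (- β) * λ″ j + s * δ p j) S
        supp′ j Sj with toSum (j ≟ p)
        ... | inj₁ ≡.refl = ⊥-elim (not-¬ Sp Sj)
        ... | inj₂ j≢p = trans (+-cong (trans (*-congˡ (supp j (∖-outside S p j Sj))) (zeroʳ _))
                                       (trans (*-congˡ (δ-other j≢p)) (zeroʳ _))) (+-identityʳ 0#)
        λ′≥0 : ∀ j → NonNegative ((- β) * λ″ j + s * δ p j)
        λ′≥0 j = nonNeg+nonNeg (nonNeg*nonNeg -β≥0 (λ≥0 j)) (nonNeg*nonNeg (inj₁ 0<s) (𝟙-nonNeg (⁅ p ⁆ j)))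
        0<λp : Positive ((- β) * λ″ p + s * δ p p)
        0<λp = pos-resp-≈ (sym (trans (+-cong (trans (*-congˡ (supp p (∖-removes S p))) (zeroʳ _))
                                              (trans (*-congˡ (δ-same p)) (*-identityʳ s)))
                                      (+-identityˡ s))) 0<s
        dep′ : ∀ l → ∑ K (λ j → A j l * ((- β) * λ″ j + s * δ p j)) ≈ 0#
        dep′ l = trans (∑-combination λ″ l) (dep l)

      module FromBoth (x : Fin d → Carrier) (x-pos : PositiveOn D S′ x) where

        γ : Carrier
        γ = ∑ K (λ l → A p l * x l)

        ξ : Fin n → Carrier
        ξ j = ∑ K (λ l → A j l * x l)

        Dx : ∀ j → ∑ K (λ l → D j l * x l) ≈ α j * γ - α p * ξ j
        Dx j = ∑-linearˡ (A p) (A j) x (α j) (α p)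

        -- w = (-β) x + (γ - ε) u with ε small: row p gives -β ε, row j ∈ S′ gives ⟨D j, x⟩ - ε α j.
        positive-if-β<0 : α p < 0# → ∃ (PositiveOn A S)
        positive-if-β<0 β<0 with small-perturbation-pos S′ (λ j → ∑ K (λ l → D j l * x l)) (λ j → - α j) x-pos
        ... | ε , 0<ε , hε = w , w-pos
          where
          β : Carrier
          β = α p
          w : Fin d → Carrier
          w l = (- β) * x l + (γ - ε) * u l
          Aw : ∀ j → ∑ K (λ l → A j l * w l) ≈ (- β) * ξ j + (γ - ε) * α j
          Aw j = ∑-linear (A j) x u (- β) (γ - ε)
          w-pos : PositiveOn A S w
          w-pos j Sj with toSum (j ≟ p)
          ... | inj₁ ≡.refl = pos-resp-≈
            (sym (trans (Aw p) (solve 3 (λ b g e → (:- b) :* g :+ (g :- e) :* b := e :* (:- b)) refl β γ ε)))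
            (*-pos 0<ε (neg⇒-pos β<0))
          ... | inj₂ j≢p = pos-resp-≈
            (sym (trans (Aw j) (trans (solve 5 (λ b xi g e a → (:- b) :* xi :+ (g :- e) :* a := (a :* g :- b :* xi) :+ e :* (:- a)) refl β (ξ j) γ ε (α j))
                                      (+-congʳ (sym (Dx j))))))
            (hε j (S′-grows Sj j≢p))

        positive-if-β≈0 : α p ≈ 0# → ∀ {i} → S′ i ≡ true → ∃ (PositiveOn A S)
        positive-if-β≈0 β≈0 {i} S′i with small-perturbation-pos S′ α ξ u-pos
        ... | ε , 0<ε , hε = w , w-pos
          where
          0<γ : Positive γ
          0<γ = pos-cancelˡ (u-pos i S′i)
            (pos-resp-≈ (trans (Dx i) (trans (+-congˡ (trans (-‿cong (trans (*-congʳ β≈0) (zeroˡ _))) -0#≈0#))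
                                              (+-identityʳ _)))
                        (x-pos i S′i))
          w : Fin d → Carrier
          w l = 1# * u l + ε * x l
          Aw : ∀ j → ∑ K (λ l → A j l * w l) ≈ 1# * α j + ε * ξ j
          Aw j = ∑-linear (A j) u x 1# ε
          w-pos : PositiveOn A S w
          w-pos j Sj with toSum (j ≟ p)
          ... | inj₁ ≡.refl = pos-resp-≈ (sym (trans (Aw p) (trans (+-congʳ (trans (*-identityˡ _) β≈0)) (+-identityˡ _))))
                                         (*-pos 0<ε 0<γ)
          ... | inj₂ j≢p = pos-resp-≈ (sym (trans (Aw j) (+-congʳ (*-identityˡ _)))) (hε j (S′-grows Sj j≢p))

      alternative : (∀ {d′} (B : Fin n → Fin d′ → Carrier) → Alternative B S′) → Alternative A S
      alternative IH with compare (α p) 0#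
      ... | tri> _ _ 0<β = inj₁ (u , u-pos′)
        where
        u-pos′ : PositiveOn A S u
        u-pos′ j Sj with toSum (j ≟ p)
        ... | inj₁ ≡.refl = 0<β
        ... | inj₂ j≢p = u-pos j (S′-grows Sj j≢p)
      ... | tri< β<0 _ _ with IH D
      ...   | inj₂ (_ , dep) = inj₂ (_ , from-dependency (inj₁ (neg⇒-pos β<0)) dep)
      ...   | inj₁ (x , x-pos) = inj₁ (FromBoth.positive-if-β<0 x x-pos β<0)
      alternative IH | tri≈ _ β≈0 _ with IH D
      ...   | inj₂ (_ , dep) = inj₂ (_ , from-dependency (inj₂ (trans (-‿cong β≈0) -0#≈0#)) dep)
      ...   | inj₁ (x , x-pos) with nonempty? S′
      ...     | inj₁ (i , S′i) = inj₁ (FromBoth.positive-if-β≈0 x x-pos β≈0 S′i)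
      ...     | inj₂ S′≡∅ = singleton-alternative A S Sp S⊆p
        where
        S⊆p : ∀ j → S j ≡ true → j ≡ p
        S⊆p j Sj with toSum (j ≟ p)
        ... | inj₁ j≡p = j≡p
        ... | inj₂ j≢p = ⊥-elim (not-¬ (S′-grows Sj j≢p) (S′≡∅ j))

    alternative : (∀ {d′} (B : Fin n → Fin d′ → Carrier) → Alternative B S′) → Alternative A S
    alternative IH with IH A
    ... | inj₂ (λ′ , dep) = inj₂ (λ′ , extend-dependency dep)
    ... | inj₁ (u , u-pos) = FromPositive.alternative u u-pos IH

  gordan′ : ∀ k {n d} (A : Fin n → Fin d → Carrier) (S : Subset n) → ∣ S ∣ ≡ k → Alternative A S
  gordan′ zero A S ∣S∣≡0 = inj₁ ((λ _ → 0#) , λ j Sj → ⊥-elim (not-¬ Sj (∣J∣≡0⇒J≡∅ S ∣S∣≡0 j)))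
  gordan′ (suc k) A S ∣S∣≡1+k with ∣J∣≡1+n⇒nonempty S ∣S∣≡1+k
  ... | p , Sp = Step.alternative A S p Sp (λ B → gordan′ k B (S ∖ p) ∣S∖p∣≡k)
    where
    ∣S∖p∣≡k : ∣ S ∖ p ∣ ≡ k
    ∣S∖p∣≡k = ℕ.suc-injective (≡.trans (≡.sym (∣J∖p∣ S p Sp)) ∣S∣≡1+k)

  gordan : ∀ {n d} (A : Fin n → Fin d → Carrier) (S : Subset n) → Alternative A S
  gordan A S = gordan′ _ A S ≡.refl

module SignVectors where

  open import Data.Nat.Base using (ℕ; zero; suc; _≤_; _<_; s≤s)
  open import Data.Fin.Base using (Fin; zero; suc)
  open import Data.Bool.Base using (Bool; true; false; _∧_)
  open import Data.Vec.Base using (Vec; []; _∷_; lookup; replicate; _[_]≔_)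
  open import Data.Vec.Properties using (≡-dec; tabulate∘lookup; tabulate-cong; lookup-replicate)
  open import Relation.Nullary.Decidable.Core using (yes; no)
  open import Relation.Binary.Definitions using (DecidableEquality)
  open import Relation.Binary.PropositionalEquality.Core using (_≡_; refl; sym; trans; cong; cong₂)
  open BooleanSubsets using (prefix)

  _≟ˢ_ : DecidableEquality Sign
  neg ≟ˢ neg = yes refl
  zer ≟ˢ zer = yes refl
  pos ≟ˢ pos = yes refl
  neg ≟ˢ zer = no λ ()
  neg ≟ˢ pos = no λ ()
  zer ≟ˢ neg = no λ ()
  zer ≟ˢ pos = no λ ()
  pos ≟ˢ neg = no λ ()
  pos ≟ˢ zer = no λ ()

  _≟ᵛ_ : ∀ {n} → DecidableEquality (Vec Sign n)
  _≟ᵛ_ = ≡-dec _≟ˢ_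

  lookup-extensional : ∀ {n} (F G : Vec Sign n) → (∀ j → lookup F j ≡ lookup G j) → F ≡ G
  lookup-extensional F G h = trans (sym (tabulate∘lookup F)) (trans (tabulate-cong h) (tabulate∘lookup G))

  isNonzero : Sign → Bool
  isNonzero zer = false
  isNonzero _ = true

  isNonzero≡false : ∀ {s} → isNonzero s ≡ false → s ≡ zer
  isNonzero≡false {zer} _ = refl

  opposite : Sign → Sign
  opposite neg = pos
  opposite zer = zer
  opposite pos = neg

  _⊑ˢ_ : Sign → Sign → Bool
  zer ⊑ˢ _ = true
  neg ⊑ˢ neg = true
  pos ⊑ˢ pos = true
  _ ⊑ˢ _ = false

  _⊑_ : ∀ {n} → Vec Sign n → Vec Sign n → Bool
  [] ⊑ [] = true
  (a ∷ G) ⊑ (b ∷ F) = (a ⊑ˢ b) ∧ (G ⊑ F)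

  ⊑ˢ-refl : ∀ s → (s ⊑ˢ s) ≡ true
  ⊑ˢ-refl neg = refl
  ⊑ˢ-refl zer = refl
  ⊑ˢ-refl pos = refl

  ⊑ˢ-zer : ∀ {s} → (s ⊑ˢ zer) ≡ true → s ≡ zer
  ⊑ˢ-zer {zer} _ = refl

  ⊑ˢ-nonzero : ∀ {s t} → isNonzero s ≡ true → (s ⊑ˢ t) ≡ true → t ≡ s
  ⊑ˢ-nonzero {neg} {neg} _ _ = refl
  ⊑ˢ-nonzero {pos} {pos} _ _ = refl

  ⊑-lookup : ∀ {n} (G F : Vec Sign n) → (G ⊑ F) ≡ true → ∀ j → (lookup G j ⊑ˢ lookup F j) ≡ true
  ⊑-lookup (a ∷ G) (b ∷ F) h zero with a ⊑ˢ b
  ... | true = refl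
  ⊑-lookup (a ∷ G) (b ∷ F) h (suc j) with a ⊑ˢ b
  ... | true = ⊑-lookup G F h j

  ⊑-tabulate : ∀ {n} (G F : Vec Sign n) → (∀ j → (lookup G j ⊑ˢ lookup F j) ≡ true) → (G ⊑ F) ≡ true
  ⊑-tabulate [] [] h = refl
  ⊑-tabulate (a ∷ G) (b ∷ F) h rewrite h zero = ⊑-tabulate G F (λ j → h (suc j))

  zeros : ∀ {n} → Vec Sign n
  zeros = replicate _ zer

  positives : ∀ {n} → Vec Sign n
  positives = replicate _ pos

  -- Coordinates beyond the first m are reset to pos, a placeholder value in the sweep.
  restrict : ∀ {n} → ℕ → Vec Sign n → Vec Sign n
  restrict zero F = positives
  restrict (suc m) [] = []
  restrict (suc m) (a ∷ F) = a ∷ restrict m F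

  select : Bool → Sign → Sign
  select true s = s
  select false s = pos

  lookup-restrict : ∀ {n} m (F : Vec Sign n) j → lookup (restrict m F) j ≡ select (prefix m j) (lookup F j)
  lookup-restrict zero F j = lookup-replicate j pos
  lookup-restrict (suc m) (a ∷ F) zero = refl
  lookup-restrict (suc m) (a ∷ F) (suc j) = lookup-restrict m F j

  restrict-all : ∀ {n} (F : Vec Sign n) → restrict n F ≡ F
  restrict-all [] = refl
  restrict-all (a ∷ F) = cong (a ∷_) (restrict-all F)

  count-zeros : ∀ n → count zer (zeros {n}) ≡ n
  count-zeros zero = refl
  count-zeros (suc n) = cong suc (count-zeros n)

  count-neg-zeros : ∀ n → count neg (zeros {n}) ≡ 0
  count-neg-zeros zero = refl
  count-neg-zeros (suc n) = count-neg-zeros n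

  count-positives : ∀ n → count zer (positives {n}) ≡ 0
  count-positives zero = refl
  count-positives (suc n) = count-positives n

  count-restrict-zeros : ∀ {n} m → m ≤ n → count zer (restrict m (zeros {n})) ≡ m
  count-restrict-zeros {n} zero _ = count-positives n
  count-restrict-zeros {suc n} (suc m) (s≤s m≤n) = cong suc (count-restrict-zeros m m≤n)

  count-zer-[]≔zer : ∀ {n} (Q : Vec Sign n) e → lookup Q e ≡ pos → count zer (Q [ e ]≔ zer) ≡ suc (count zer Q)
  count-zer-[]≔zer (pos ∷ Q) zero _ = refl
  count-zer-[]≔zer (neg ∷ Q) (suc e) h = count-zer-[]≔zer Q e h
  count-zer-[]≔zer (zer ∷ Q) (suc e) h = cong suc (count-zer-[]≔zer Q e h)
  count-zer-[]≔zer (pos ∷ Q) (suc e) h = count-zer-[]≔zer Q e h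

  count-zer-[]≔neg : ∀ {n} (Q : Vec Sign n) e → lookup Q e ≡ pos → count zer (Q [ e ]≔ neg) ≡ count zer Q
  count-zer-[]≔neg (pos ∷ Q) zero _ = refl
  count-zer-[]≔neg (neg ∷ Q) (suc e) h = count-zer-[]≔neg Q e h
  count-zer-[]≔neg (zer ∷ Q) (suc e) h = cong suc (count-zer-[]≔neg Q e h)
  count-zer-[]≔neg (pos ∷ Q) (suc e) h = count-zer-[]≔neg Q e h

module SignFunction {c ℓ₁ ℓ₂} (K : OrderedField c ℓ₁ ℓ₂) where

  open import Data.Nat.Base using (zero; suc)
  open import Data.Fin.Base using (Fin; zero; suc)
  open import Data.Bool.Base using (Bool; true; false)
  open import Data.Vec.Base using (Vec; []; _∷_; lookup)
  open import Data.Empty using (⊥-elim)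
  open import Relation.Nullary.Negation.Core using (¬_)
  open import Relation.Binary.Definitions using (tri<; tri≈; tri>)
  open import Relation.Binary.PropositionalEquality.Core as ≡ using (_≡_)

  open OrderedFieldProperties K
  open SignVectors

  signValue : Sign → Carrier
  signValue neg = - 1#
  signValue zer = 0#
  signValue pos = 1#

  signValue²≈1 : ∀ s → isNonzero s ≡ true → signValue s * signValue s ≈ 1#
  signValue²≈1 neg _ = -1*-1≈1
  signValue²≈1 pos _ = *-identityˡ 1#

  signValue≉0 : ∀ s → isNonzero s ≡ true → ¬ (signValue s ≈ 0#)
  signValue≉0 s h sv≈0 = 0≉1 (trans (sym (trans (*-congˡ sv≈0) (zeroʳ _))) (signValue²≈1 s h))

  sgn-pos : ∀ {x} → Positive x → sgn K x ≡ pos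
  sgn-pos {x} 0<x with compare x 0#
  ... | tri< x<0 _ _ = ⊥-elim (<-asym x<0 0<x)
  ... | tri≈ _ x≈0 _ = ⊥-elim (pos⇒≉0 0<x x≈0)
  ... | tri> _ _ _ = ≡.refl

  sgn-neg : ∀ {x} → x < 0# → sgn K x ≡ neg
  sgn-neg {x} x<0 with compare x 0#
  ... | tri< _ _ _ = ≡.refl
  ... | tri≈ _ x≈0 _ = ⊥-elim (neg⇒≉0 x<0 x≈0)
  ... | tri> _ _ 0<x = ⊥-elim (<-asym 0<x x<0)

  sgn-zer : ∀ {x} → x ≈ 0# → sgn K x ≡ zer
  sgn-zer {x} x≈0 with compare x 0#
  ... | tri< x<0 _ _ = ⊥-elim (neg⇒≉0 x<0 x≈0)
  ... | tri≈ _ _ _ = ≡.refl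
  ... | tri> _ _ 0<x = ⊥-elim (pos⇒≉0 0<x x≈0)

  sgn≡zer⇒≈0 : ∀ x → sgn K x ≡ zer → x ≈ 0#
  sgn≡zer⇒≈0 x h with compare x 0#
  ... | tri≈ _ x≈0 _ = x≈0

  sgn-nonzero⇒≉0 : ∀ x → isNonzero (sgn K x) ≡ true → ¬ (x ≈ 0#)
  sgn-nonzero⇒≉0 x h x≈0 rewrite sgn-zer x≈0 with h
  ... | ()

  sgn-cong : ∀ {x y} → x ≈ y → sgn K x ≡ sgn K y
  sgn-cong {x} {y} x≈y with compare y 0#
  ... | tri< y<0 _ _ = sgn-neg (<-resp-≈ (sym x≈y) refl y<0)
  ... | tri≈ _ y≈0 _ = sgn-zer (trans x≈y y≈0)
  ... | tri> _ _ 0<y = sgn-pos (pos-resp-≈ (sym x≈y) 0<y)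

  sgn-by-signValue : ∀ {x} s → isNonzero s ≡ true → Positive (signValue s * x) → sgn K x ≡ s
  sgn-by-signValue {x} pos _ h = sgn-pos (pos-resp-≈ (*-identityˡ x) h)
  sgn-by-signValue {x} neg _ h = sgn-neg (-pos⇒neg (pos-resp-≈ (solve 1 (λ x → :-1 :* x := :- x) refl x) h))

  signValue-sgn : ∀ x → isNonzero (sgn K x) ≡ true → Positive (signValue (sgn K x) * x)
  signValue-sgn x h with compare x 0#
  ... | tri< x<0 _ _ = pos-resp-≈ (solve 1 (λ x → :- x := :-1 :* x) refl x) (neg⇒-pos x<0)
  ... | tri> _ _ 0<x = pos-resp-≈ (sym (*-identityˡ x)) 0<x

  signValue-sgn′ : ∀ {x s} → sgn K x ≡ s → isNonzero s ≡ true → Positive (signValue s * x)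
  signValue-sgn′ {x} ≡.refl h = signValue-sgn x h

  sgn-characterisation : ∀ x s → (isNonzero s ≡ true → Positive (signValue s * x)) →
                         (isNonzero s ≡ false → x ≈ 0#) → sgn K x ≡ s
  sgn-characterisation x neg h _ = sgn-by-signValue neg ≡.refl (h ≡.refl)
  sgn-characterisation x pos h _ = sgn-by-signValue pos ≡.refl (h ≡.refl)
  sgn-characterisation x zer _ h = sgn-zer (h ≡.refl)

  sgn-‿ : ∀ x → sgn K (- x) ≡ opposite (sgn K x)
  sgn-‿ x with compare x 0#
  ... | tri< x<0 _ _ = sgn-pos (neg⇒-pos x<0)
  ... | tri≈ _ x≈0 _ = sgn-zer (trans (-‿cong x≈0) -0#≈0#)
  ... | tri> _ _ 0<x = sgn-neg (pos⇒-neg 0<x)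

  same-nonzero-sign : ∀ {a b x y} t → isNonzero t ≡ true → Positive a → Positive b →
                      sgn K x ≡ t → sgn K y ≡ t → sgn K (a * x + b * y) ≡ t
  same-nonzero-sign {a} {b} {x} {y} t t≢0 0<a 0<b sx sy = sgn-by-signValue t t≢0
    (pos-resp-≈ (solve 5 (λ s a b x y → a :* (s :* x) :+ b :* (s :* y) := s :* (a :* x :+ b :* y)) refl (signValue t) a b x y)
                (pos+pos (*-pos 0<a (signValue-sgn′ sx t≢0)) (*-pos 0<b (signValue-sgn′ sy t≢0))))

  sgn-positive-combination : ∀ {a b x y} t → Positive a → Positive b → sgn K x ≡ t → sgn K y ≡ t →
                             sgn K (a * x + b * y) ≡ t
  sgn-positive-combination {a} {b} {x} {y} zer _ _ sx sy =
    sgn-zer (trans (+-cong (trans (*-congˡ (sgn≡zer⇒≈0 x sx)) (zeroʳ a)) (trans (*-congˡ (sgn≡zer⇒≈0 y sy)) (zeroʳ b)))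
                   (+-identityʳ 0#))
  sgn-positive-combination neg 0<a 0<b sx sy = same-nonzero-sign neg ≡.refl 0<a 0<b sx sy
  sgn-positive-combination pos 0<a 0<b sx sy = same-nonzero-sign pos ≡.refl 0<a 0<b sx sy

  lookup-signVec : ∀ {n} (f : Fin n → Carrier) j → lookup (signVec K f) j ≡ sgn K (f j)
  lookup-signVec f zero = ≡.refl
  lookup-signVec f (suc j) = lookup-signVec (λ i → f (suc i)) j

  signVec-≡ : ∀ {n} (f : Fin n → Carrier) (G : Vec Sign n) → (∀ j → sgn K (f j) ≡ lookup G j) → signVec K f ≡ G
  signVec-≡ {zero} f [] h = ≡.refl
  signVec-≡ {suc n} f (s ∷ G) h = ≡.cong₂ _∷_ (h zero) (signVec-≡ (λ j → f (suc j)) G (λ j → h (suc j)))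

module SignVectorSums {c ℓ₁ ℓ₂} (K : OrderedField c ℓ₁ ℓ₂) where

  open import Data.Nat.Base using (zero; suc)
  open import Data.Fin.Base using (Fin; zero; suc)
  open import Data.Bool.Base using (Bool; true; false; _∧_; _∨_)
  open import Data.Vec.Base using (Vec; []; _∷_; lookup; _[_]≔_)
  open import Data.Vec.Properties using (∷-injectiveˡ; ∷-injectiveʳ)
  open import Data.List.Base using (List; []; _∷_)
  open import Data.List.Membership.Propositional using (_∈_)
  import Data.List.Membership.DecPropositional as DecMembership
  open import Data.List.Relation.Unary.All.Properties using (All¬⇒¬Any)
  open import Data.List.Relation.Unary.AllPairs using (_∷_)
  open import Data.List.Relation.Unary.Unique.Propositional using (Unique)
  open import Data.Empty using (⊥; ⊥-elim)
  open import Relation.Nullary.Decidable.Core using (Dec; does; yes; no)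
  open import Relation.Nullary.Decidable using (dec-true)
  open import Relation.Binary.PropositionalEquality.Core as ≡ using (_≡_; _≢_)

  open OrderedFieldProperties K
  open FiniteSums K using (𝟙)
  open SignVectors

  ∑ᵛ : ∀ {m} → (Vec Sign m → Carrier) → Carrier
  ∑ᵛ {zero} h = h []
  ∑ᵛ {suc m} h = ∑ᵛ (λ P → h (neg ∷ P)) + (∑ᵛ (λ P → h (zer ∷ P)) + ∑ᵛ (λ P → h (pos ∷ P)))

  ∑ᵛ-cong : ∀ {m} {h h′ : Vec Sign m → Carrier} → (∀ P → h P ≈ h′ P) → ∑ᵛ h ≈ ∑ᵛ h′
  ∑ᵛ-cong {zero} e = e []
  ∑ᵛ-cong {suc m} e = +-cong (∑ᵛ-cong (λ P → e (neg ∷ P))) (+-cong (∑ᵛ-cong (λ P → e (zer ∷ P))) (∑ᵛ-cong (λ P → e (pos ∷ P))))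

  ∑ᵛ-zero : ∀ {m} {h : Vec Sign m → Carrier} → (∀ P → h P ≈ 0#) → ∑ᵛ h ≈ 0#
  ∑ᵛ-zero {zero} e = e []
  ∑ᵛ-zero {suc m} e = trans (+-cong (∑ᵛ-zero (λ P → e (neg ∷ P))) (+-cong (∑ᵛ-zero (λ P → e (zer ∷ P))) (∑ᵛ-zero (λ P → e (pos ∷ P)))))
                            (solve 0 (:0 :+ (:0 :+ :0) := :0) refl)

  ∑ᵛ-+ : ∀ {m} (h h′ : Vec Sign m → Carrier) → ∑ᵛ (λ P → h P + h′ P) ≈ ∑ᵛ h + ∑ᵛ h′
  ∑ᵛ-+ {zero} h h′ = refl
  ∑ᵛ-+ {suc m} h h′ = trans (+-cong (∑ᵛ-+ {m} _ _) (+-cong (∑ᵛ-+ {m} _ _) (∑ᵛ-+ {m} _ _)))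
    (solve 6 (λ a a′ b b′ c c′ → (a :+ a′) :+ ((b :+ b′) :+ (c :+ c′)) := (a :+ (b :+ c)) :+ (a′ :+ (b′ :+ c′))) refl _ _ _ _ _ _)

  ∑ᵛ-*ˡ : ∀ {m} x (h : Vec Sign m → Carrier) → ∑ᵛ (λ P → x * h P) ≈ x * ∑ᵛ h
  ∑ᵛ-*ˡ {zero} x h = refl
  ∑ᵛ-*ˡ {suc m} x h = trans (+-cong (∑ᵛ-*ˡ {m} x _) (+-cong (∑ᵛ-*ˡ {m} x _) (∑ᵛ-*ˡ {m} x _)))
    (solve 4 (λ x a b c → x :* a :+ (x :* b :+ x :* c) := x :* (a :+ (b :+ c))) refl x _ _ _)

  ∑ᵛ-*ʳ : ∀ {m} x (h : Vec Sign m → Carrier) → ∑ᵛ (λ P → h P * x) ≈ ∑ᵛ h * x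
  ∑ᵛ-*ʳ {m} x h = trans (∑ᵛ-cong {m} (λ P → *-comm (h P) x)) (trans (∑ᵛ-*ˡ x h) (*-comm x _))

  ∑ᵛ-neg : ∀ {m} (h : Vec Sign m → Carrier) → ∑ᵛ (λ P → - h P) ≈ - ∑ᵛ h
  ∑ᵛ-neg {m} h = trans (∑ᵛ-cong {m} (λ P → solve 1 (λ a → :- a := :-1 :* a) refl (h P)))
                       (trans (∑ᵛ-*ˡ (- 1#) h) (solve 1 (λ a → :-1 :* a := :- a) refl (∑ᵛ h)))

  ∑ᵛ-comm : ∀ {m k} (h : Vec Sign m → Vec Sign k → Carrier) →
            ∑ᵛ (λ P → ∑ᵛ (λ Q → h P Q)) ≈ ∑ᵛ (λ Q → ∑ᵛ (λ P → h P Q))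
  ∑ᵛ-comm {zero} h = refl
  ∑ᵛ-comm {suc m} {k} h = trans (+-cong (∑ᵛ-comm {m} {k} _) (+-cong (∑ᵛ-comm {m} {k} _) (∑ᵛ-comm {m} {k} _)))
    (trans (+-congˡ (sym (∑ᵛ-+ {k} _ _))) (sym (∑ᵛ-+ {k} _ _)))

  ∑ᵛ-branch-off : ∀ {m s} t (Q : Vec Sign m) (h : Vec Sign (suc m) → Carrier) → (∀ P → P ≢ s ∷ Q → h P ≈ 0#) → t ≢ s →
                  ∑ᵛ (λ P → h (t ∷ P)) ≈ 0#
  ∑ᵛ-branch-off {m} t Q h off t≢s = ∑ᵛ-zero {m} (λ P → off (t ∷ P) (λ e → t≢s (∷-injectiveˡ e)))

  ∑ᵛ-point : ∀ {m} (Q : Vec Sign m) (h : Vec Sign m → Carrier) → (∀ P → P ≢ Q → h P ≈ 0#) → ∑ᵛ h ≈ h Q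
  ∑ᵛ-branch-on : ∀ {m s} (Q : Vec Sign m) (h : Vec Sign (suc m) → Carrier) → (∀ P → P ≢ s ∷ Q → h P ≈ 0#) →
                 ∑ᵛ (λ P → h (s ∷ P)) ≈ h (s ∷ Q)

  ∑ᵛ-point [] h _ = refl
  ∑ᵛ-point (neg ∷ Q) h off =
    trans (+-cong (∑ᵛ-branch-on Q h off) (+-cong (∑ᵛ-branch-off zer Q h off λ ()) (∑ᵛ-branch-off pos Q h off λ ())))
          (solve 1 (λ a → a :+ (:0 :+ :0) := a) refl (h (neg ∷ Q)))
  ∑ᵛ-point (zer ∷ Q) h off =
    trans (+-cong (∑ᵛ-branch-off neg Q h off λ ()) (+-cong (∑ᵛ-branch-on Q h off) (∑ᵛ-branch-off pos Q h off λ ())))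
          (solve 1 (λ a → :0 :+ (a :+ :0) := a) refl (h (zer ∷ Q)))
  ∑ᵛ-point (pos ∷ Q) h off =
    trans (+-cong (∑ᵛ-branch-off neg Q h off λ ()) (+-cong (∑ᵛ-branch-off zer Q h off λ ()) (∑ᵛ-branch-on Q h off)))
          (solve 1 (λ a → :0 :+ (:0 :+ a) := a) refl (h (pos ∷ Q)))

  ∑ᵛ-branch-on {s = s} Q h off =
    ∑ᵛ-point Q (λ P → h (s ∷ P)) (λ P P≢Q → off (s ∷ P) (λ e → P≢Q (∷-injectiveʳ e)))

  isPos : Sign → Bool
  isPos s = does (s ≟ˢ pos)

  isPos≡true : ∀ {s} → isPos s ≡ true → s ≡ pos
  isPos≡true {pos} _ = ≡.refl

  -- Every sign vector arises exactly once from a vector with pos at e by resetting coordinate e.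
  ∑ᵛ-fibres : ∀ {m} (e : Fin m) (h : Vec Sign m → Carrier) →
    ∑ᵛ h ≈ ∑ᵛ (λ P → 𝟙 (isPos (lookup P e)) * (h (P [ e ]≔ neg) + (h (P [ e ]≔ zer) + h (P [ e ]≔ pos))))
  ∑ᵛ-fibres {suc m} zero h = sym (trans
    (+-cong (∑ᵛ-zero {m} (λ _ → zeroˡ _))
            (+-cong (∑ᵛ-zero {m} (λ _ → zeroˡ _))
                    (trans (∑ᵛ-cong {m} (λ _ → *-identityˡ _)) (trans (∑ᵛ-+ {m} _ _) (+-congˡ (∑ᵛ-+ {m} _ _))))))
    (trans (+-identityˡ _) (+-identityˡ _)))
  ∑ᵛ-fibres {suc m} (suc e) h = +-cong (∑ᵛ-fibres {m} e _) (+-cong (∑ᵛ-fibres {m} e _) (∑ᵛ-fibres {m} e _))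

  _∈?_ : ∀ {m} (F : Vec Sign m) L → Dec (F ∈ L)
  _∈?_ = DecMembership._∈?_ _≟ᵛ_

  _∈ᵇ_ : ∀ {m} → Vec Sign m → List (Vec Sign m) → Bool
  F ∈ᵇ L = does (F ∈? L)

  ∈ᵇ-intro : ∀ {m} {F : Vec Sign m} {L} → F ∈ L → (F ∈ᵇ L) ≡ true
  ∈ᵇ-intro {F = F} {L} = dec-true (F ∈? L)

  ∈ᵇ-elim : ∀ {m} {F : Vec Sign m} {L} → (F ∈ᵇ L) ≡ true → F ∈ L
  ∈ᵇ-elim {F = F} {L} e with F ∈? L
  ∈ᵇ-elim e  | yes F∈L = F∈L
  ∈ᵇ-elim () | no _

  _≡ᵇ_ : ∀ {m} → Vec Sign m → Vec Sign m → Bool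
  F ≡ᵇ G = does (F ≟ᵛ G)

  ≡ᵇ-refl : ∀ {m} (F : Vec Sign m) → (F ≡ᵇ F) ≡ true
  ≡ᵇ-refl F = dec-true (F ≟ᵛ F) ≡.refl

  ≡ᵇ-sound : ∀ {m} {F G : Vec Sign m} → (F ≡ᵇ G) ≡ true → F ≡ G
  ≡ᵇ-sound {F = F} {G} e with F ≟ᵛ G
  ≡ᵇ-sound e  | yes F≡G = F≡G
  ≡ᵇ-sound () | no _

  𝟙-∨ : ∀ a b → (a ∧ b ≡ true → ⊥) → 𝟙 (a ∨ b) ≈ 𝟙 a + 𝟙 b
  𝟙-∨ true true h = ⊥-elim (h ≡.refl)
  𝟙-∨ true false h = sym (+-identityʳ 1#)
  𝟙-∨ false b h = sym (+-identityˡ _)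

  monomial : ∀ {m} → Carrier → Carrier → Vec Sign m → Carrier
  monomial x y F = pow K x (count zer F) * pow K y (count neg F)

  genPoly≈∑ᵛ : ∀ {m} (L : List (Vec Sign m)) → Unique L → ∀ x y →
               genPoly K L x y ≈ ∑ᵛ (λ P → 𝟙 (P ∈ᵇ L) * monomial x y P)
  genPoly≈∑ᵛ {m} [] _ x y = sym (∑ᵛ-zero {m} (λ P → zeroˡ _))
  genPoly≈∑ᵛ {m} (F ∷ L) (F∉L ∷ unique) x y = begin
    monomial x y F + genPoly K L x y
      ≈⟨ +-cong (sym (trans (∑ᵛ-point F _ off) (trans (*-congʳ (reflexive (≡.cong 𝟙 (≡ᵇ-refl F)))) (*-identityˡ _))))
                (genPoly≈∑ᵛ L unique x y) ⟩
    ∑ᵛ (λ P → 𝟙 (P ≡ᵇ F) * monomial x y P) + ∑ᵛ (λ P → 𝟙 (P ∈ᵇ L) * monomial x y P)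
      ≈⟨ ∑ᵛ-+ {m} _ _ ⟨
    ∑ᵛ (λ P → 𝟙 (P ≡ᵇ F) * monomial x y P + 𝟙 (P ∈ᵇ L) * monomial x y P)
      ≈⟨ ∑ᵛ-cong {m} (λ P → trans (sym (distribʳ _ _ _)) (*-congʳ (sym (𝟙-∨ (P ≡ᵇ F) (P ∈ᵇ L) (disjoint P))))) ⟩
    ∑ᵛ (λ P → 𝟙 (P ∈ᵇ (F ∷ L)) * monomial x y P) ∎
    where
    off : ∀ P → P ≢ F → 𝟙 (P ≡ᵇ F) * monomial x y P ≈ 0#
    off P P≢F with P ≟ᵛ F
    ... | yes P≡F = ⊥-elim (P≢F P≡F)
    ... | no _ = zeroˡ _
    disjoint : ∀ P → (P ≡ᵇ F) ∧ (P ∈ᵇ L) ≡ true → ⊥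
    disjoint P h with P ≟ᵛ F
    ... | yes ≡.refl = All¬⇒¬Any F∉L (∈ᵇ-elim h)

module GeneratingPolynomials {c ℓ₁ ℓ₂} (K : OrderedField c ℓ₁ ℓ₂) where

  open import Data.Nat.Base as ℕ using (ℕ; zero; suc; _≤_; _∸_)
  open import Data.Bool.Base using (_∧_)
  open import Data.Bool.Properties using (∧-zeroʳ)
  open import Relation.Nullary.Decidable using (dec-true; dec-false)
  open import Relation.Binary.Definitions using (tri<; tri≈; tri>)
  import Data.Nat.Properties as ℕ
  open import Data.Vec.Base using (Vec; []; _∷_)
  open import Data.List.Base using (List; []; _∷_)
  open import Data.List.Relation.Unary.Unique.Propositional using (Unique)
  open import Relation.Binary.PropositionalEquality.Core as ≡ using (_≡_; _≢_)
  open import Relation.Nullary.Decidable.Core using (does; yes; no)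
  open import Data.Empty using (⊥-elim)

  open OrderedFieldProperties K
  open FiniteSums K using (𝟙)
  open SignVectors
  open SignVectorSums K

  pow-cong : ∀ {a b} m → a ≈ b → pow K a m ≈ pow K b m
  pow-cong zero _ = refl
  pow-cong (suc m) a≈b = *-cong a≈b (pow-cong m a≈b)

  pow-+ : ∀ a m k → pow K a (m ℕ.+ k) ≈ pow K a m * pow K a k
  pow-+ a zero k = sym (*-identityˡ _)
  pow-+ a (suc m) k = trans (*-congˡ (pow-+ a m k)) (sym (*-assoc _ _ _))

  pow-* : ∀ a b m → pow K (a * b) m ≈ pow K a m * pow K b m
  pow-* a b zero = sym (*-identityˡ 1#)
  pow-* a b (suc m) = trans (*-congˡ (pow-* a b m))
    (solve 4 (λ a b p q → (a :* b) :* (p :* q) := (a :* p) :* (b :* q)) refl a b (pow K a m) (pow K b m))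

  pow-1# : ∀ m → pow K 1# m ≈ 1#
  pow-1# zero = refl
  pow-1# (suc m) = trans (*-identityˡ _) (pow-1# m)

  -1^r*-1^m : ∀ {m r} → r ≤ m → pow K (- 1#) r * pow K (- 1#) m ≈ pow K (- 1#) (m ∸ r)
  -1^r*-1^m {m} {r} r≤m = begin
    pow K (- 1#) r * pow K (- 1#) m               ≈⟨ pow-+ (- 1#) r m ⟨
    pow K (- 1#) (r ℕ.+ m)                        ≡⟨ ≡.cong (pow K (- 1#)) r+m≡[m∸r]+[r+r] ⟩
    pow K (- 1#) ((m ∸ r) ℕ.+ (r ℕ.+ r))          ≈⟨ pow-+ (- 1#) (m ∸ r) (r ℕ.+ r) ⟩
    pow K (- 1#) (m ∸ r) * pow K (- 1#) (r ℕ.+ r) ≈⟨ *-congˡ -1^[r+r]≈1 ⟩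
    pow K (- 1#) (m ∸ r) * 1#                     ≈⟨ *-identityʳ _ ⟩
    pow K (- 1#) (m ∸ r)                          ∎
    where
    r+m≡[m∸r]+[r+r] : r ℕ.+ m ≡ (m ∸ r) ℕ.+ (r ℕ.+ r)
    r+m≡[m∸r]+[r+r] = ≡.trans (≡.cong (r ℕ.+_) (≡.sym (ℕ.m∸n+n≡m r≤m)))
      (≡.trans (≡.sym (ℕ.+-assoc r (m ∸ r) r)) (≡.trans (≡.cong (ℕ._+ r) (ℕ.+-comm r (m ∸ r))) (ℕ.+-assoc (m ∸ r) r r)))
    -1^[r+r]≈1 : pow K (- 1#) (r ℕ.+ r) ≈ 1#
    -1^[r+r]≈1 = trans (pow-+ (- 1#) r r) (trans (sym (pow-* (- 1#) (- 1#) r)) (trans (pow-cong r -1*-1≈1) (pow-1# r)))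

  monomial-cong : ∀ {m a a′ b b′} (F : Vec Sign m) → a ≈ a′ → b ≈ b′ → monomial a b F ≈ monomial a′ b′ F
  monomial-cong F a≈a′ b≈b′ = *-cong (pow-cong (count zer F) a≈a′) (pow-cong (count neg F) b≈b′)

  genPoly-cong : ∀ {m} (L : List (Vec Sign m)) {a a′ b b′} → a ≈ a′ → b ≈ b′ → genPoly K L a b ≈ genPoly K L a′ b′
  genPoly-cong [] _ _ = refl
  genPoly-cong (F ∷ L) a≈a′ b≈b′ = +-cong (monomial-cong F a≈a′ b≈b′) (genPoly-cong L a≈a′ b≈b′)

  monomial-zeros : ∀ m x y → monomial x y (zeros {m}) ≈ pow K x m
  monomial-zeros m x y rewrite count-zeros m | count-neg-zeros m = *-identityʳ _

  ∑ᵛ-monomial : ∀ m x y → ∑ᵛ {m} (monomial x y) ≈ pow K ((x + y) + 1#) m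
  ∑ᵛ-monomial zero x y = *-identityˡ 1#
  ∑ᵛ-monomial (suc m) x y = begin
    ∑ᵛ {m} (λ P → monomial x y (neg ∷ P)) + (∑ᵛ {m} (λ P → monomial x y (zer ∷ P)) + ∑ᵛ {m} (λ P → monomial x y (pos ∷ P)))
      ≈⟨ +-cong (trans (∑ᵛ-cong {m} (λ P → solve 3 (λ a b y → a :* (y :* b) := y :* (a :* b)) refl (pow K x (count zer P)) (pow K y (count neg P)) y)) (∑ᵛ-*ˡ {m} y (monomial x y)))
                (+-congʳ (trans (∑ᵛ-cong {m} (λ P → *-assoc _ _ _)) (∑ᵛ-*ˡ {m} x (monomial x y)))) ⟩
    y * T + (x * T + T)   ≈⟨ solve 3 (λ x y t → y :* t :+ (x :* t :+ t) := ((x :+ y) :+ :1) :* t) refl x y T ⟩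
    ((x + y) + 1#) * T    ≈⟨ *-congˡ (∑ᵛ-monomial m x y) ⟩
    pow K ((x + y) + 1#) (suc m) ∎
    where
    T : Carrier
    T = ∑ᵛ {m} (monomial x y)

  ∑ᵛ-at-zeros : ∀ m x y → ∑ᵛ {m} (λ G → 𝟙 (G ≡ᵇ zeros) * monomial x y G) ≈ pow K x m
  ∑ᵛ-at-zeros m x y = trans (∑ᵛ-point (zeros {m}) (λ G → 𝟙 (G ≡ᵇ zeros) * monomial x y G) off)
    (trans (*-congʳ (reflexive (≡.cong 𝟙 (≡ᵇ-refl (zeros {m}))))) (trans (*-identityˡ _) (monomial-zeros m x y)))
    where
    off : ∀ G → G ≢ zeros → 𝟙 (G ≡ᵇ zeros) * monomial x y G ≈ 0#
    off G G≢0 with G ≟ᵛ zeros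
    ... | yes G≡0 = ⊥-elim (G≢0 G≡0)
    ... | no _ = zeroˡ _

  altSign : ∀ {m} → Vec Sign m → Carrier
  altSign F = pow K (- 1#) (count zer F)

  χ : ∀ {m} → List (Vec Sign m) → Vec Sign m → Carrier
  χ L G = ∑ᵛ (λ F → 𝟙 (F ∈ᵇ L) * (𝟙 (G ⊑ F) * altSign F))

  module Substitution (x y w : Carrier) (hw : (x + 1#) * w ≈ 1#) where

    x′ y′ : Carrier
    x′ = - (x * w)
    y′ = (x + y) * w

    [x+1]y′≈x+y : (x + 1#) * y′ ≈ x + y
    [x+1]y′≈x+y = trans (solve 3 (λ x y w → (x :+ :1) :* ((x :+ y) :* w) := (x :+ y) :* ((x :+ :1) :* w)) refl x y w)
                        (trans (*-congˡ hw) (*-identityʳ _))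

    [x+1]x′≈-x : (x + 1#) * x′ ≈ - x
    [x+1]x′≈-x = trans (solve 2 (λ x w → (x :+ :1) :* (:- (x :* w)) := :- (x :* ((x :+ :1) :* w))) refl x w)
                       (-‿cong (trans (*-congˡ hw) (*-identityʳ _)))

    [x′+1][x+1]≈1 : (x′ + 1#) * (x + 1#) ≈ 1#
    [x′+1][x+1]≈1 = begin
      (x′ + 1#) * (x + 1#)          ≈⟨ solve 2 (λ x w → (:- (x :* w) :+ :1) :* (x :+ :1) := (x :+ :1) :- x :* ((x :+ :1) :* w)) refl x w ⟩
      (x + 1#) - x * ((x + 1#) * w) ≈⟨ +-congˡ (-‿cong (trans (*-congˡ hw) (*-identityʳ x))) ⟩
      (x + 1#) - x                  ≈⟨ solve 1 (λ x → (x :+ :1) :- x := :1) refl x ⟩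
      1#                            ∎

    -[x′[x+1]]≈x : - (x′ * (x + 1#)) ≈ x
    -[x′[x+1]]≈x = trans (solve 2 (λ x w → :- ((:- (x :* w)) :* (x :+ :1)) := x :* ((x :+ :1) :* w)) refl x w)
                         (trans (*-congˡ hw) (*-identityʳ x))

    [x′+y′][x+1]≈y : (x′ + y′) * (x + 1#) ≈ y
    [x′+y′][x+1]≈y = trans (solve 3 (λ x y w → (:- (x :* w) :+ (x :+ y) :* w) :* (x :+ :1) := y :* ((x :+ :1) :* w)) refl x y w)
                           (trans (*-congˡ hw) (*-identityʳ y))

    [x+1][[x′+y′]+1]≈[x+y]+1 : (x + 1#) * ((x′ + y′) + 1#) ≈ (x + y) + 1#
    [x+1][[x′+y′]+1]≈[x+y]+1 = begin
      (x + 1#) * ((x′ + y′) + 1#)      ≈⟨ solve 3 (λ x y w → (x :+ :1) :* ((:- (x :* w) :+ (x :+ y) :* w) :+ :1) := y :* ((x :+ :1) :* w) :+ (x :+ :1)) refl x y w ⟩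
      y * ((x + 1#) * w) + (x + 1#)    ≈⟨ +-congʳ (trans (*-congˡ hw) (*-identityʳ y)) ⟩
      y + (x + 1#)                     ≈⟨ solve 2 (λ x y → y :+ (x :+ :1) := (x :+ y) :+ :1) refl x y ⟩
      (x + y) + 1#                     ∎

    -- Summing over G ⊑ F coordinatewise: neg ↦ y + x, zer ↦ -x, pos ↦ x + 1, each (x + 1) times the new variable.
    ∑ᵛ-faces : ∀ {m} (F : Vec Sign m) →
               ∑ᵛ (λ G → (𝟙 (G ⊑ F) * altSign F) * monomial x y G) ≈ pow K (x + 1#) m * monomial x′ y′ F
    ∑ᵛ-faces [] = solve 0 ((:1 :* :1) :* (:1 :* :1) := :1 :* (:1 :* :1)) refl
    ∑ᵛ-faces {suc m} (neg ∷ F) = begin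
      ∑ᵛ {m} (λ G → (𝟙 (G ⊑ F) * altSign F) * monomial x y (neg ∷ G)) + (∑ᵛ {m} (λ G → (𝟙 (G ⊑ F) * altSign F) * monomial x y (zer ∷ G)) + ∑ᵛ {m} (λ G → (0# * altSign F) * monomial x y (pos ∷ G)))
        ≈⟨ +-cong (trans (∑ᵛ-cong {m} (λ G → solve 4 (λ a b c y → a :* (b :* (y :* c)) := y :* (a :* (b :* c))) refl (𝟙 (G ⊑ F) * altSign F) (pow K x (count zer G)) (pow K y (count neg G)) y)) (∑ᵛ-*ˡ {m} y _))
            (+-cong (trans (∑ᵛ-cong {m} (λ G → solve 4 (λ a b c x → a :* ((x :* b) :* c) := x :* (a :* (b :* c))) refl (𝟙 (G ⊑ F) * altSign F) (pow K x (count zer G)) (pow K y (count neg G)) x)) (∑ᵛ-*ˡ {m} x _))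
                    (∑ᵛ-zero {m} (λ G → trans (*-congʳ (zeroˡ _)) (zeroˡ _)))) ⟩
      y * T + (x * T + 0#)  ≈⟨ solve 3 (λ x y t → y :* t :+ (x :* t :+ :0) := (x :+ y) :* t) refl x y T ⟩
      (x + y) * T           ≈⟨ *-cong (sym [x+1]y′≈x+y) (∑ᵛ-faces F) ⟩
      ((x + 1#) * y′) * (pow K (x + 1#) m * monomial x′ y′ F)
        ≈⟨ solve 5 (λ a y p b c → (a :* y) :* (p :* (b :* c)) := (a :* p) :* (b :* (y :* c))) refl (x + 1#) y′ (pow K (x + 1#) m) (pow K x′ (count zer F)) (pow K y′ (count neg F)) ⟩
      pow K (x + 1#) (suc m) * monomial x′ y′ (neg ∷ F) ∎
      where
      T : Carrier
      T = ∑ᵛ {m} (λ G → (𝟙 (G ⊑ F) * altSign F) * monomial x y G)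
    ∑ᵛ-faces {suc m} (zer ∷ F) = begin
      ∑ᵛ {m} (λ G → (0# * (- 1# * altSign F)) * monomial x y (neg ∷ G)) + (∑ᵛ {m} (λ G → (𝟙 (G ⊑ F) * (- 1# * altSign F)) * monomial x y (zer ∷ G)) + ∑ᵛ {m} (λ G → (0# * (- 1# * altSign F)) * monomial x y (pos ∷ G)))
        ≈⟨ +-cong (∑ᵛ-zero {m} (λ G → trans (*-congʳ (zeroˡ _)) (zeroˡ _)))
            (+-cong (trans (∑ᵛ-cong {m} (λ G → solve 5 (λ a v b c x → (a :* (:-1 :* v)) :* ((x :* b) :* c) := (:- x) :* ((a :* v) :* (b :* c))) refl (𝟙 (G ⊑ F)) (altSign F) (pow K x (count zer G)) (pow K y (count neg G)) x)) (∑ᵛ-*ˡ {m} (- x) _))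
                    (∑ᵛ-zero {m} (λ G → trans (*-congʳ (zeroˡ _)) (zeroˡ _)))) ⟩
      0# + ((- x) * T + 0#) ≈⟨ solve 2 (λ x t → :0 :+ ((:- x) :* t :+ :0) := (:- x) :* t) refl x T ⟩
      (- x) * T             ≈⟨ *-cong (sym [x+1]x′≈-x) (∑ᵛ-faces F) ⟩
      ((x + 1#) * x′) * (pow K (x + 1#) m * monomial x′ y′ F)
        ≈⟨ solve 5 (λ a x p b c → (a :* x) :* (p :* (b :* c)) := (a :* p) :* ((x :* b) :* c)) refl (x + 1#) x′ (pow K (x + 1#) m) (pow K x′ (count zer F)) (pow K y′ (count neg F)) ⟩
      pow K (x + 1#) (suc m) * monomial x′ y′ (zer ∷ F) ∎
      where
      T : Carrier
      T = ∑ᵛ {m} (λ G → (𝟙 (G ⊑ F) * altSign F) * monomial x y G)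
    ∑ᵛ-faces {suc m} (pos ∷ F) = begin
      ∑ᵛ {m} (λ G → (0# * altSign F) * monomial x y (neg ∷ G)) + (∑ᵛ {m} (λ G → (𝟙 (G ⊑ F) * altSign F) * monomial x y (zer ∷ G)) + ∑ᵛ {m} (λ G → (𝟙 (G ⊑ F) * altSign F) * monomial x y (pos ∷ G)))
        ≈⟨ +-cong (∑ᵛ-zero {m} (λ G → trans (*-congʳ (zeroˡ _)) (zeroˡ _)))
            (+-congʳ (trans (∑ᵛ-cong {m} (λ G → solve 4 (λ a b c x → a :* ((x :* b) :* c) := x :* (a :* (b :* c))) refl (𝟙 (G ⊑ F) * altSign F) (pow K x (count zer G)) (pow K y (count neg G)) x)) (∑ᵛ-*ˡ {m} x _))) ⟩
      0# + (x * T + T)      ≈⟨ solve 2 (λ x t → :0 :+ (x :* t :+ t) := (x :+ :1) :* t) refl x T ⟩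
      (x + 1#) * T          ≈⟨ *-congˡ (∑ᵛ-faces F) ⟩
      (x + 1#) * (pow K (x + 1#) m * monomial x′ y′ F) ≈⟨ *-assoc _ _ _ ⟨
      pow K (x + 1#) (suc m) * monomial x′ y′ (pos ∷ F) ∎
      where
      T : Carrier
      T = ∑ᵛ {m} (λ G → (𝟙 (G ⊑ F) * altSign F) * monomial x y G)

    ∑ᵛ-χ : ∀ {m} (L : List (Vec Sign m)) → Unique L →
           ∑ᵛ {m} (λ G → χ L G * monomial x y G) ≈ pow K (x + 1#) m * genPoly K L x′ y′
    ∑ᵛ-χ {m} L L-unique = begin
      ∑ᵛ (λ G → χ L G * monomial x y G)
        ≈⟨ ∑ᵛ-cong {m} (λ G → trans (sym (∑ᵛ-*ʳ {m} (monomial x y G) _)) (∑ᵛ-cong {m} (λ F → *-assoc _ _ _))) ⟩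
      ∑ᵛ (λ G → ∑ᵛ (λ F → 𝟙 (F ∈ᵇ L) * ((𝟙 (G ⊑ F) * altSign F) * monomial x y G)))
        ≈⟨ ∑ᵛ-comm {m} {m} _ ⟩
      ∑ᵛ (λ F → ∑ᵛ (λ G → 𝟙 (F ∈ᵇ L) * ((𝟙 (G ⊑ F) * altSign F) * monomial x y G)))
        ≈⟨ ∑ᵛ-cong {m} (λ F → trans (∑ᵛ-*ˡ {m} (𝟙 (F ∈ᵇ L)) _) (*-congˡ (∑ᵛ-faces F))) ⟩
      ∑ᵛ (λ F → 𝟙 (F ∈ᵇ L) * (pow K (x + 1#) m * monomial x′ y′ F))
        ≈⟨ ∑ᵛ-cong {m} (λ F → solve 3 (λ a b c → a :* (b :* c) := b :* (a :* c)) refl (𝟙 (F ∈ᵇ L)) (pow K (x + 1#) m) (monomial x′ y′ F)) ⟩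
      ∑ᵛ (λ F → pow K (x + 1#) m * (𝟙 (F ∈ᵇ L) * monomial x′ y′ F))
        ≈⟨ ∑ᵛ-*ˡ {m} _ _ ⟩
      pow K (x + 1#) m * ∑ᵛ (λ F → 𝟙 (F ∈ᵇ L) * monomial x′ y′ F)
        ≈⟨ *-congˡ (genPoly≈∑ᵛ L L-unique x′ y′) ⟨
      pow K (x + 1#) m * genPoly K L x′ y′ ∎

  jumps : ℕ → ℕ → Carrier
  jumps q k = 𝟙 (does (1 ℕ.≤? q) ∧ does (q ℕ.≤? k)) * pow K (- 1#) (q ∸ 1)

  jumps-zero : ∀ q → jumps q 0 ≈ 0#
  jumps-zero zero = zeroˡ _
  jumps-zero (suc q) = zeroˡ _

  jumps-step : ∀ q m → jumps q (suc m) ≈ jumps q m + 𝟙 (does (suc m ℕ.≟ q)) * pow K (- 1#) m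
  jumps-step q m with ℕ.<-cmp (suc m) q
  ... | tri< 1+m<q _ _
    rewrite dec-false (q ℕ.≤? suc m) (ℕ.<⇒≱ 1+m<q) | dec-false (q ℕ.≤? m) (ℕ.<⇒≱ (ℕ.<-trans (ℕ.n<1+n m) 1+m<q))
          | dec-false (suc m ℕ.≟ q) (ℕ.<⇒≢ 1+m<q) | ∧-zeroʳ (does (1 ℕ.≤? q)) =
    solve 2 (λ a b → :0 :* a := :0 :* a :+ :0 :* b) refl _ _
  ... | tri≈ _ ≡.refl _
    rewrite dec-true (suc m ℕ.≤? suc m) ℕ.≤-refl | dec-false (suc m ℕ.≤? m) (ℕ.n≮n m)
          | dec-true (suc m ℕ.≟ suc m) ≡.refl =
    solve 2 (λ a b → :1 :* a := :0 :* a :+ :1 :* a) refl (pow K (- 1#) m) (pow K (- 1#) m)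
  ... | tri> _ _ q<1+m
    rewrite dec-true (q ℕ.≤? suc m) (ℕ.<⇒≤ q<1+m) | dec-true (q ℕ.≤? m) (ℕ.≤-pred q<1+m)
          | dec-false (suc m ℕ.≟ q) (ℕ.>⇒≢ q<1+m) =
    sym (trans (+-congˡ (zeroˡ _)) (+-identityʳ _))

  CoefficientIdentity : ∀ {m} → List (Vec Sign m) → List (Vec Sign m) → ℕ → Set ℓ₁
  CoefficientIdentity L L* r = ∀ G → 𝟙 (G ∈ᵇ L*) ≈ (1# - pow K (- 1#) r * 𝟙 (G ≡ᵇ zeros)) - χ L G

  dual-identity : ∀ {m} (L L* : List (Vec Sign m)) → Unique L → Unique L* → ∀ r → CoefficientIdentity L L* r →
    ∀ x y w → (x + 1#) * w ≈ 1# →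
    genPoly K L* x y ≈ (pow K ((x + y) + 1#) m - pow K (- 1#) r * pow K x m)
                       - pow K (x + 1#) m * genPoly K L (- (x * w)) ((x + y) * w)
  dual-identity {m} L L* L-unique L*-unique r coefficients x y w hw = begin
    genPoly K L* x y
      ≈⟨ genPoly≈∑ᵛ L* L*-unique x y ⟩
    ∑ᵛ (λ G → 𝟙 (G ∈ᵇ L*) * monomial x y G)
      ≈⟨ ∑ᵛ-cong {m} (λ G → *-congʳ (coefficients G)) ⟩
    ∑ᵛ (λ G → ((1# - σ * 𝟙 (G ≡ᵇ zeros)) - χ L G) * monomial x y G)
      ≈⟨ ∑ᵛ-cong {m} (λ G → solve 4 (λ c b g mo → ((:1 :- c :* b) :- g) :* mo := (mo :+ (:- (c :* (b :* mo)))) :+ (:- (g :* mo))) refl σ (𝟙 (G ≡ᵇ zeros)) (χ L G) (monomial x y G)) ⟩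
    ∑ᵛ (λ G → (monomial x y G + - (σ * (𝟙 (G ≡ᵇ zeros) * monomial x y G))) + - (χ L G * monomial x y G))
      ≈⟨ trans (∑ᵛ-+ {m} _ _) (+-cong (trans (∑ᵛ-+ {m} _ _) (+-congˡ (trans (∑ᵛ-neg {m} _) (-‿cong (∑ᵛ-*ˡ {m} σ _))))) (∑ᵛ-neg {m} _)) ⟩
    (∑ᵛ {m} (monomial x y) - σ * ∑ᵛ {m} (λ G → 𝟙 (G ≡ᵇ zeros) * monomial x y G)) - ∑ᵛ {m} (λ G → χ L G * monomial x y G)
      ≈⟨ +-cong (+-cong (∑ᵛ-monomial m x y) (-‿cong (*-congˡ (∑ᵛ-at-zeros m x y)))) (-‿cong (∑ᵛ-χ L L-unique)) ⟩
    (pow K ((x + y) + 1#) m - σ * pow K x m) - pow K (x + 1#) m * genPoly K L x′ y′ ∎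
    where
    open Substitution x y w hw
    σ : Carrier
    σ = pow K (- 1#) r

  primal-identity : ∀ {m} (L L* : List (Vec Sign m)) → Unique L → Unique L* → ∀ {r} → r ≤ m →
    CoefficientIdentity L L* r →
    ∀ x y w → (x + 1#) * w ≈ 1# →
    genPoly K L x y ≈ (pow K ((x + y) + 1#) m - pow K (- 1#) (m ∸ r) * pow K x m)
                      - pow K (x + 1#) m * genPoly K L* (- (x * w)) ((x + y) * w)
  primal-identity {m} L L* L-unique L*-unique {r} r≤m coefficients x y w hw = begin
    A                             ≈⟨ solve 2 (λ p a → a := p :- (p :- :1 :* a)) refl P A ⟩
    P - (P - 1# * A)              ≈⟨ +-congˡ (-‿cong (sym QB≈P-A)) ⟩
    P - Q * B                     ≈⟨ +-congʳ (+-congˡ (-‿cong (*-congʳ (-1^r*-1^m r≤m)))) ⟩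
    (pow K ((x + y) + 1#) m - pow K (- 1#) (m ∸ r) * pow K x m) - Q * B ∎
    where
    open Substitution x y w hw
    A B Q P : Carrier
    A = genPoly K L x y
    B = genPoly K L* x′ y′
    Q = pow K (x + 1#) m
    P = pow K ((x + y) + 1#) m - (pow K (- 1#) r * pow K (- 1#) m) * pow K x m
    -- The substitution (x, y) ↦ (x′, y′) is an involution, with x + 1 = 1 / (x′ + 1).
    B≈ : B ≈ (pow K ((x′ + y′) + 1#) m - pow K (- 1#) r * pow K x′ m) - pow K (x′ + 1#) m * A
    B≈ = trans (dual-identity L L* L-unique L*-unique r coefficients x′ y′ (x + 1#) [x′+1][x+1]≈1)
               (+-congˡ (-‿cong (*-congˡ (genPoly-cong L -[x′[x+1]]≈x [x′+y′][x+1]≈y))))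
    QE : Q * pow K ((x′ + y′) + 1#) m ≈ pow K ((x + y) + 1#) m
    QE = trans (sym (pow-* (x + 1#) _ m)) (pow-cong m [x+1][[x′+y′]+1]≈[x+y]+1)
    QX : Q * pow K x′ m ≈ pow K (- 1#) m * pow K x m
    QX = trans (sym (pow-* (x + 1#) x′ m))
               (trans (pow-cong m (trans [x+1]x′≈-x (solve 1 (λ x → :- x := :-1 :* x) refl x))) (pow-* (- 1#) x m))
    QW : Q * pow K (x′ + 1#) m ≈ 1#
    QW = trans (sym (pow-* (x + 1#) (x′ + 1#) m)) (trans (pow-cong m (trans (*-comm _ _) [x′+1][x+1]≈1)) (pow-1# m))
    QB≈P-A : Q * B ≈ P - 1# * A
    QB≈P-A = begin
      Q * B
        ≈⟨ *-congˡ B≈ ⟩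
      Q * ((pow K ((x′ + y′) + 1#) m - pow K (- 1#) r * pow K x′ m) - pow K (x′ + 1#) m * A)
        ≈⟨ solve 6 (λ q e c x w a → q :* ((e :- c :* x) :- w :* a) := (q :* e :- c :* (q :* x)) :- (q :* w) :* a) refl Q (pow K ((x′ + y′) + 1#) m) (pow K (- 1#) r) (pow K x′ m) (pow K (x′ + 1#) m) A ⟩
      (Q * pow K ((x′ + y′) + 1#) m - pow K (- 1#) r * (Q * pow K x′ m)) - (Q * pow K (x′ + 1#) m) * A
        ≈⟨ +-cong (+-cong QE (-‿cong (*-congˡ QX))) (-‿cong (*-congʳ QW)) ⟩
      (pow K ((x + y) + 1#) m - pow K (- 1#) r * (pow K (- 1#) m * pow K x m)) - 1# * A
        ≈⟨ +-congʳ (+-congˡ (-‿cong (sym (*-assoc _ _ _)))) ⟩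
      P - 1# * A ∎

module GeneralPositionProperties {c ℓ₁ ℓ₂} (K : OrderedField c ℓ₁ ℓ₂)
  {r n} (r≤n : r ≤ n) (V : Matrix K r n) (general : GeneralPosition K V) where

  open import Data.Nat.Base as ℕ using (ℕ; zero; suc; _≤_)
  import Data.Nat.Properties as ℕ
  open import Data.Fin.Base using (Fin; zero; suc)
  open import Data.Bool.Base using (true; false)
  open import Data.Bool.Properties using (not-¬)
  open import Data.Product.Base using (∃; _×_; _,_)
  open import Data.Sum.Base using (inj₁; inj₂)
  open import Data.Empty using (⊥-elim)
  open import Relation.Nullary.Negation.Core using (¬_)
  open import Relation.Nullary.Decidable.Core using (yes; no)
  open import Relation.Binary.PropositionalEquality.Core as ≡ using (_≡_)

  open OrderedFieldProperties K
  open FiniteSums K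
  open BooleanSubsets
  open LinearElimination K

  column : Fin n → Fin r → Carrier
  column j l = V l j

  ⟨_,_⟩ : Fin n → (Fin r → Carrier) → Carrier
  ⟨ j , u ⟩ = ∑ K (λ l → V l j * u l)

  IsDependency : (Fin n → Carrier) → Set ℓ₁
  IsDependency μ = ∀ i → ∑ K (λ j → V i j * μ j) ≈ 0#

  general-of-size : ∀ {m} → m ≡ r → (σ : Fin m → Fin n) → (∀ {k l} → σ k ≡ σ l → k ≡ l) →
             (μ : Fin m → Carrier) → (∀ i → ∑ K (λ k → V i (σ k) * μ k) ≈ 0#) → ∀ k → μ k ≈ 0#
  general-of-size ≡.refl = general

  small-dependency-vanishes : ∀ (J : Subset n) → ∣ J ∣ ≤ r → ∀ {μ} → SupportedOn μ J → IsDependency μ →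
                              ∀ j → μ j ≈ 0#
  small-dependency-vanishes J ∣J∣≤r {μ} supp dep j with superset-of-size J r ∣J∣≤r r≤n
  ... | J′ , J⊆J′ , ∣J′∣≡r = vanish
    where
    supp′ : SupportedOn μ J′
    supp′ j J′j with J j in Jj
    ... | true = ⊥-elim (not-¬ (J⊆J′ j Jj) J′j)
    ... | false = supp j Jj
    μ′ : Fin ∣ J′ ∣ → Carrier
    μ′ k = μ (enumerate J′ k)
    dep′ : ∀ i → ∑ K (λ k → V i (enumerate J′ k) * μ′ k) ≈ 0#
    dep′ i = trans (∑-enumerate J′ (λ j → V i j * μ j) (λ j J′j → trans (*-congˡ (supp′ j J′j)) (zeroʳ _))) (dep i)
    vanish : μ j ≈ 0#
    vanish with J′ j in J′j
    ... | false = supp′ j J′j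
    ... | true with enumerate-surjective J′ j J′j
    ...   | k , k↦j = trans (reflexive (≡.cong μ (≡.sym k↦j)))
                            (general-of-size ∣J′∣≡r (enumerate J′) (enumerate-injective J′) μ′ dep′ k)

  dependency-support-exceeds-r : ∀ (J : Subset n) {μ} → SupportedOn μ J → Nonzero μ → IsDependency μ → r ℕ.< ∣ J ∣
  dependency-support-exceeds-r J supp (j , μj≉0) dep with r ℕ.<? ∣ J ∣
  ... | yes r<∣J∣ = r<∣J∣
  ... | no r≮∣J∣ = ⊥-elim (μj≉0 (small-dependency-vanishes J (ℕ.≮⇒≥ r≮∣J∣) supp dep j))

  unit-and-columns : Fin r → Fin (suc n) → Fin r → Carrier
  unit-and-columns i zero l = δ i l
  unit-and-columns i (suc j) l = V l j

  -- Otherwise the unit vector e_i and r columns orthogonal to u are dependent, and pairing with u kills e_i.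
  orthogonal-to-r-columns : ∀ (J : Subset n) → r ≤ ∣ J ∣ → ∀ u → (∀ j → J j ≡ true → ⟨ j , u ⟩ ≈ 0#) → ¬ Nonzero u
  orthogonal-to-r-columns J r≤∣J∣ u u⊥J (i , ui≉0) with subset-of-size J r r≤∣J∣
  ... | R , R⊆J , ∣R∣≡r with dependent-or-solvable r (unit-and-columns i) (λ { zero → true ; (suc j) → R j })
  ... | inj₂ (∣R⁺∣≤r , _) = ℕ.1+n≰n (≡.subst (λ k → suc k ≤ r) ∣R∣≡r ∣R⁺∣≤r)
  ... | inj₁ (μ , supp , (k , μk≉0) , dep) = μk≉0 (μ≈0 k)
    where
    tail≈0 : ∑ K (λ j → ⟨ j , u ⟩ * μ (suc j)) ≈ 0#
    tail≈0 = ∑-zero term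
      where
      term : ∀ j → ⟨ j , u ⟩ * μ (suc j) ≈ 0#
      term j with R j in Rj
      ... | true = trans (*-congʳ (u⊥J j (R⊆J j Rj))) (zeroˡ _)
      ... | false = trans (*-congˡ (supp (suc j) Rj)) (zeroʳ _)
    μ0≈0 : μ zero ≈ 0#
    μ0≈0 = *-cancelˡ-≈0 ui≉0 (begin
      u i * μ zero                                       ≈⟨ +-identityʳ _ ⟨
      u i * μ zero + 0#                                  ≈⟨ +-cong (*-congʳ (sym (∑-δ i u))) (sym tail≈0) ⟩
      ∑ K (λ l → δ i l * u l) * μ zero + ∑ K (λ j → ⟨ j , u ⟩ * μ (suc j)) ≈⟨ ∑-transpose (unit-and-columns i) u μ ⟨
      ∑ K (λ l → u l * ∑ K (λ j → unit-and-columns i j l * μ j)) ≈⟨ ∑-zero (λ l → trans (*-congˡ (dep l)) (zeroʳ _)) ⟩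
      0#                                                 ∎)
    tail-dependency : IsDependency (λ j → μ (suc j))
    tail-dependency i = trans (sym (+-identityˡ _)) (trans (+-congʳ (sym (trans (*-congˡ μ0≈0) (zeroʳ _)))) (dep i))
    μ≈0 : ∀ k → μ k ≈ 0#
    μ≈0 zero = μ0≈0
    μ≈0 (suc j) = small-dependency-vanishes R (ℕ.≤-reflexive ∣R∣≡r) (λ j → supp (suc j)) tail-dependency j

  orthogonal-nonzero⇒∣J∣<r : ∀ (J : Subset n) u → Nonzero u → (∀ j → J j ≡ true → ⟨ j , u ⟩ ≈ 0#) → ∣ J ∣ ℕ.< r
  orthogonal-nonzero⇒∣J∣<r J u u≉0 u⊥J with r ℕ.≤? ∣ J ∣
  ... | yes r≤∣J∣ = ⊥-elim (orthogonal-to-r-columns J r≤∣J∣ u u⊥J u≉0)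
  ... | no r≰∣J∣ = ℕ.≰⇒> r≰∣J∣

  few-columns-have-orthogonal : ∀ (J : Subset n) → ∣ J ∣ ℕ.< r → ∃ λ u → Nonzero u × (∀ j → J j ≡ true → ⟨ j , u ⟩ ≈ 0#)
  few-columns-have-orthogonal J ∣J∣<r with dependent-or-solvable ∣ J ∣ (λ i l → V i (enumerate J l)) full
  ... | inj₂ (∣full∣≤∣J∣ , _) = ⊥-elim (ℕ.<⇒≱ ∣J∣<r (≡.subst (_≤ ∣ J ∣) ∣full∣ ∣full∣≤∣J∣))
  ... | inj₁ (u , _ , u≉0 , u⊥) = u , u≉0 , u⊥J
    where
    u⊥J : ∀ j → J j ≡ true → ⟨ j , u ⟩ ≈ 0#
    u⊥J j Jj with enumerate-surjective J j Jj
    ... | k , ≡.refl = u⊥ k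

  few-columns-solvable : ∀ (J : Subset n) → ∣ J ∣ ≤ r → SolvableOn column J
  few-columns-solvable J ∣J∣≤r with dependent-or-solvable r column J
  ... | inj₂ (_ , solvable) = solvable
  ... | inj₁ (μ , supp , (j , μj≉0) , dep) = ⊥-elim (μj≉0 (small-dependency-vanishes J ∣J∣≤r supp dep j))

module SignPatterns {c ℓ₁ ℓ₂} (K : OrderedField c ℓ₁ ℓ₂)
  {r n} (r≤n : r ≤ n) (V : Matrix K r n) (general : GeneralPosition K V) where

  open import Level using (_⊔_)
  open import Data.Nat.Base as ℕ using (ℕ; zero; suc)
  import Data.Nat.Properties as ℕ
  open import Data.Fin.Base using (Fin; zero; suc)
  open import Data.Fin.Properties using (_≟_)
  open import Data.Bool.Base using (true; false; _∧_; _∨_; not)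
  open import Data.Bool.Properties using (not-¬)
  open import Data.Product.Base using (∃; _×_; _,_; proj₁; proj₂)
  open import Data.Sum.Base using (_⊎_; inj₁; inj₂)
  open import Data.Empty using (⊥-elim)
  open import Relation.Nullary.Negation.Core using (¬_)
  open import Relation.Nullary.Decidable.Core using (does; yes; no; toSum)
  open import Relation.Binary.PropositionalEquality.Core as ≡ using (_≡_; _≢_)

  open OrderedFieldProperties K
  open FiniteSums K
  open BooleanSubsets
  open LinearElimination K
  open SignVectors
  open SignFunction K
  open GeneralPositionProperties K r≤n V general

  Realises : (Fin n → Sign) → (Fin r → Carrier) → Set ℓ₂
  Realises g u = ∀ j → isNonzero (g j) ≡ true → Positive (signValue (g j) * ⟨ j , u ⟩)

  ExactDependency : (Fin n → Sign) → (Fin n → Carrier) → Set (ℓ₁ ⊔ ℓ₂)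
  ExactDependency g μ =
    IsDependency μ × (∀ j → isNonzero (g j) ≡ true → Positive (signValue (g j) * μ j)) ×
    (∀ j → isNonzero (g j) ≡ false → μ j ≈ 0#)

  support : (Fin n → Carrier) → Subset n
  support μ j = not (does (μ j ≈? 0#))

  support⇒≉0 : ∀ μ {j} → support μ j ≡ true → ¬ (μ j ≈ 0#)
  support⇒≉0 μ {j} h with μ j ≈? 0#
  ... | no μj≉0 = μj≉0

  ¬support⇒≈0 : ∀ μ {j} → support μ j ≡ false → μ j ≈ 0#
  ¬support⇒≈0 μ {j} h with μ j ≈? 0#
  ... | yes μj≈0 = μj≈0

  ≈0⇒¬support : ∀ μ {j} → μ j ≈ 0# → support μ j ≡ false
  ≈0⇒¬support μ {j} μj≈0 with μ j ≈? 0#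
  ... | yes _ = ≡.refl
  ... | no μj≉0 = ⊥-elim (μj≉0 μj≈0)

  ≉0⇒support : ∀ μ {j} → ¬ (μ j ≈ 0#) → support μ j ≡ true
  ≉0⇒support μ {j} μj≉0 with μ j ≈? 0#
  ... | yes μj≈0 = ⊥-elim (μj≉0 μj≈0)
  ... | no _ = ≡.refl

  record PartialDependency (g : Fin n → Sign) (Z : Subset n) : Set (c ⊔ ℓ₁ ⊔ ℓ₂) where
    field
      μ : Fin n → Carrier
      dependency : IsDependency μ
      nonzero : Nonzero μ
      vanishes-off-g : ∀ j → isNonzero (g j) ≡ false → μ j ≈ 0#
      Z⊆supp-g : ∀ j → Z j ≡ true → isNonzero (g j) ≡ true
      vanishes-on-Z : ∀ j → Z j ≡ true → μ j ≈ 0#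
      signs-off-Z : ∀ j → isNonzero (g j) ≡ true → Z j ≡ false → Positive (signValue (g j) * μ j)

  -- Any r nonzero coordinates of μ together with e carry a dependency ν with ν e ≠ 0; μ + ε ν fixes e.
  module FillStep {g : Fin n → Sign} {Z : Subset n} (partial : PartialDependency g Z) {e} (Ze : Z e ≡ true) where
    open PartialDependency partial

    T : Subset n
    T = support μ

    Te : T e ≡ false
    Te with T e in eq
    ... | true = ⊥-elim (support⇒≉0 μ eq (vanishes-on-Z e Ze))
    ... | false = ≡.refl

    r<∣T∣ : r ℕ.< ∣ T ∣
    r<∣T∣ = dependency-support-exceeds-r T (λ j → ¬support⇒≈0 μ) nonzero dependency

    R : Subset n
    R = proj₁ (subset-of-size T r (ℕ.<⇒≤ r<∣T∣))

    R⊆T : R ⊆ T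
    R⊆T = proj₁ (proj₂ (subset-of-size T r (ℕ.<⇒≤ r<∣T∣)))

    ∣R∣≡r : ∣ R ∣ ≡ r
    ∣R∣≡r = proj₂ (proj₂ (subset-of-size T r (ℕ.<⇒≤ r<∣T∣)))

    outside-R : ∀ {j} → T j ≡ false → R j ≡ false
    outside-R {j} Tj with R j in Rj
    ... | true = ⊥-elim (not-¬ (R⊆T j Rj) Tj)
    ... | false = ≡.refl

    R⁺ : Subset n
    R⁺ j = R j ∨ ⁅ e ⁆ j

    ν-exists : ∃ λ ν → DependencyOn column R⁺ ν
    ν-exists with dependent-or-solvable r column R⁺
    ... | inj₁ dep = dep
    ... | inj₂ (∣R⁺∣≤r , _) = ⊥-elim (ℕ.1+n≰n (≡.subst (ℕ._≤ r) ∣R⁺∣≡1+r ∣R⁺∣≤r))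
      where
      ∣R⁺∣≡1+r : ∣ R⁺ ∣ ≡ suc r
      ∣R⁺∣≡1+r = ≡.trans (∣∪⁅p⁆∣ R e (outside-R Te)) (≡.cong suc ∣R∣≡r)

    ν : Fin n → Carrier
    ν = proj₁ ν-exists

    ν-dependency : IsDependency ν
    ν-dependency = proj₂ (proj₂ (proj₂ ν-exists))

    ν-outside : ∀ {j} → R⁺ j ≡ false → ν j ≈ 0#
    ν-outside = proj₁ (proj₂ ν-exists) _

    R⁺-false : ∀ {j} → R j ≡ false → j ≢ e → R⁺ j ≡ false
    R⁺-false Rj j≢e rewrite Rj | ⁅p⁆j j≢e = ≡.refl

    νe≉0 : ¬ (ν e ≈ 0#)
    νe≉0 νe≈0 with proj₁ (proj₂ (proj₂ ν-exists))
    ... | k , νk≉0 = νk≉0 (small-dependency-vanishes R (ℕ.≤-reflexive ∣R∣≡r) supp-R ν-dependency k)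
      where
      supp-R : SupportedOn ν R
      supp-R j Rj with toSum (j ≟ e)
      ... | inj₁ ≡.refl = νe≈0
      ... | inj₂ j≢e = ν-outside (R⁺-false Rj j≢e)

    κ : Carrier
    κ = signValue (g e) * ν e ⁻¹⟨ νe≉0 ⟩

    ν′ : Fin n → Carrier
    ν′ j = κ * ν j

    ν′e≈σ : ν′ e ≈ signValue (g e)
    ν′e≈σ = begin
      (signValue (g e) * ν e ⁻¹⟨ νe≉0 ⟩) * ν e   ≈⟨ solve 3 (λ a b c → (a :* b) :* c := a :* (c :* b)) refl (signValue (g e)) (ν e ⁻¹⟨ νe≉0 ⟩) (ν e) ⟩
      signValue (g e) * (ν e * ν e ⁻¹⟨ νe≉0 ⟩) ≈⟨ *-congˡ (*-inverseʳ (ν e) νe≉0) ⟩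
      signValue (g e) * 1#                     ≈⟨ *-identityʳ _ ⟩
      signValue (g e)                          ∎

    ν′-off : ∀ {j} → T j ≡ false → j ≢ e → ν′ j ≈ 0#
    ν′-off Tj j≢e = trans (*-congˡ (ν-outside (R⁺-false (outside-R Tj) j≢e))) (zeroʳ κ)

    T-positive : ∀ j → T j ≡ true → Positive (signValue (g j) * μ j)
    T-positive j Tj with isNonzero (g j) in gj | Z j in Zj
    ... | false | _ = ⊥-elim (support⇒≉0 μ Tj (vanishes-off-g j gj))
    ... | true | true = ⊥-elim (support⇒≉0 μ Tj (vanishes-on-Z j Zj))
    ... | true | false = signs-off-Z j gj Zj

    ε : Carrier
    ε = proj₁ (small-perturbation-pos T (λ j → signValue (g j) * μ j) (λ j → signValue (g j) * ν′ j) T-positive)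

    0<ε : Positive ε
    0<ε = proj₁ (proj₂ (small-perturbation-pos T (λ j → signValue (g j) * μ j) (λ j → signValue (g j) * ν′ j) T-positive))

    ε-small : ∀ j → T j ≡ true → Positive (signValue (g j) * μ j + ε * (signValue (g j) * ν′ j))
    ε-small = proj₂ (proj₂ (small-perturbation-pos T (λ j → signValue (g j) * μ j) (λ j → signValue (g j) * ν′ j) T-positive))

    μ′ : Fin n → Carrier
    μ′ j = μ j + ε * ν′ j

    μ′-off : ∀ {j} → T j ≡ false → j ≢ e → μ′ j ≈ 0#
    μ′-off Tj j≢e = trans (+-cong (¬support⇒≈0 μ Tj) (trans (*-congˡ (ν′-off Tj j≢e)) (zeroʳ ε))) (+-identityʳ 0#)

    μ′e : signValue (g e) * μ′ e ≈ ε
    μ′e = begin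
      signValue (g e) * (μ e + ε * ν′ e)          ≈⟨ *-congˡ (+-cong (vanishes-on-Z e Ze) (*-congˡ ν′e≈σ)) ⟩
      signValue (g e) * (0# + ε * signValue (g e)) ≈⟨ solve 2 (λ s e → s :* (:0 :+ e :* s) := e :* (s :* s)) refl (signValue (g e)) ε ⟩
      ε * (signValue (g e) * signValue (g e))     ≈⟨ *-congˡ (signValue²≈1 (g e) (Z⊆supp-g e Ze)) ⟩
      ε * 1#                                      ≈⟨ *-identityʳ ε ⟩
      ε                                           ∎

    μ′-dependency : IsDependency μ′
    μ′-dependency i = begin
      ∑ K (λ j → V i j * μ′ j)
        ≈⟨ ∑-cong (λ j → solve 5 (λ v m e k n → v :* (m :+ e :* (k :* n)) := v :* m :+ (e :* k) :* (v :* n)) refl (V i j) (μ j) ε κ (ν j)) ⟩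
      ∑ K (λ j → V i j * μ j + (ε * κ) * (V i j * ν j))
        ≈⟨ ∑-+ (λ j → V i j * μ j) (λ j → (ε * κ) * (V i j * ν j)) ⟩
      ∑ K (λ j → V i j * μ j) + ∑ K (λ j → (ε * κ) * (V i j * ν j))
        ≈⟨ +-cong (dependency i) (trans (∑-*ˡ (ε * κ) (λ j → V i j * ν j)) (trans (*-congˡ (ν-dependency i)) (zeroʳ _))) ⟩
      0# + 0#
        ≈⟨ +-identityʳ 0# ⟩
      0# ∎

    off-support : ∀ {j} → μ j ≈ 0# → T j ≡ false
    off-support {j} μj≈0 with T j in Tj
    ... | true = ⊥-elim (support⇒≉0 μ Tj μj≈0)
    ... | false = ≡.refl

    step : PartialDependency g (Z ∖ e)
    step = record
      { μ = μ′
      ; dependency = μ′-dependency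
      ; nonzero = e , λ μ′e≈0 → pos⇒≉0 0<ε (trans (sym μ′e) (trans (*-congˡ μ′e≈0) (zeroʳ _)))
      ; vanishes-off-g = λ j gj → μ′-off (off-support (vanishes-off-g j gj)) (λ { ≡.refl → not-¬ (Z⊆supp-g e Ze) gj })
      ; Z⊆supp-g = λ j Z′j → Z⊆supp-g j (∖-⊆ Z e j Z′j)
      ; vanishes-on-Z = on-Z′
      ; signs-off-Z = off-Z′
      }
      where
      on-Z′ : ∀ j → (Z ∖ e) j ≡ true → μ′ j ≈ 0#
      on-Z′ j Z′j with toSum (j ≟ e)
      ... | inj₁ ≡.refl = ⊥-elim (not-¬ Z′j (∖-removes Z e))
      ... | inj₂ j≢e = μ′-off (off-support (vanishes-on-Z j (∖-⊆ Z e j Z′j))) j≢e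
      off-Z′ : ∀ j → isNonzero (g j) ≡ true → (Z ∖ e) j ≡ false → Positive (signValue (g j) * μ′ j)
      off-Z′ j gj Z′j with toSum (j ≟ e)
      ... | inj₁ ≡.refl = pos-resp-≈ (sym μ′e) 0<ε
      ... | inj₂ j≢e = pos-resp-≈
        (solve 4 (λ s m e n → s :* m :+ e :* (s :* n) := s :* (m :+ e :* n)) refl (signValue (g j)) (μ j) ε (ν′ j))
        (ε-small j (≉0⇒support μ (λ μj≈0 → pos⇒≉0 0<sμ (trans (*-congˡ μj≈0) (zeroʳ _)))))
        where
        0<sμ : Positive (signValue (g j) * μ j)
        0<sμ = signs-off-Z j gj (≡.trans (≡.sym (∖-keeps Z j≢e)) Z′j)

  fill : ∀ {g Z} k → ∣ Z ∣ ≡ k → PartialDependency g Z → ∃ (ExactDependency g)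
  fill {g} {Z} zero ∣Z∣≡0 partial = μ , dependency , (λ j gj → signs-off-Z j gj (∣J∣≡0⇒J≡∅ Z ∣Z∣≡0 j)) , vanishes-off-g
    where open PartialDependency partial
  fill {Z = Z} (suc k) ∣Z∣≡1+k partial with ∣J∣≡1+n⇒nonempty Z ∣Z∣≡1+k
  ... | e , Ze = fill k (ℕ.suc-injective (≡.trans (≡.sym (∣J∖p∣ Z e Ze)) ∣Z∣≡1+k)) (FillStep.step partial Ze)

  realisable-or-dependent : ∀ (g : Fin n → Sign) → (∃ (Realises g)) ⊎ (∃ (ExactDependency g))
  realisable-or-dependent g with GordanAlternative.gordan K (λ j l → signValue (g j) * V l j) (λ j → isNonzero (g j))
  ... | inj₁ (u , u-pos) = inj₁ (u , λ j gj → pos-resp-≈ (σ-out j) (u-pos j gj))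
    where
    σ-out : ∀ j → ∑ K (λ l → (signValue (g j) * V l j) * u l) ≈ signValue (g j) * ⟨ j , u ⟩
    σ-out j = trans (∑-cong (λ l → *-assoc (signValue (g j)) (V l j) (u l))) (∑-*ˡ (signValue (g j)) (λ l → V l j * u l))
  ... | inj₂ (λ′ , supp , λ′≥0 , (j₀ , 0<λ′j₀) , dep) = inj₂ (fill _ ≡.refl partial)
    where
    Z : Subset n
    Z j = isNonzero (g j) ∧ not (support λ′ j)
    partial : PartialDependency g Z
    partial = record
      { μ = λ j → signValue (g j) * λ′ j
      ; dependency = λ i → trans (∑-cong (λ j → solve 3 (λ v s l → v :* (s :* l) := (s :* v) :* l) refl (V i j) (signValue (g j)) (λ′ j))) (dep i)
      ; nonzero = j₀ , *-≉0 (signValue≉0 (g j₀) gj₀) (pos⇒≉0 0<λ′j₀)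
      ; vanishes-off-g = λ j gj → trans (*-congˡ (supp j gj)) (zeroʳ _)
      ; Z⊆supp-g = λ j Zj → ∧-≡-trueˡ Zj
      ; vanishes-on-Z = λ j Zj → trans (*-congˡ (¬support⇒≈0 λ′ (not-≡-true (∧-≡-trueʳ Zj)))) (zeroʳ _)
      ; signs-off-Z = off-Z
      }
      where
      gj₀ : isNonzero (g j₀) ≡ true
      gj₀ with isNonzero (g j₀) in eq
      ... | true = ≡.refl
      ... | false = ⊥-elim (pos⇒≉0 0<λ′j₀ (supp j₀ eq))
      off-Z : ∀ j → isNonzero (g j) ≡ true → Z j ≡ false → Positive (signValue (g j) * (signValue (g j) * λ′ j))
      off-Z j gj Zj = pos-resp-≈ (sym (trans (sym (*-assoc _ _ _)) (trans (*-congʳ (signValue²≈1 (g j) gj)) (*-identityˡ _)))) 0<λ′j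
        where
        0<λ′j : Positive (λ′ j)
        0<λ′j with λ′≥0 j
        ... | inj₁ 0<λ′j = 0<λ′j
        ... | inj₂ λ′j≈0 = ⊥-elim (not-¬ Zj-true Zj)
          where
          Zj-true : Z j ≡ true
          Zj-true rewrite gj | ≈0⇒¬support λ′ λ′j≈0 = ≡.refl

  -- Pairing u with μ gives ∑ ⟨ j , u ⟩ μ j = 0, yet every term is ≥ 0 and the term at a nonzero g j is > 0.
  ¬realisable-and-dependent : ∀ (g : Fin n → Sign) → (∃ λ j → isNonzero (g j) ≡ true) →
                              ∀ {u μ} → Realises g u → ¬ ExactDependency g μ
  ¬realisable-and-dependent g (j₀ , gj₀) {u} {μ} u-realises (dep , μ-signs , μ-off) =
    pos⇒≉0 (∑-pos term≥0 j₀ (term>0 j₀ gj₀))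
      (trans (sym (∑-transpose column u μ)) (∑-zero (λ l → trans (*-congˡ (dep l)) (zeroʳ _))))
    where
    term>0 : ∀ j → isNonzero (g j) ≡ true → Positive (⟨ j , u ⟩ * μ j)
    term>0 j gj = pos-resp-≈
      (trans (solve 3 (λ s d m → (s :* d) :* (s :* m) := (s :* s) :* (d :* m)) refl (signValue (g j)) ⟨ j , u ⟩ (μ j))
             (trans (*-congʳ (signValue²≈1 (g j) gj)) (*-identityˡ _)))
      (*-pos (u-realises j gj) (μ-signs j gj))
    term≥0 : ∀ j → NonNegative (⟨ j , u ⟩ * μ j)
    term≥0 j with isNonzero (g j) in gj
    ... | true = inj₁ (term>0 j gj)
    ... | false = inj₂ (trans (*-congˡ (μ-off j gj)) (zeroʳ _))

module Sweep {c ℓ₁ ℓ₂} (K : OrderedField c ℓ₁ ℓ₂) {r n} (r≤n : r ≤ n) (V : Matrix K r n)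
  (general : GeneralPosition K V) (L : List (Vec Sign n)) (L-covectors : Enumerates (Covector K V) L)
  (G : Vec Sign n) where

  open import Data.Nat.Base as ℕ using (ℕ; zero; suc; s≤s; z≤n)
  import Data.Nat.Properties as ℕ
  open import Data.Fin.Base using (Fin; zero; suc; fromℕ<)
  open import Data.Fin.Properties using (_≟_; toℕ<n)
  open import Data.Bool.Base using (Bool; true; false; _∧_; _∨_; not)
  open import Data.Bool.Properties using (not-¬; T-≡; ⇔→≡; ∧-zeroʳ)
  open import Data.Vec.Base using (lookup; _[_]≔_)
  open import Data.Vec.Properties using (lookup∘update; lookup∘update′; lookup-replicate; []≔-lookup)
  open import Data.Bool.ListAction using (any)
  open import Data.List.Membership.Propositional using (_∈_; find; lose)
  open import Data.List.Relation.Unary.Any.Properties using (any⁺; any⁻)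
  open import Data.Product.Base using (∃; _×_; _,_; proj₁; proj₂)
  open import Data.Sum.Base using (_⊎_; inj₁; inj₂)
  open import Data.Empty using (⊥-elim)
  open import Function.Bundles using (Equivalence; mk⇔)
  open import Function.Base using (_∘_)
  open import Relation.Nullary.Negation.Core using (¬_)
  open import Relation.Nullary.Decidable.Core using (does; toSum)
  open import Relation.Nullary.Decidable using (dec-true; dec-false)
  open import Relation.Binary.Definitions using (tri<; tri≈; tri>)
  open import Relation.Binary.PropositionalEquality.Core as ≡ using (_≡_; _≢_)

  open OrderedFieldProperties K
  open FiniteSums K
  open BooleanSubsets
  open SignVectors
  open SignFunction K
  open SignVectorSums K
  open GeneratingPolynomials K using (altSign; χ; jumps; jumps-zero; jumps-step)
  open GeneralPositionProperties K r≤n V general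

  covector : (Fin r → Carrier) → Vec Sign n
  covector u = signVec K (λ j → ⟨ j , u ⟩)

  covector∈L : ∀ {u} → Nonzero u → covector u ∈ L
  covector∈L {u} u≉0 = Equivalence.from (proj₂ L-covectors (covector u)) (u , u≉0 , ≡.refl)

  ∈L⇒covector : ∀ {F} → F ∈ L → ∃ λ u → Nonzero u × covector u ≡ F
  ∈L⇒covector {F} = Equivalence.to (proj₂ L-covectors F)

  record Witness (k : ℕ) (Q : Vec Sign n) (u : Fin r → Carrier) : Set ℓ₁ where
    constructor witness
    field
      nonzero : Nonzero u
      conforms : ∀ j → (lookup G j ⊑ˢ sgn K ⟨ j , u ⟩) ≡ true
      signs : ∀ j → lookup Q j ≡ select (prefix k j) (sgn K ⟨ j , u ⟩)

  cell : ℕ → Vec Sign n → Bool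
  cell k Q = any (λ F → (G ⊑ F) ∧ (restrict k F ≡ᵇ Q)) L

  cell-intro : ∀ k Q {u} → Witness k Q u → cell k Q ≡ true
  cell-intro k Q {u} (witness u≉0 G⊑u Q≡) =
    Equivalence.to T-≡ (any⁺ _ (lose (covector∈L u≉0) (Equivalence.from T-≡ selected)))
    where
    restrict≡Q : restrict k (covector u) ≡ Q
    restrict≡Q = lookup-extensional _ _ λ j →
      ≡.trans (lookup-restrict k (covector u) j) (≡.trans (≡.cong (select (prefix k j)) (lookup-signVec _ j)) (≡.sym (Q≡ j)))
    selected : ((G ⊑ covector u) ∧ (restrict k (covector u) ≡ᵇ Q)) ≡ true
    selected rewrite ⊑-tabulate G (covector u) (λ j → ≡.subst (λ s → (lookup G j ⊑ˢ s) ≡ true) (≡.sym (lookup-signVec _ j)) (G⊑u j))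
                   | restrict≡Q = ≡ᵇ-refl Q

  cell-elim : ∀ k Q → cell k Q ≡ true → ∃ (Witness k Q)
  cell-elim k Q h with find (any⁻ _ L (Equivalence.from T-≡ h))
  ... | F , F∈L , selected with ∈L⇒covector F∈L | Equivalence.to T-≡ selected
  ... | u , u≉0 , ≡.refl | selected′ = u , witness u≉0 G⊑u Q≡
    where
    G⊑u : ∀ j → (lookup G j ⊑ˢ sgn K ⟨ j , u ⟩) ≡ true
    G⊑u j = ≡.subst (λ s → (lookup G j ⊑ˢ s) ≡ true) (lookup-signVec _ j) (⊑-lookup G (covector u) (∧-≡-trueˡ selected′) j)
    restrict≡Q : restrict k (covector u) ≡ Q
    restrict≡Q = ≡ᵇ-sound (∧-≡-trueʳ selected′)
    Q≡ : ∀ j → lookup Q j ≡ select (prefix k j) (sgn K ⟨ j , u ⟩)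
    Q≡ j = ≡.trans (≡.sym (≡.cong (λ X → lookup X j) restrict≡Q))
                   (≡.trans (lookup-restrict k (covector u) j) (≡.cong (select (prefix k j)) (lookup-signVec _ j)))

  module Stage (m : ℕ) (m<n : m ℕ.< n) where

    e : Fin n
    e = fromℕ< m<n

    select-e : ∀ s → select (prefix (suc m) e) s ≡ s
    select-e s rewrite prefix-last m m<n = ≡.refl

    select-other : ∀ {j} → j ≢ e → ∀ s → select (prefix (suc m) j) s ≡ select (prefix m j) s
    select-other j≢e s = ≡.cong (λ b → select b s) (prefix-other m m<n j≢e)

    lookup-e : ∀ {Q u s} → Witness (suc m) (Q [ e ]≔ s) u → sgn K ⟨ e , u ⟩ ≡ s
    lookup-e {Q} {u} {s} (witness _ _ Q≡) = ≡.sym (≡.trans (≡.sym (lookup∘update e Q s)) (≡.trans (Q≡ e) (select-e _)))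

    lookup-other : ∀ {Q u s j} → Witness (suc m) (Q [ e ]≔ s) u → j ≢ e →
                   lookup Q j ≡ select (prefix (suc m) j) (sgn K ⟨ j , u ⟩)
    lookup-other {Q} {u} {s} {j} (witness _ _ Q≡) j≢e = ≡.trans (≡.sym (lookup∘update′ j≢e Q s)) (Q≡ j)

    witness-extend : ∀ {Q u s} → Witness m Q u → sgn K ⟨ e , u ⟩ ≡ s → Witness (suc m) (Q [ e ]≔ s) u
    witness-extend {Q} {u} {s} (witness u≉0 G⊑u Q≡) sgn≡s = witness u≉0 G⊑u Q≡′
      where
      Q≡′ : ∀ j → lookup (Q [ e ]≔ s) j ≡ select (prefix (suc m) j) (sgn K ⟨ j , u ⟩)
      Q≡′ j with toSum (j ≟ e)
      ... | inj₁ ≡.refl = ≡.trans (lookup∘update e Q s) (≡.sym (≡.trans (select-e _) sgn≡s))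
      ... | inj₂ j≢e = ≡.trans (lookup∘update′ j≢e Q s) (≡.trans (Q≡ j) (≡.sym (select-other j≢e _)))

    witness-restrict : ∀ {Q u s} → lookup Q e ≡ pos → Witness (suc m) (Q [ e ]≔ s) u → Witness m Q u
    witness-restrict {Q} {u} {s} Qe≡pos w@(witness u≉0 G⊑u _) = witness u≉0 G⊑u Q≡
      where
      Q≡ : ∀ j → lookup Q j ≡ select (prefix m j) (sgn K ⟨ j , u ⟩)
      Q≡ j with toSum (j ≟ e)
      ... | inj₁ ≡.refl rewrite prefix-next m m<n = Qe≡pos
      ... | inj₂ j≢e = ≡.trans (lookup-other w j≢e) (select-other j≢e _)

    cell-splits : ∀ {Q} → cell m Q ≡ true →
                  (cell (suc m) (Q [ e ]≔ neg) ∨ (cell (suc m) (Q [ e ]≔ zer) ∨ cell (suc m) (Q [ e ]≔ pos))) ≡ true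
    cell-splits {Q} h with cell-elim m Q h
    ... | u , w = split (sgn K ⟨ e , u ⟩) ≡.refl
      where
      split : ∀ s → sgn K ⟨ e , u ⟩ ≡ s →
              (cell (suc m) (Q [ e ]≔ neg) ∨ (cell (suc m) (Q [ e ]≔ zer) ∨ cell (suc m) (Q [ e ]≔ pos))) ≡ true
      split neg sgn≡ = ∨-≡-trueˡ _ (cell-intro (suc m) (Q [ e ]≔ neg) (witness-extend w sgn≡))
      split zer sgn≡ = ∨-≡-trueʳ (cell (suc m) (Q [ e ]≔ neg)) (∨-≡-trueˡ _ (cell-intro (suc m) (Q [ e ]≔ zer) (witness-extend w sgn≡)))
      split pos sgn≡ = ∨-≡-trueʳ (cell (suc m) (Q [ e ]≔ neg))
                         (∨-≡-trueʳ (cell (suc m) (Q [ e ]≔ zer)) (cell-intro (suc m) (Q [ e ]≔ pos) (witness-extend w sgn≡)))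

    cell-restricts : ∀ {Q} s → lookup Q e ≡ pos → cell (suc m) (Q [ e ]≔ s) ≡ true → cell m Q ≡ true
    cell-restricts {Q} s Qe≡pos h = cell-intro m Q (witness-restrict Qe≡pos (proj₂ (cell-elim (suc m) (Q [ e ]≔ s) h)))

    -- Move u₀ off the hyperplane of e, along a direction u₁ orthogonal to the other zero coordinates.
    module Perturb {Q u₀} (w₀ : Witness (suc m) (Q [ e ]≔ zer) u₀) (σ : Sign) (σ≢0 : isNonzero σ ≡ true) where
      open Witness w₀

      J₀ : Subset n
      J₀ j = prefix (suc m) j ∧ not (isNonzero (sgn K ⟨ j , u₀ ⟩))

      J₀-zero : ∀ {j} → J₀ j ≡ true → sgn K ⟨ j , u₀ ⟩ ≡ zer
      J₀-zero h = isNonzero≡false (not-≡-true (∧-≡-trueʳ h))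

      J₀e : J₀ e ≡ true
      J₀e rewrite prefix-last m m<n | lookup-e w₀ = ≡.refl

      u₁-exists : ∃ λ u₁ → ∀ j → J₀ j ≡ true → ⟨ j , u₁ ⟩ ≈ δ e j
      u₁-exists = few-columns-solvable J₀ (ℕ.<⇒≤ (orthogonal-nonzero⇒∣J∣<r J₀ u₀ nonzero λ j h → sgn≡zer⇒≈0 _ (J₀-zero h))) (δ e)

      u₁ : Fin r → Carrier
      u₁ = proj₁ u₁-exists

      C : Subset n
      C j = isNonzero (sgn K ⟨ j , u₀ ⟩)

      ε-exists : ∃ λ ε → Positive ε × (∀ j → C j ≡ true →
                   Positive (signValue (sgn K ⟨ j , u₀ ⟩) * ⟨ j , u₀ ⟩ + ε * (signValue (sgn K ⟨ j , u₀ ⟩) * (signValue σ * ⟨ j , u₁ ⟩))))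
      ε-exists = small-perturbation-pos C (λ j → signValue (sgn K ⟨ j , u₀ ⟩) * ⟨ j , u₀ ⟩)
                   (λ j → signValue (sgn K ⟨ j , u₀ ⟩) * (signValue σ * ⟨ j , u₁ ⟩)) (λ j → signValue-sgn ⟨ j , u₀ ⟩)

      ε : Carrier
      ε = proj₁ ε-exists

      uσ : Fin r → Carrier
      uσ l = 1# * u₀ l + ε * (signValue σ * u₁ l)

      ⟨uσ⟩ : ∀ j → ⟨ j , uσ ⟩ ≈ ⟨ j , u₀ ⟩ + ε * (signValue σ * ⟨ j , u₁ ⟩)
      ⟨uσ⟩ j = trans (∑-linear (λ l → V l j) u₀ (λ l → signValue σ * u₁ l) 1# ε)
        (+-cong (*-identityˡ _) (*-congˡ (trans (∑-cong (λ l → solve 3 (λ v s u → v :* (s :* u) := s :* (v :* u)) refl (V l j) (signValue σ) (u₁ l)))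
                                                (∑-*ˡ (signValue σ) (λ l → V l j * u₁ l)))))

      sgn-e : sgn K ⟨ e , uσ ⟩ ≡ σ
      sgn-e = sgn-by-signValue σ σ≢0 (pos-resp-≈ (sym (begin
        signValue σ * ⟨ e , uσ ⟩                     ≈⟨ *-congˡ (trans (⟨uσ⟩ e) (+-cong (sgn≡zer⇒≈0 _ (lookup-e w₀)) (*-congˡ (*-congˡ u₁e≈1)))) ⟩
        signValue σ * (0# + ε * (signValue σ * 1#))  ≈⟨ solve 2 (λ s e → s :* (:0 :+ e :* (s :* :1)) := e :* (s :* s)) refl (signValue σ) ε ⟩
        ε * (signValue σ * signValue σ)              ≈⟨ *-congˡ (signValue²≈1 σ σ≢0) ⟩
        ε * 1#                                       ≈⟨ *-identityʳ ε ⟩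
        ε                                            ∎)) (proj₁ (proj₂ ε-exists)))
        where
        u₁e≈1 : ⟨ e , u₁ ⟩ ≈ 1#
        u₁e≈1 = trans (proj₂ u₁-exists e J₀e) (δ-same e)

      sgn-kept : ∀ j → C j ≡ true → sgn K ⟨ j , uσ ⟩ ≡ sgn K ⟨ j , u₀ ⟩
      sgn-kept j Cj = sgn-by-signValue _ Cj (pos-resp-≈
        (sym (trans (*-congˡ (⟨uσ⟩ j)) (solve 4 (λ s d e q → s :* (d :+ e :* q) := s :* d :+ e :* (s :* q)) refl (signValue (sgn K ⟨ j , u₀ ⟩)) ⟨ j , u₀ ⟩ ε (signValue σ * ⟨ j , u₁ ⟩))))
        (proj₂ (proj₂ ε-exists) j Cj))

      sgn-J₀ : ∀ j → J₀ j ≡ true → j ≢ e → sgn K ⟨ j , uσ ⟩ ≡ zer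
      sgn-J₀ j J₀j j≢e = sgn-zer (trans (⟨uσ⟩ j)
        (trans (+-cong (sgn≡zer⇒≈0 _ (J₀-zero J₀j)) (*-congˡ (*-congˡ (trans (proj₂ u₁-exists j J₀j) (δ-other j≢e)))))
               (solve 2 (λ e s → :0 :+ e :* (s :* :0) := :0) refl ε (signValue σ))))

      conforms′ : ∀ j → (lookup G j ⊑ˢ sgn K ⟨ j , uσ ⟩) ≡ true
      conforms′ j with C j in Cj
      ... | true = ≡.subst (λ s → (lookup G j ⊑ˢ s) ≡ true) (≡.sym (sgn-kept j Cj)) (conforms j)
      ... | false = ≡.subst (λ t → (t ⊑ˢ sgn K ⟨ j , uσ ⟩) ≡ true) (≡.sym Gj≡zer) ≡.refl
        where
        Gj≡zer : lookup G j ≡ zer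
        Gj≡zer = ⊑ˢ-zer (≡.subst (λ s → (lookup G j ⊑ˢ s) ≡ true) (isNonzero≡false Cj) (conforms j))

      signs′ : ∀ j → lookup (Q [ e ]≔ σ) j ≡ select (prefix (suc m) j) (sgn K ⟨ j , uσ ⟩)
      signs′ j with toSum (j ≟ e)
      ... | inj₁ ≡.refl = ≡.trans (lookup∘update e Q σ) (≡.sym (≡.trans (select-e _) sgn-e))
      ... | inj₂ j≢e = ≡.trans (lookup∘update′ j≢e Q σ) (≡.trans (lookup-other w₀ j≢e) (same-selection (prefix (suc m) j) ≡.refl))
        where
        same-selection : ∀ b → prefix (suc m) j ≡ b → select b (sgn K ⟨ j , u₀ ⟩) ≡ select b (sgn K ⟨ j , uσ ⟩)
        same-selection false _ = ≡.refl
        same-selection true pj with C j in Cj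
        ... | true = ≡.sym (sgn-kept j Cj)
        ... | false = ≡.trans (isNonzero≡false Cj) (≡.sym (sgn-J₀ j J₀j j≢e))
          where
          J₀j : J₀ j ≡ true
          J₀j rewrite pj | Cj = ≡.refl

      lifted : Witness (suc m) (Q [ e ]≔ σ) uσ
      lifted = witness (∑≉0⇒nonzero (λ l → V l e) uσ (sgn-nonzero⇒≉0 _ (≡.subst (λ s → isNonzero s ≡ true) (≡.sym sgn-e) σ≢0)))
                       conforms′ signs′

    zero-cell⇒signed-cell : ∀ {Q} σ → isNonzero σ ≡ true → cell (suc m) (Q [ e ]≔ zer) ≡ true → cell (suc m) (Q [ e ]≔ σ) ≡ true
    zero-cell⇒signed-cell {Q} σ σ≢0 h = cell-intro (suc m) (Q [ e ]≔ σ) (Perturb.lifted (proj₂ (cell-elim (suc m) (Q [ e ]≔ zer) h)) σ σ≢0)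

    -- The combination α u₊ + β u₋ with α = -⟨ e , u₋ ⟩, β = ⟨ e , u₊ ⟩ lies on the hyperplane of e and
    -- keeps every sign on which u₊ and u₋ agree; it can only vanish when G = 0 and Q is all zero.
    module Merge {Q u₊ u₋} (w₊ : Witness (suc m) (Q [ e ]≔ pos) u₊) (w₋ : Witness (suc m) (Q [ e ]≔ neg) u₋) where

      α β : Carrier
      α = - ⟨ e , u₋ ⟩
      β = ⟨ e , u₊ ⟩

      0<α : Positive α
      0<α = neg⇒-pos (-pos⇒neg (pos-resp-≈ (solve 1 (λ x → :-1 :* x := :- x) refl ⟨ e , u₋ ⟩) (signValue-sgn′ (lookup-e w₋) ≡.refl)))

      0<β : Positive β
      0<β = pos-resp-≈ (*-identityˡ _) (signValue-sgn′ (lookup-e w₊) ≡.refl)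

      u : Fin r → Carrier
      u l = α * u₊ l + β * u₋ l

      ⟨u⟩ : ∀ j → ⟨ j , u ⟩ ≈ α * ⟨ j , u₊ ⟩ + β * ⟨ j , u₋ ⟩
      ⟨u⟩ j = ∑-linear (λ l → V l j) u₊ u₋ α β

      agree : ∀ j t → sgn K ⟨ j , u₊ ⟩ ≡ t → sgn K ⟨ j , u₋ ⟩ ≡ t → sgn K ⟨ j , u ⟩ ≡ t
      agree j t s₊ s₋ = ≡.trans (sgn-cong (⟨u⟩ j)) (sgn-positive-combination t 0<α 0<β s₊ s₋)

      sgn-e : sgn K ⟨ e , u ⟩ ≡ zer
      sgn-e = sgn-zer (trans (⟨u⟩ e) (solve 2 (λ a b → (:- b) :* a :+ a :* b := :0) refl ⟨ e , u₊ ⟩ ⟨ e , u₋ ⟩))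

      sgn-prefix : ∀ {j} → j ≢ e → prefix (suc m) j ≡ true → sgn K ⟨ j , u ⟩ ≡ lookup Q j
      sgn-prefix {j} j≢e pj = agree j (lookup Q j)
        (≡.sym (≡.trans (lookup-other w₊ j≢e) (≡.cong (λ b → select b _) pj)))
        (≡.sym (≡.trans (lookup-other w₋ j≢e) (≡.cong (λ b → select b _) pj)))

      sgn-G : ∀ j → isNonzero (lookup G j) ≡ true → sgn K ⟨ j , u ⟩ ≡ lookup G j
      sgn-G j Gj = agree j (lookup G j) (⊑ˢ-nonzero Gj (Witness.conforms w₊ j)) (⊑ˢ-nonzero Gj (Witness.conforms w₋ j))

      conforms′ : ∀ j → (lookup G j ⊑ˢ sgn K ⟨ j , u ⟩) ≡ true
      conforms′ j with isNonzero (lookup G j) in Gj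
      ... | true rewrite sgn-G j Gj = ⊑ˢ-refl (lookup G j)
      ... | false rewrite isNonzero≡false Gj = ≡.refl

      signs′ : ∀ j → lookup (Q [ e ]≔ zer) j ≡ select (prefix (suc m) j) (sgn K ⟨ j , u ⟩)
      signs′ j with toSum (j ≟ e)
      ... | inj₁ ≡.refl = ≡.trans (lookup∘update e Q zer) (≡.sym (≡.trans (select-e _) sgn-e))
      ... | inj₂ j≢e with prefix (suc m) j in pj
      ...   | true = ≡.trans (lookup∘update′ j≢e Q zer) (≡.sym (sgn-prefix j≢e pj))
      ...   | false = ≡.trans (lookup∘update′ j≢e Q zer) (≡.trans (lookup-other w₊ j≢e) (≡.cong (λ b → select b _) pj))

      merged : ∀ {j} → ¬ (⟨ j , u ⟩ ≈ 0#) → Witness (suc m) (Q [ e ]≔ zer) u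
      merged {j} uj≉0 = witness (∑≉0⇒nonzero (λ l → V l j) u uj≉0) conforms′ signs′

    signed-cells⇒zero-cell : ∀ {Q} → lookup Q e ≡ pos → cell (suc m) (Q [ e ]≔ pos) ≡ true → cell (suc m) (Q [ e ]≔ neg) ≡ true →
                             cell (suc m) (Q [ e ]≔ zer) ≡ true ⊎ ((∀ j → lookup G j ≡ zer) × Q ≡ restrict m zeros)
    signed-cells⇒zero-cell {Q} Qe≡pos h₊ h₋ with cell-elim (suc m) (Q [ e ]≔ pos) h₊ | cell-elim (suc m) (Q [ e ]≔ neg) h₋
    ... | u₊ , w₊ | _ , w₋ with nonempty? (λ j → isNonzero (lookup G j))
    ...   | inj₁ (j , Gj) = inj₁ (cell-intro (suc m) (Q [ e ]≔ zer) (merged {j} (sgn-nonzero⇒≉0 _ (≡.subst (λ s → isNonzero s ≡ true) (≡.sym (sgn-G j Gj)) Gj))))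
      where open Merge w₊ w₋
    ...   | inj₂ G≡0 with nonempty? (λ j → prefix m j ∧ isNonzero (lookup Q j))
    ...     | inj₁ (j , h) = inj₁ (cell-intro (suc m) (Q [ e ]≔ zer) (merged {j} (sgn-nonzero⇒≉0 _ (≡.subst (λ s → isNonzero s ≡ true) (≡.sym (sgn-prefix j≢e pj)) (∧-≡-trueʳ h)))))
      where
      open Merge w₊ w₋
      j≢e : j ≢ e
      j≢e ≡.refl = not-¬ (∧-≡-trueˡ h) (prefix-next m m<n)
      pj : prefix (suc m) j ≡ true
      pj = ≡.trans (prefix-other m m<n j≢e) (∧-≡-trueˡ h)
    ...     | inj₂ Q≡0 = inj₂ ((λ j → isNonzero≡false (G≡0 j)) , lookup-extensional _ _ Q≡)
      where
      Q≡ : ∀ j → lookup Q j ≡ lookup (restrict m zeros) j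
      Q≡ j rewrite lookup-restrict m (zeros {n}) j | lookup-replicate j zer with prefix m j in pj
      ... | true = isNonzero≡false (≡.subst (λ b → (b ∧ isNonzero (lookup Q j)) ≡ false) pj (Q≡0 j))
      ... | false with toSum (j ≟ e)
      ...   | inj₁ ≡.refl = Qe≡pos
      ...   | inj₂ j≢e = ≡.trans (lookup-other w₊ j≢e) (≡.trans (select-other j≢e _) (≡.cong (λ b → select b (sgn K ⟨ j , u₊ ⟩)) pj))

  weighted : ℕ → Vec Sign n → Carrier
  weighted k Q = 𝟙 (cell k Q) * altSign Q

  N : ℕ → Carrier
  N k = ∑ᵛ (weighted k)

  cell⇒next-pos : ∀ m (m<n : m ℕ.< n) {Q} → cell m Q ≡ true → lookup Q (fromℕ< m<n) ≡ pos
  cell⇒next-pos m m<n {Q} h with cell-elim m Q h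
  ... | u , w = ≡.trans (Witness.signs w (fromℕ< m<n)) (≡.cong (λ b → select b (sgn K ⟨ fromℕ< m<n , u ⟩)) (prefix-next m m<n))

  -- Over one fibre {Q[e]≔neg, Q[e]≔zer, Q[e]≔pos}: a + c - b = d + [a ∧ c ∧ ¬ b].
  fibre-identity : ∀ {a b c d} W → (d ≡ true → (a ∨ (b ∨ c)) ≡ true) →
                   (a ≡ true → d ≡ true) → (b ≡ true → d ≡ true) → (c ≡ true → d ≡ true) →
                   (b ≡ true → a ≡ true) → (b ≡ true → c ≡ true) →
                   𝟙 a * W + (𝟙 b * (- 1# * W) + 𝟙 c * W) ≈ 𝟙 d * W + 𝟙 (a ∧ (c ∧ not b)) * W
  fibre-identity {false} {false} {false} {false} W _ _ _ _ _ _ =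
    solve 1 (λ W → :0 :* W :+ (:0 :* (:-1 :* W) :+ :0 :* W) := :0 :* W :+ :0 :* W) refl W
  fibre-identity {true} {false} {false} {true} W _ _ _ _ _ _ =
    solve 1 (λ W → :1 :* W :+ (:0 :* (:-1 :* W) :+ :0 :* W) := :1 :* W :+ :0 :* W) refl W
  fibre-identity {false} {false} {true} {true} W _ _ _ _ _ _ =
    solve 1 (λ W → :0 :* W :+ (:0 :* (:-1 :* W) :+ :1 :* W) := :1 :* W :+ :0 :* W) refl W
  fibre-identity {true} {false} {true} {true} W _ _ _ _ _ _ =
    solve 1 (λ W → :1 :* W :+ (:0 :* (:-1 :* W) :+ :1 :* W) := :1 :* W :+ :1 :* W) refl W
  fibre-identity {true} {true} {true} {true} W _ _ _ _ _ _ =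
    solve 1 (λ W → :1 :* W :+ (:1 :* (:-1 :* W) :+ :1 :* W) := :1 :* W :+ :0 :* W) refl W
  fibre-identity {false} {false} {false} {true} W d→abc _ _ _ _ _ with d→abc ≡.refl
  ... | ()
  fibre-identity {true} {_} {_} {false} W _ a→d _ _ _ _ with a→d ≡.refl
  ... | ()
  fibre-identity {false} {true} {_} {false} W _ _ b→d _ _ _ with b→d ≡.refl
  ... | ()
  fibre-identity {false} {false} {true} {false} W _ _ _ c→d _ _ with c→d ≡.refl
  ... | ()
  fibre-identity {false} {true} {_} {true} W _ _ _ _ b→a _ with b→a ≡.refl
  ... | ()
  fibre-identity {true} {true} {false} {true} W _ _ _ _ _ b→c with b→c ≡.refl
  ... | ()

  module Step (m : ℕ) (m<n : m ℕ.< n) where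
    open Stage m m<n

    crossing : Vec Sign n → Bool
    crossing Q = cell (suc m) (Q [ e ]≔ neg) ∧ (cell (suc m) (Q [ e ]≔ pos) ∧ not (cell (suc m) (Q [ e ]≔ zer)))

    X : Vec Sign n → Carrier
    X Q = 𝟙 (isPos (lookup Q e)) * (𝟙 (crossing Q) * altSign Q)

    fibre : ∀ Q → 𝟙 (isPos (lookup Q e)) * (weighted (suc m) (Q [ e ]≔ neg) + (weighted (suc m) (Q [ e ]≔ zer) + weighted (suc m) (Q [ e ]≔ pos))) ≈
                  weighted m Q + 𝟙 (isPos (lookup Q e)) * (𝟙 (crossing Q) * altSign Q)
    fibre Q with isPos (lookup Q e) in Qe
    ... | false = begin
      0# * _                           ≈⟨ zeroˡ _ ⟩
      0#                               ≈⟨ +-identityʳ 0# ⟨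
      0# + 0#                          ≈⟨ +-cong (trans (*-congʳ (reflexive (≡.cong 𝟙 cell-off))) (zeroˡ _)) (zeroˡ _) ⟨
      𝟙 (cell m Q) * altSign Q + 0# * (𝟙 (crossing Q) * altSign Q) ∎
      where
      cell-off : cell m Q ≡ false
      cell-off with cell m Q in cmQ
      ... | true = ⊥-elim (not-¬ (≡.cong isPos (cell⇒next-pos m m<n cmQ)) Qe)
      ... | false = ≡.refl
    ... | true = begin
      1# * (weighted (suc m) (Q [ e ]≔ neg) + (weighted (suc m) (Q [ e ]≔ zer) + weighted (suc m) (Q [ e ]≔ pos)))
        ≈⟨ trans (*-identityˡ _) (+-cong (*-congˡ altSign-neg) (+-cong (*-congˡ altSign-zer) (*-congˡ altSign-pos))) ⟩
      𝟙 a₋ * altSign Q + (𝟙 a₀ * (- 1# * altSign Q) + 𝟙 a₊ * altSign Q)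
        ≈⟨ fibre-identity (altSign Q) (cell-splits {Q}) (cell-restricts neg Qe≡pos) (cell-restricts zer Qe≡pos)
                          (cell-restricts pos Qe≡pos) (zero-cell⇒signed-cell neg ≡.refl) (zero-cell⇒signed-cell pos ≡.refl) ⟩
      𝟙 (cell m Q) * altSign Q + 𝟙 (crossing Q) * altSign Q
        ≈⟨ +-congˡ (*-identityˡ _) ⟨
      𝟙 (cell m Q) * altSign Q + 1# * (𝟙 (crossing Q) * altSign Q) ∎
      where
      a₋ a₀ a₊ : Bool
      a₋ = cell (suc m) (Q [ e ]≔ neg)
      a₀ = cell (suc m) (Q [ e ]≔ zer)
      a₊ = cell (suc m) (Q [ e ]≔ pos)
      Qe≡pos : lookup Q e ≡ pos
      Qe≡pos = isPos≡true Qe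
      altSign-neg : altSign (Q [ e ]≔ neg) ≈ altSign Q
      altSign-neg = reflexive (≡.cong (pow K (- 1#)) (count-zer-[]≔neg Q e Qe≡pos))
      altSign-zer : altSign (Q [ e ]≔ zer) ≈ - 1# * altSign Q
      altSign-zer = reflexive (≡.cong (pow K (- 1#)) (count-zer-[]≔zer Q e Qe≡pos))
      altSign-pos : altSign (Q [ e ]≔ pos) ≈ altSign Q
      altSign-pos = reflexive (≡.cong altSign (≡.trans (≡.cong (Q [ e ]≔_) (≡.sym Qe≡pos)) ([]≔-lookup Q e)))

    N-step : N (suc m) ≈ N m + ∑ᵛ X
    N-step = begin
      N (suc m)
        ≈⟨ ∑ᵛ-fibres e (weighted (suc m)) ⟩
      ∑ᵛ (λ Q → 𝟙 (isPos (lookup Q e)) * (weighted (suc m) (Q [ e ]≔ neg) + (weighted (suc m) (Q [ e ]≔ zer) + weighted (suc m) (Q [ e ]≔ pos))))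
        ≈⟨ ∑ᵛ-cong {n} fibre ⟩
      ∑ᵛ (λ Q → weighted m Q + X Q)
        ≈⟨ ∑ᵛ-+ {n} _ _ ⟩
      N m + ∑ᵛ X ∎

    crossing-cells : ∀ {Q} → crossing Q ≡ true →
      cell (suc m) (Q [ e ]≔ neg) ≡ true × cell (suc m) (Q [ e ]≔ pos) ≡ true × cell (suc m) (Q [ e ]≔ zer) ≡ false
    crossing-cells {Q} h =
      ∧-≡-trueˡ h , ∧-≡-trueˡ (∧-≡-trueʳ {cell (suc m) (Q [ e ]≔ neg)} h) ,
      not-≡-true (∧-≡-trueʳ {cell (suc m) (Q [ e ]≔ pos)} (∧-≡-trueʳ {cell (suc m) (Q [ e ]≔ neg)} h))

    crossing-true : ∀ {Q} → cell (suc m) (Q [ e ]≔ neg) ≡ true → cell (suc m) (Q [ e ]≔ pos) ≡ true →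
                    cell (suc m) (Q [ e ]≔ zer) ≡ false → crossing Q ≡ true
    crossing-true c₋ c₊ ¬c₀ rewrite c₋ | c₊ | ¬c₀ = ≡.refl

    crossing-false-zero : ∀ {Q} → cell (suc m) (Q [ e ]≔ zer) ≡ true → crossing Q ≡ false
    crossing-false-zero {Q} c₀ rewrite c₀ | ∧-zeroʳ (cell (suc m) (Q [ e ]≔ pos)) = ∧-zeroʳ (cell (suc m) (Q [ e ]≔ neg))

    crossing-false-neg : ∀ {Q} → cell (suc m) (Q [ e ]≔ neg) ≡ false → crossing Q ≡ false
    crossing-false-neg ¬c₋ rewrite ¬c₋ = ≡.refl

    Zm : Vec Sign n
    Zm = restrict m zeros

    X-vanishes : ∀ Q → Q ≢ Zm ⊎ (∃ λ j → isNonzero (lookup G j) ≡ true) → X Q ≈ 0#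
    X-vanishes Q away with isPos (lookup Q e) in Qe
    ... | false = zeroˡ _
    ... | true with crossing Q in crossingQ
    ...   | false = trans (*-identityˡ _) (zeroˡ _)
    ...   | true with crossing-cells {Q} crossingQ
    ...     | c₋ , c₊ , ¬c₀ with signed-cells⇒zero-cell (isPos≡true Qe) c₊ c₋
    ...       | inj₁ c₀ = ⊥-elim (not-¬ c₀ ¬c₀)
    ...       | inj₂ (G≡0 , Q≡Zm) with away
    ...         | inj₁ Q≢Zm = ⊥-elim (Q≢Zm Q≡Zm)
    ...         | inj₂ (j , Gj) = ⊥-elim (not-¬ Gj (≡.cong isNonzero (G≡0 j)))

    ∑X-vanishes : (∃ λ j → isNonzero (lookup G j) ≡ true) → ∑ᵛ X ≈ 0#
    ∑X-vanishes G≢0 = ∑ᵛ-zero {n} (λ Q → X-vanishes Q (inj₂ G≢0))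

    Zm-e : lookup Zm e ≡ pos
    Zm-e = ≡.trans (lookup-restrict m zeros e) (≡.cong (λ b → select b (lookup (zeros {n}) e)) (prefix-next m m<n))

    ∑X-at-Zm : ∑ᵛ X ≈ 𝟙 (crossing Zm) * pow K (- 1#) m
    ∑X-at-Zm = begin
      ∑ᵛ X                                              ≈⟨ ∑ᵛ-point Zm X (λ Q Q≢Zm → X-vanishes Q (inj₁ Q≢Zm)) ⟩
      𝟙 (isPos (lookup Zm e)) * (𝟙 (crossing Zm) * altSign Zm) ≈⟨ *-congʳ (reflexive (≡.cong (𝟙 ∘ isPos) Zm-e)) ⟩
      1# * (𝟙 (crossing Zm) * altSign Zm)               ≈⟨ *-identityˡ _ ⟩
      𝟙 (crossing Zm) * altSign Zm                      ≈⟨ *-congˡ (reflexive (≡.cong (pow K (- 1#)) (count-restrict-zeros m (ℕ.<⇒≤ m<n)))) ⟩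
      𝟙 (crossing Zm) * pow K (- 1#) m                  ∎

  N-constant : (∃ λ j → isNonzero (lookup G j) ≡ true) → ∀ k → k ≤ n → N k ≈ N 0
  N-constant G≢0 zero _ = refl
  N-constant G≢0 (suc k) k<n = trans (Step.N-step k k<n) (trans (+-cong (N-constant G≢0 k (ℕ.<⇒≤ k<n)) (Step.∑X-vanishes k k<n G≢0)) (+-identityʳ _))

  N-initial : N 0 ≈ 𝟙 (cell 0 positives)
  N-initial = begin
    N 0                                       ≈⟨ ∑ᵛ-point (positives {n}) (λ Q → 𝟙 (cell 0 Q) * altSign Q) off ⟩
    𝟙 (cell 0 positives) * altSign (positives {n}) ≈⟨ *-congˡ (reflexive (≡.cong (pow K (- 1#)) (count-positives n))) ⟩
    𝟙 (cell 0 positives) * 1#                ≈⟨ *-identityʳ _ ⟩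
    𝟙 (cell 0 positives)                     ∎
    where
    off : ∀ Q → Q ≢ positives → 𝟙 (cell 0 Q) * altSign Q ≈ 0#
    off Q Q≢+ with cell 0 Q in c0Q
    ... | false = zeroˡ _
    ... | true with cell-elim 0 Q c0Q
    ...   | _ , w = ⊥-elim (Q≢+ (lookup-extensional _ _ λ j → ≡.trans (Witness.signs w j) (≡.sym (lookup-replicate j pos))))

  N-final : N n ≈ χ L G
  N-final = ∑ᵛ-cong {n} λ Q → trans (*-congʳ (reflexive (≡.cong 𝟙 (cell-all Q)))) (𝟙-∧ (Q ∈ᵇ L) (G ⊑ Q) (altSign Q))
    where
    cell-all : ∀ Q → cell n Q ≡ (Q ∈ᵇ L) ∧ (G ⊑ Q)
    cell-all Q = ⇔→≡ {z = true} (mk⇔ to from)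
      where
      to : cell n Q ≡ true → ((Q ∈ᵇ L) ∧ (G ⊑ Q)) ≡ true
      to h with find (any⁻ (λ F → (G ⊑ F) ∧ (restrict n F ≡ᵇ Q)) L (Equivalence.from T-≡ h))
      ... | F , F∈L , selected with Equivalence.to T-≡ selected
      ...   | selected′ with ≡.trans (≡.sym (restrict-all F)) (≡ᵇ-sound (∧-≡-trueʳ selected′))
      ...     | ≡.refl rewrite ∈ᵇ-intro F∈L = ∧-≡-trueˡ selected′
      from : ((Q ∈ᵇ L) ∧ (G ⊑ Q)) ≡ true → cell n Q ≡ true
      from h = Equivalence.to T-≡ (any⁺ (λ F → (G ⊑ F) ∧ (restrict n F ≡ᵇ Q)) (lose (∈ᵇ-elim {L = L} (∧-≡-trueˡ h)) (Equivalence.from T-≡ selected)))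
        where
        selected : ((G ⊑ Q) ∧ (restrict n Q ≡ᵇ Q)) ≡ true
        selected rewrite ∧-≡-trueʳ {Q ∈ᵇ L} h | restrict-all Q = ≡ᵇ-refl Q

  module ZeroPattern (G≡0 : ∀ j → lookup G j ≡ zer) where

    conforms-any : ∀ u j → (lookup G j ⊑ˢ sgn K ⟨ j , u ⟩) ≡ true
    conforms-any u j rewrite G≡0 j = ≡.refl

    prefix-cell : ∀ k → k ℕ.< r → cell k (restrict k zeros) ≡ true
    prefix-cell k k<r with few-columns-have-orthogonal (prefix k) (≡.subst (ℕ._< r) (≡.sym (∣prefix∣ k k≤n)) k<r)
      where
      k≤n : k ≤ n
      k≤n = ℕ.≤-trans (ℕ.<⇒≤ k<r) r≤n
    ... | u , u≉0 , u⊥ = cell-intro k _ (witness u≉0 (conforms-any u) signs)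
      where
      signs : ∀ j → lookup (restrict k zeros) j ≡ select (prefix k j) (sgn K ⟨ j , u ⟩)
      signs j rewrite lookup-restrict k (zeros {n}) j | lookup-replicate j zer with prefix k j in pj
      ... | true = ≡.sym (sgn-zer (u⊥ j pj))
      ... | false = ≡.refl

    no-prefix-cell : ∀ k → r ≤ k → k ≤ n → cell k (restrict k zeros) ≡ false
    no-prefix-cell k r≤k k≤n with cell k (restrict k zeros) in ck
    ... | false = ≡.refl
    ... | true with cell-elim k _ ck
    ...   | u , witness u≉0 _ signs =
      ⊥-elim (orthogonal-to-r-columns (prefix k) (≡.subst (r ≤_) (≡.sym (∣prefix∣ k k≤n)) r≤k) u u⊥ u≉0)
      where
      u⊥ : ∀ j → prefix k j ≡ true → ⟨ j , u ⟩ ≈ 0#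
      u⊥ j pj = sgn≡zer⇒≈0 _ (≡.sym (select-true pj (≡.trans (≡.sym (lookup-zero j)) (signs j))))
        where
        lookup-zero : ∀ j → lookup (restrict k zeros) j ≡ select (prefix k j) zer
        lookup-zero j = ≡.trans (lookup-restrict k zeros j) (≡.cong (select (prefix k j)) (lookup-replicate j zer))
        select-true : ∀ {b s t} → b ≡ true → select b s ≡ select b t → s ≡ t
        select-true ≡.refl eq = eq

    module AtStage (m : ℕ) (m<n : m ℕ.< n) where
      open Stage m m<n
      open Step m m<n

      Zm-other : ∀ {j} → j ≢ e → lookup Zm j ≡ select (prefix (suc m) j) zer
      Zm-other {j} j≢e = ≡.trans (lookup-restrict m zeros j)
        (≡.trans (≡.cong (select (prefix m j)) (lookup-replicate j zer)) (≡.sym (select-other j≢e zer)))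

      Zm[e]≔zer : Zm [ e ]≔ zer ≡ restrict (suc m) zeros
      Zm[e]≔zer = lookup-extensional _ _ λ j → ≡.trans (lookup-at j) (≡.sym (≡.trans (lookup-restrict (suc m) zeros j) (≡.cong (select (prefix (suc m) j)) (lookup-replicate j zer))))
        where
        lookup-at : ∀ j → lookup (Zm [ e ]≔ zer) j ≡ select (prefix (suc m) j) zer
        lookup-at j with toSum (j ≟ e)
        ... | inj₁ ≡.refl = ≡.trans (lookup∘update e Zm zer) (≡.sym (select-e zer))
        ... | inj₂ j≢e = ≡.trans (lookup∘update′ j≢e Zm zer) (Zm-other j≢e)

      -- Replacing u by -u reverses all signs, and Zm is zero on the prefix.
      opposite-cell : ∀ s → cell (suc m) (Zm [ e ]≔ s) ≡ true → cell (suc m) (Zm [ e ]≔ opposite s) ≡ true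
      opposite-cell s h with cell-elim (suc m) (Zm [ e ]≔ s) h
      ... | u , w@(witness (i , ui≉0) _ signs) = cell-intro (suc m) _ (witness (i , -ui≉0) (conforms-any -u) signs′)
        where
        -u : Fin r → Carrier
        -u l = - u l
        -ui≉0 : ¬ (- u i ≈ 0#)
        -ui≉0 -ui≈0 = ui≉0 (trans (sym (-‿involutive′ (u i))) (trans (-‿cong -ui≈0) -0#≈0#))
          where
          -‿involutive′ : ∀ x → - - x ≈ x
          -‿involutive′ = solve 1 (λ x → :- (:- x) := x) refl
        sgn-u : ∀ j → sgn K ⟨ j , -u ⟩ ≡ opposite (sgn K ⟨ j , u ⟩)
        sgn-u j = ≡.trans (sgn-cong (trans (∑-cong (λ l → solve 2 (λ v u → v :* (:- u) := :- (v :* u)) refl (V l j) (u l))) (∑-neg (λ l → V l j * u l))))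
                          (sgn-‿ ⟨ j , u ⟩)
        signs′ : ∀ j → lookup (Zm [ e ]≔ opposite s) j ≡ select (prefix (suc m) j) (sgn K ⟨ j , -u ⟩)
        signs′ j rewrite sgn-u j with toSum (j ≟ e)
        ... | inj₁ ≡.refl = ≡.trans (lookup∘update e Zm (opposite s)) (≡.trans (≡.cong opposite (≡.sym (lookup-e w))) (≡.sym (select-e _)))
        ... | inj₂ j≢e = ≡.trans (lookup∘update′ j≢e Zm (opposite s))
                                 (≡.trans (Zm-other j≢e) (flip-select (prefix (suc m) j) (≡.trans (≡.sym (Zm-other j≢e)) (lookup-other w j≢e))))
          where
          flip-select : ∀ b {t} → select b zer ≡ select b t → select b zer ≡ select b (opposite t)
          flip-select false _ = ≡.refl
          flip-select true ≡.refl = ≡.refl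

      crossing-Zm : crossing Zm ≡ does (suc m ℕ.≟ r)
      crossing-Zm with ℕ.<-cmp (suc m) r
      ... | tri< 1+m<r _ _ = ≡.trans (crossing-false-zero {Zm} zero-cell) (≡.sym (dec-false (suc m ℕ.≟ r) (ℕ.<⇒≢ 1+m<r)))
        where
        zero-cell : cell (suc m) (Zm [ e ]≔ zer) ≡ true
        zero-cell = ≡.trans (≡.cong (cell (suc m)) Zm[e]≔zer) (prefix-cell (suc m) 1+m<r)
      ... | tri≈ _ 1+m≡r _ = ≡.trans (both-signs (cell (suc m) (Zm [ e ]≔ neg)) ≡.refl (cell (suc m) (Zm [ e ]≔ pos)) ≡.refl)
                                     (≡.sym (dec-true (suc m ℕ.≟ r) 1+m≡r))
        where
        no-zero : cell (suc m) (Zm [ e ]≔ zer) ≡ false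
        no-zero = ≡.trans (≡.cong (cell (suc m)) Zm[e]≔zer) (no-prefix-cell (suc m) (ℕ.≤-reflexive (≡.sym 1+m≡r)) m<n)
        split : (cell (suc m) (Zm [ e ]≔ neg) ∨ (cell (suc m) (Zm [ e ]≔ zer) ∨ cell (suc m) (Zm [ e ]≔ pos))) ≡ true
        split = cell-splits (prefix-cell m (≡.subst (m ℕ.<_) 1+m≡r ℕ.≤-refl))
        both-signs : ∀ a → cell (suc m) (Zm [ e ]≔ neg) ≡ a → ∀ b → cell (suc m) (Zm [ e ]≔ pos) ≡ b → crossing Zm ≡ true
        both-signs true c₋ true c₊ = crossing-true {Zm} c₋ c₊ no-zero
        both-signs true c₋ false ¬c₊ = ⊥-elim (not-¬ (opposite-cell neg c₋) ¬c₊)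
        both-signs false ¬c₋ true c₊ = ⊥-elim (not-¬ (opposite-cell pos c₊) ¬c₋)
        both-signs false ¬c₋ false ¬c₊ = ⊥-elim (not-¬ split (none ¬c₋ no-zero ¬c₊))
          where
          none : ∀ {a b c} → a ≡ false → b ≡ false → c ≡ false → (a ∨ (b ∨ c)) ≡ false
          none ≡.refl ≡.refl ≡.refl = ≡.refl
      ... | tri> _ _ r<1+m = ≡.trans (crossing-false-neg {Zm} no-neg) (≡.sym (dec-false (suc m ℕ.≟ r) (ℕ.>⇒≢ r<1+m)))
        where
        no-neg : cell (suc m) (Zm [ e ]≔ neg) ≡ false
        no-neg with cell (suc m) (Zm [ e ]≔ neg) in c₋
        ... | false = ≡.refl
        ... | true = ⊥-elim (not-¬ (cell-restricts neg Zm-e c₋) (no-prefix-cell m (ℕ.≤-pred r<1+m) (ℕ.<⇒≤ m<n)))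

    initial-cell : cell 0 positives ≡ does (1 ℕ.≤? r)
    initial-cell with toSum (1 ℕ.≤? r)
    ... | inj₁ 1≤r = ≡.trans (prefix-cell 0 1≤r) (≡.sym (dec-true (1 ℕ.≤? r) 1≤r))
    ... | inj₂ 1≰r = ≡.trans no-cell (≡.sym (dec-false (1 ℕ.≤? r) 1≰r))
      where
      no-cell : cell 0 positives ≡ false
      no-cell with cell 0 positives in c₀
      ... | false = ≡.refl
      ... | true with cell-elim 0 positives c₀
      ...   | _ , witness (i , _) _ _ = ⊥-elim (1≰r (ℕ.≤-trans (s≤s z≤n) (toℕ<n i)))

    N-jumps : ∀ k → k ≤ n → N k ≈ N 0 + jumps r k
    N-jumps zero _ = sym (trans (+-congˡ (jumps-zero r)) (+-identityʳ _))
    N-jumps (suc k) k<n = begin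
      N (suc k)                                                  ≈⟨ Step.N-step k k<n ⟩
      N k + ∑ᵛ (Step.X k k<n)                                     ≈⟨ +-cong (N-jumps k (ℕ.<⇒≤ k<n)) (Step.∑X-at-Zm k k<n) ⟩
      (N 0 + jumps r k) + 𝟙 (Step.crossing k k<n (Step.Zm k k<n)) * pow K (- 1#) k
        ≈⟨ +-congˡ (*-congʳ (reflexive (≡.cong 𝟙 (AtStage.crossing-Zm k k<n)))) ⟩
      (N 0 + jumps r k) + 𝟙 (does (suc k ℕ.≟ r)) * pow K (- 1#) k  ≈⟨ trans (+-assoc _ _ _) (+-congˡ (sym (jumps-step r k))) ⟩
      N 0 + jumps r (suc k)                                      ∎

module Coefficients {c ℓ₁ ℓ₂} (K : OrderedField c ℓ₁ ℓ₂) {r n} (r≤n : r ≤ n) (V : Matrix K r n)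
  (general : GeneralPosition K V) (L L* : List (Vec Sign n))
  (L-covectors : Enumerates (Covector K V) L) (L*-dependencies : Enumerates (Dependency K V) L*) where

  open import Data.Nat.Base as ℕ using (ℕ; zero; suc)
  import Data.Nat.Properties as ℕ
  open import Data.Bool.Base using (true; false; not)
  open import Data.Bool.Properties using (not-¬)
  open import Data.Vec.Base using (lookup)
  open import Data.Vec.Properties using (lookup-replicate)
  open import Data.Product.Base using (∃; _,_; proj₂)
  open import Data.Sum.Base using (inj₁; inj₂)
  open import Data.Empty using (⊥-elim)
  open import Function.Bundles using (Equivalence)
  open import Relation.Nullary.Decidable.Core using (does)
  open import Relation.Nullary.Decidable using (dec-true; dec-false)
  open import Relation.Binary.PropositionalEquality.Core as ≡ using (_≡_)

  open OrderedFieldProperties K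
  open FiniteSums K using (𝟙; Nonzero)
  open BooleanSubsets using (nonempty?)
  open SignVectors
  open SignFunction K
  open SignVectorSums K
  open GeneratingPolynomials K using (χ; CoefficientIdentity; jumps)
  open GeneralPositionProperties K r≤n V general using (⟨_,_⟩)
  open SignPatterns K r≤n V general

  ∈L*⇒dependency : ∀ G → (G ∈ᵇ L*) ≡ true → ∃ (ExactDependency (lookup G))
  ∈L*⇒dependency G h with Equivalence.to (proj₂ L*-dependencies G) (∈ᵇ-elim h)
  ... | μ , _ , dep , ≡.refl = μ , dep , (λ j gj → signValue-sgn′ (≡.sym (lookup-signVec μ j)) gj) ,
                                      (λ j gj → sgn≡zer⇒≈0 (μ j) (≡.trans (≡.sym (lookup-signVec μ j)) (isNonzero≡false gj)))

  dependency⇒∈L* : ∀ G → (∃ λ j → isNonzero (lookup G j) ≡ true) → ∃ (ExactDependency (lookup G)) → (G ∈ᵇ L*) ≡ true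
  dependency⇒∈L* G (j , Gj) (μ , dep , μ-signs , μ-off) = ∈ᵇ-intro (Equivalence.from (proj₂ L*-dependencies G)
    (μ , (j , λ μj≈0 → pos⇒≉0 (μ-signs j Gj) (trans (*-congˡ μj≈0) (zeroʳ _))) , dep ,
     signVec-≡ μ G (λ j → sgn-characterisation (μ j) (lookup G j) (μ-signs j) (μ-off j))))

  module _ (G : Vec Sign n) where
    open Sweep K r≤n V general L L-covectors G

    realisable⇒initial-cell : (∃ λ j → isNonzero (lookup G j) ≡ true) → ∀ {u} → Realises (lookup G) u → cell 0 positives ≡ true
    realisable⇒initial-cell (j₀ , Gj₀) {u} realises = cell-intro 0 positives (witness u≉0 conforms (λ j → lookup-replicate j pos))
      where
      u≉0 : Nonzero u
      u≉0 = FiniteSums.∑≉0⇒nonzero K (λ l → V l j₀) u (λ u≈0 → pos⇒≉0 (realises j₀ Gj₀) (trans (*-congˡ u≈0) (zeroʳ _)))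
      conforms : ∀ j → (lookup G j ⊑ˢ sgn K ⟨ j , u ⟩) ≡ true
      conforms j with isNonzero (lookup G j) in Gj
      ... | true rewrite sgn-by-signValue (lookup G j) Gj (realises j Gj) = ⊑ˢ-refl (lookup G j)
      ... | false rewrite isNonzero≡false Gj = ≡.refl

    initial-cell⇒realisable : cell 0 positives ≡ true → ∃ (Realises (lookup G))
    initial-cell⇒realisable h with cell-elim 0 positives h
    ... | u , witness _ conforms _ = u , λ j Gj → signValue-sgn′ (⊑ˢ-nonzero Gj (conforms j)) Gj

    ∈L*≡¬initial-cell : (∃ λ j → isNonzero (lookup G j) ≡ true) → (G ∈ᵇ L*) ≡ not (cell 0 positives)
    ∈L*≡¬initial-cell G≢0 with realisable-or-dependent (lookup G)
    ... | inj₁ (u , realises) rewrite realisable⇒initial-cell G≢0 realises with G ∈ᵇ L* in G∈L*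
    ...   | false = ≡.refl
    ...   | true = ⊥-elim (¬realisable-and-dependent (lookup G) G≢0 realises (proj₂ (∈L*⇒dependency G G∈L*)))
    ∈L*≡¬initial-cell G≢0 | inj₂ dependent rewrite dependency⇒∈L* G G≢0 dependent with cell 0 positives in c₀
    ...   | false = ≡.refl
    ...   | true = ⊥-elim (¬realisable-and-dependent (lookup G) G≢0 (proj₂ (initial-cell⇒realisable c₀)) (proj₂ dependent))

    coefficient-nonzero : (∃ λ j → isNonzero (lookup G j) ≡ true) →
                          𝟙 (G ∈ᵇ L*) ≈ (1# - pow K (- 1#) r * 𝟙 (G ≡ᵇ zeros)) - χ L G
    coefficient-nonzero G≢0@(j , Gj) = begin
      𝟙 (G ∈ᵇ L*)                                    ≡⟨ ≡.cong 𝟙 (∈L*≡¬initial-cell G≢0) ⟩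
      𝟙 (not (cell 0 positives))                     ≈⟨ complement (cell 0 positives) ⟩
      (1# - pow K (- 1#) r * 0#) - 𝟙 (cell 0 positives) ≈⟨ +-cong (+-congˡ (-‿cong (*-congˡ (reflexive (≡.cong 𝟙 (≡.sym G≢zeros)))))) (-‿cong (sym χ≈)) ⟩
      (1# - pow K (- 1#) r * 𝟙 (G ≡ᵇ zeros)) - χ L G ∎
      where
      G≢zeros : (G ≡ᵇ zeros) ≡ false
      G≢zeros = dec-false (G ≟ᵛ zeros) λ G≡0 → not-¬ Gj (≡.cong isNonzero (≡.trans (≡.cong (λ X → lookup X j) G≡0) (lookup-replicate j zer)))
      χ≈ : χ L G ≈ 𝟙 (cell 0 positives)
      χ≈ = trans (sym N-final) (trans (N-constant G≢0 n ℕ.≤-refl) N-initial)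
      complement : ∀ b → 𝟙 (not b) ≈ (1# - pow K (- 1#) r * 0#) - 𝟙 b
      complement true = solve 1 (λ p → :0 := (:1 :- p :* :0) :- :1) refl (pow K (- 1#) r)
      complement false = solve 1 (λ p → :1 := (:1 :- p :* :0) :- :0) refl (pow K (- 1#) r)

    coefficient-zero : (∀ j → lookup G j ≡ zer) → 𝟙 (G ∈ᵇ L*) ≈ (1# - pow K (- 1#) r * 𝟙 (G ≡ᵇ zeros)) - χ L G
    coefficient-zero G≡0 = begin
      𝟙 (G ∈ᵇ L*)                                           ≡⟨ ≡.cong 𝟙 G∉L* ⟩
      0#                                                    ≈⟨ sphere r r≤n ⟩
      (1# - pow K (- 1#) r * 1#) - (𝟙 (does (1 ℕ.≤? r)) + jumps r n)
        ≈⟨ +-cong (+-congˡ (-‿cong (*-congˡ (reflexive (≡.cong 𝟙 (≡.sym G≡zeros))))))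
                  (-‿cong (sym (trans (sym N-final) (trans (N-jumps n ℕ.≤-refl) (+-congʳ (trans N-initial (reflexive (≡.cong 𝟙 initial-cell)))))))) ⟩
      (1# - pow K (- 1#) r * 𝟙 (G ≡ᵇ zeros)) - χ L G        ∎
      where
      open ZeroPattern G≡0
      G≡zeros′ : G ≡ zeros
      G≡zeros′ = lookup-extensional _ _ λ j → ≡.trans (G≡0 j) (≡.sym (lookup-replicate j zer))
      G≡zeros : (G ≡ᵇ zeros) ≡ true
      G≡zeros = dec-true (G ≟ᵛ zeros) G≡zeros′
      G∉L* : (G ∈ᵇ L*) ≡ false
      G∉L* with G ∈ᵇ L* in G∈L*
      ... | false = ≡.refl
      ... | true with Equivalence.to (proj₂ L*-dependencies G) (∈ᵇ-elim G∈L*)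
      ...   | μ , (i , μi≉0) , _ , sgn≡ = ⊥-elim (μi≉0 (sgn≡zer⇒≈0 (μ i) (≡.trans (≡.sym (lookup-signVec μ i)) (≡.trans (≡.cong (λ X → lookup X i) sgn≡) (G≡0 i)))))
      -- The cells of the sphere S^{r-1} have Euler characteristic 1 - (-1)^r.
      sphere : ∀ q → q ℕ.≤ n → 0# ≈ (1# - pow K (- 1#) q * 1#) - (𝟙 (does (1 ℕ.≤? q)) + jumps q n)
      sphere zero _ = solve 0 (:0 := (:1 :- :1 :* :1) :- (:0 :+ :0 :* :1)) refl
      sphere (suc q) q<n rewrite dec-true (suc q ℕ.≤? n) q<n =
        solve 1 (λ p → :0 := (:1 :- (:-1 :* p) :* :1) :- (:1 :+ :1 :* p)) refl (pow K (- 1#) q)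

  coefficient-identity : CoefficientIdentity L L* r
  coefficient-identity G with nonempty? (λ j → isNonzero (lookup G j))
  ... | inj₁ G≢0 = coefficient-nonzero G G≢0
  ... | inj₂ G≡0 = coefficient-zero G (λ j → isNonzero≡false (G≡0 j))

theorem2p8 : ∀ {c ℓ₁ ℓ₂} (K : OrderedField c ℓ₁ ℓ₂) {r n : ℕ} → r ≤ n →
    (V : Matrix K r n) → GeneralPosition K V →
    (L L* : List (Vec Sign n)) →
    Enumerates (Covector K V) L → Enumerates (Dependency K V) L* →
    let open OrderedField K in
    ∀ (x y w : Carrier) → ((x + 1#) * w) ≈ 1# →
      (genPoly K L* x y ≈
        ((pow K ((x + y) + 1#) n - (pow K (- 1#) r * pow K x n))
          - (pow K (x + 1#) n * genPoly K L (- (x * w)) ((x + y) * w))))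
      ×
      (genPoly K L x y ≈
        ((pow K ((x + y) + 1#) n - (pow K (- 1#) (n ∸ r) * pow K x n))
          - (pow K (x + 1#) n * genPoly K L* (- (x * w)) ((x + y) * w))))
theorem2p8 K {r} r≤n V general L L* L-covectors L*-dependencies x y w hw =
  dual-identity L L* (proj₁ L-covectors) (proj₁ L*-dependencies) r coefficients x y w hw ,
  primal-identity L L* (proj₁ L-covectors) (proj₁ L*-dependencies) r≤n coefficients x y w hw
  where
  open GeneratingPolynomials K using (CoefficientIdentity; dual-identity; primal-identity)
  coefficients : CoefficientIdentity L L* r
  coefficients = Coefficients.coefficient-identity K r≤n V general L L* L-covectors L*-dependencies
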